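{- Let $F$ be a figure, let $eq$ be an equilibrium function of $F$, and let $T$ be a domino tiling of $F$. Then for every cycle $C$ of $G_F$ one has $g_T(C)=0$.
   Context: Let $\Lambda$ be the square grid of $\mathbb{R}^2$: vertices are points of $\mathbb{Z}^2$, edges are closed unit segments joining vertices at distance $1$, cells are closed unit squares whose corners are vertices; cells are coloured black and white as a checkerboard (cells sharing an edge have different colours). A figure $F$ is a finite union of cells of $\Lambda$ which is 4-connected (any two of its cells are joined by a sequence of cells of $F$, consecutive ones sharing an edge). The unbounded 8-connected component of $\mathbb{R}^2\setminus F$ is $H_\infty$; the other components are the holes of $F$. Every vertex $v$ of $F$ all of whose incident edges lie on the boundary of $F$ (two cells of $F$ meeting only at the corner $v$) is replaced by two distinct copies, each adjacent to the two neighbours of $v$ lying on one of these two cells. $G_F=(V_F,E_F)$ is the directed graph whose vertices are the corners of cells of $F$ (after these duplications) and whose arcs are both orientations $(v,v')$, $(v',v)$ of every side of every cell of $F$. $E_b(F)$ is the set of arcs whose edge lies on the boundary of $F$. A path is a sequence $(v_0,\dots,v_k)$ with each $(v_i,v_{i+1})\in E_F$; it is a cycle if $v_k=v_0$, and elementary if no vertex repeats except $v_0=v_k$. For $g:E_F\to\mathbb{Z}$ and a path $P$, $g(P)$ is the sum of $g$ over the arcs of $P$ counted with multiplicity. The spin $sp(v,v')$ is $1$ if an observer moving from $v$ to $v'$ has a white cell on its left (and a black cell on its right), and $-1$ otherwise. For an elementary clockwise cycle $C$, $Dis_F(C)$ is the number of black cells of $F$ enclosed by $C$ minus the number of white cells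 of $F$ enclosed by $C$. An equilibrium function is a skew-symmetric $eq:E_F\to\mathbb{Z}$ (i.e. $eq(v',v)=-eq(v,v')$) such that $sp(C)+eq(C)=4\,Dis_F(C)$ for every elementary clockwise cycle $C$ of $G_F$. A domino is the union of two cells sharing an edge, called its central axis; a tiling of $F$ is a set of dominoes contained in $F$ with pairwise disjoint interiors whose union is $F$. For a tiling $T$, $\chi_T(a)=1$ if the edge of the arc $a$ is the central axis of a domino of $T$ and $\chi_T(a)=0$ otherwise, and $g_T(a)=eq(a)-sp(a)+2\,sp(a)(1-2\chi_T(a))$ for $a\in E_F$. -}

module Defs where

open import Data.Bool using (Bool; true; false; _∧_; _∨_; not; if_then_else_)
open import Data.Nat as ℕ using (ℕ; _%_; _≡ᵇ_)
open import Data.Integer as ℤ using (ℤ; +_; -_; _-_; _*_; _<_; 0ℤ; 1ℤ; ∣_∣)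
import Data.Integer.Properties as ℤP
open import Data.Product using (Σ; Σ-syntax; ∃; ∃-syntax; _×_; _,_; proj₁; proj₂)
open import Data.Product.Properties using (≡-dec)
open import Data.Sum using (_⊎_)
open import Data.List using (List; []; _∷_; _++_)
open import Data.Bool.ListAction using (any)
open import Data.List.Membership.Propositional using (_∈_)
open import Data.List.Relation.Unary.Unique.Propositional using (Unique)
open import Relation.Binary.PropositionalEquality using (_≡_; _≢_)
open import Relation.Nullary.Decidable using (⌊_⌋; Dec)
open import Data.Empty using (⊥)
import Data.List.Membership.DecPropositional as DecMem

-- Grid geometry.
-- A point of ℤ² is a vertex of the grid.  A cell is named by its
-- lower-left corner (a , b): it is the closed square [a,a+1]×[b,b+1].

Point : Set
Point = ℤ × ℤ

Cell : Set
Cell = ℤ × ℤ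

_≟P_ : (p q : Point) → Dec (p ≡ q)
_≟P_ = ≡-dec ℤ._≟_ ℤ._≟_

open DecMem _≟P_ using (_∈?_)

_∈ᵇ_ : Cell → List Cell → Bool
c ∈ᵇ F = ⌊ c ∈? F ⌋

infix 4 _==_ _==P_

_==_ : ℤ → ℤ → Bool
x == y = ⌊ x ℤ.≟ y ⌋

_==P_ : Point → Point → Bool
p ==P q = ⌊ p ≟P q ⌋

-- Checkerboard colouring (convention): cell (a , b) is white iff a + b
-- is even, black otherwise.  Edge-adjacent cells get different colours.
isWhite : Cell → Bool
isWhite (a , b) = ∣ a ℤ.+ b ∣ % 2 ≡ᵇ 0

colourSign : Cell → ℤ
colourSign c = if isWhite c then - 1ℤ else 1ℤ

corners : Cell → List Point
corners (a , b) = (a , b) ∷ (a ℤ.+ 1ℤ , b) ∷ (a ℤ.+ 1ℤ , b ℤ.+ 1ℤ) ∷ (a , b ℤ.+ 1ℤ) ∷ []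

sides : Cell → List (Point × Point)
sides (a , b) =
  (p0 , p1) ∷ (p1 , p0) ∷ (p1 , p2) ∷ (p2 , p1) ∷
  (p2 , p3) ∷ (p3 , p2) ∷ (p3 , p0) ∷ (p0 , p3) ∷ []
  where
  p0 = (a , b)
  p1 = (a ℤ.+ 1ℤ , b)
  p2 = (a ℤ.+ 1ℤ , b ℤ.+ 1ℤ)
  p3 = (a , b ℤ.+ 1ℤ)

Adj : Cell → Cell → Set
Adj (a , b) (a' , b') =
  ((a' ≡ a ℤ.+ 1ℤ) × (b' ≡ b)) ⊎ ((a ≡ a' ℤ.+ 1ℤ) × (b' ≡ b)) ⊎
  ((b' ≡ b ℤ.+ 1ℤ) × (a' ≡ a)) ⊎ ((b ≡ b' ℤ.+ 1ℤ) × (a' ≡ a))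

data CellPath (F : List Cell) : Cell → Cell → Set where
  here : ∀ {c} → c ∈ F → CellPath F c c
  step : ∀ {c c' d} → c ∈ F → Adj c c' → CellPath F c' d → CellPath F c d

record Figure : Set where
  field
    cells     : List Cell
    unique    : Unique cells
    nonempty  : cells ≢ []
    connected : ∀ {c d} → c ∈ cells → d ∈ cells → CellPath cells c d
open Figure public

-- A vertex of G_F is a grid point together with a tag.  A point p of F
-- is a "pinch" point if exactly two diagonally opposite cells of F
-- contain p (all four edges at p lie on the boundary of F).  Such a p
-- is split into two copies: the copy with tag true belongs to the cell
-- of F lying east of p, the copy with tag false to the cell lying west
-- of p.  Every other point has the single copy with tag false.

Vtx : Set
Vtx = Point × Bool

isPinch : Figure → Point → Bool
isPinch F (x , y) =
  (ne ∧ sw ∧ not nw ∧ not se) ∨ (nw ∧ se ∧ not ne ∧ not sw)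
  where
  ne = (x , y) ∈ᵇ cells F
  nw = (x - 1ℤ , y) ∈ᵇ cells F
  sw = (x - 1ℤ , y - 1ℤ) ∈ᵇ cells F
  se = (x , y - 1ℤ) ∈ᵇ cells F

tag : Figure → Point → Cell → Bool
tag F p c = isPinch F p ∧ (proj₁ c == proj₁ p)

IsVertex : Figure → Vtx → Set
IsVertex F (p , t) = Σ[ c ∈ Cell ] (c ∈ cells F × p ∈ corners c × t ≡ tag F p c)

Arc : Figure → Vtx → Vtx → Set
Arc F (p , t) (q , u) =
  Σ[ c ∈ Cell ] (c ∈ cells F × (p , q) ∈ sides c × t ≡ tag F p c × u ≡ tag F q c)

IsPath : Figure → List Vtx → Set
IsPath F []           = ⊥
IsPath F (v ∷ [])     = IsVertex F v
IsPath F (v ∷ w ∷ vs) = Arc F v w × IsPath F (w ∷ vs)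

lastOr : Vtx → List Vtx → Vtx
lastOr v []       = v
lastOr v (w ∷ ws) = lastOr w ws

dropLast : List Vtx → List Vtx
dropLast []           = []
dropLast (v ∷ [])     = []
dropLast (v ∷ w ∷ ws) = v ∷ dropLast (w ∷ ws)

IsCycle : Figure → List Vtx → Set
IsCycle F []       = ⊥
IsCycle F (v ∷ vs) = IsPath F (v ∷ vs) × lastOr v vs ≡ v

IsElementaryCycle : Figure → List Vtx → Set
IsElementaryCycle F C = IsCycle F C × Unique (dropLast C)

pathSum : (Vtx → Vtx → ℤ) → List Vtx → ℤ
pathSum g []           = 0ℤ
pathSum g (v ∷ [])     = 0ℤ
pathSum g (v ∷ w ∷ vs) = g v w ℤ.+ pathSum g (w ∷ vs)

-- Spin: sp(v,v') = 1 if the cell on the left of an observer moving from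
-- v to v' is white, -1 otherwise.  (Only meaningful on arcs, i.e. unit
-- steps; 0 on other pairs.)

leftCell? : Point → Point → Bool × Cell
leftCell? (x , y) (x' , y') =
  if (x' == x ℤ.+ 1ℤ) ∧ (y' == y) then (true , (x , y))
  else if (x == x' ℤ.+ 1ℤ) ∧ (y' == y) then (true , (x - 1ℤ , y - 1ℤ))
  else if (y' == y ℤ.+ 1ℤ) ∧ (x' == x) then (true , (x - 1ℤ , y))
  else if (y == y' ℤ.+ 1ℤ) ∧ (x' == x) then (true , (x , y - 1ℤ))
  else (false , (x , y))

sp : Vtx → Vtx → ℤ
sp (p , _) (q , _) with leftCell? p q
... | (true , c)  = if isWhite c then 1ℤ else - 1ℤ
... | (false , _) = 0ℤ

-- Winding number of a closed lattice path around the centre of a cell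
-- (a , b), computed by counting signed crossings of the upward vertical
-- ray from (a+½ , b+½).  It is +1 inside a simple counterclockwise
-- cycle and -1 inside a simple clockwise cycle.

windStep : Cell → Vtx → Vtx → ℤ
windStep (a , b) ((x , y) , _) ((x' , y') , _) =
  if (y == y') ∧ ⌊ b ℤ.<? y ⌋ then
    (if (x == a ℤ.+ 1ℤ) ∧ (x' == a) then 1ℤ
     else if (x == a) ∧ (x' == a ℤ.+ 1ℤ) then - 1ℤ
     else 0ℤ)
  else 0ℤ

winding : List Vtx → Cell → ℤ
winding C c = pathSum (windStep c) C

-- twice the signed area (shoelace); negative iff the cycle is clockwise
shoelaceStep : Vtx → Vtx → ℤ
shoelaceStep ((x , y) , _) ((x' , y') , _) = x * y' - x' * y

IsClockwise : List Vtx → Set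
IsClockwise C = pathSum shoelaceStep C < 0ℤ

-- Dis_F(C): (#black cells of F enclosed by C) − (#white cells enclosed);
-- a cell is enclosed iff C winds around it (nonzero winding number).
sumCells : (Cell → ℤ) → List Cell → ℤ
sumCells f []       = 0ℤ
sumCells f (c ∷ cs) = f c ℤ.+ sumCells f cs

Dis : Figure → List Vtx → ℤ
Dis F C = sumCells (λ c → if winding C c == 0ℤ then 0ℤ else colourSign c) (cells F)

-- Equilibrium functions (given on all pairs; only arcs matter).

record IsEquilibrium (F : Figure) (eqf : Vtx → Vtx → ℤ) : Set where
  field
    skew    : ∀ v w → Arc F v w → eqf w v ≡ - eqf v w
    balance : ∀ C → IsElementaryCycle F C → IsClockwise C →
              pathSum sp C ℤ.+ pathSum eqf C ≡ ℤ.+ 4 * Dis F C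

data Orientation : Set where
  horizontal vertical : Orientation

-- a domino: its lower-left cell and orientation
Domino : Set
Domino = Cell × Orientation

domCells : Domino → List Cell
domCells ((a , b) , horizontal) = (a , b) ∷ (a ℤ.+ 1ℤ , b) ∷ []
domCells ((a , b) , vertical)   = (a , b) ∷ (a , b ℤ.+ 1ℤ) ∷ []

axis : Domino → Point × Point
axis ((a , b) , horizontal) = (a ℤ.+ 1ℤ , b) , (a ℤ.+ 1ℤ , b ℤ.+ 1ℤ)
axis ((a , b) , vertical)   = (a , b ℤ.+ 1ℤ) , (a ℤ.+ 1ℤ , b ℤ.+ 1ℤ)

record IsTiling (F : Figure) (T : List Domino) : Set where
  field
    inside   : ∀ {d c} → d ∈ T → c ∈ domCells d → c ∈ cells F
    disjoint : ∀ {d d' c} → d ∈ T → d' ∈ T → c ∈ domCells d → c ∈ domCells d' → d ≡ d'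
    covers   : ∀ {c} → c ∈ cells F → Σ[ d ∈ Domino ] (d ∈ T × c ∈ domCells d)

isAxis : Point → Point → Domino → Bool
isAxis p q d with axis d
... | (r , s) = ((p ==P r) ∧ (q ==P s)) ∨ ((p ==P s) ∧ (q ==P r))

χ : List Domino → Vtx → Vtx → ℤ
χ T (p , _) (q , _) = if any (isAxis p q) T then 1ℤ else 0ℤ

gT : List Domino → (Vtx → Vtx → ℤ) → Vtx → Vtx → ℤ
gT T eqf v w = eqf v w - sp v w ℤ.+ ℤ.+ 2 * sp v w * (1ℤ - ℤ.+ 2 * χ T v w)

-- Write g_T = eq + sp − 4·sp·χ_T on arcs.  For a closed lattice path C with winding
-- numbers w_C, the sum Σ_c colour(c)·w_C(c) over the cells of F plus Σ_C sp·χ_T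
-- vanishes: each domino contributes 0, since the winding numbers of its two cells, which
-- have opposite colours, differ by the signed number of traversals of its central axis,
-- and those traversals are what sp·χ_T counts, with the colour as sign.  For an
-- elementary clockwise cycle of G_F the winding number is −1 inside and 0 outside (a
-- discrete Jordan curve theorem), so Σ_C sp·χ_T = Dis_F(C) and the equilibrium condition
-- gives g_T(C) = 0.  Skew-symmetry handles counterclockwise cycles, and any other cycle
-- splits at a repeated vertex into shorter ones.

module Submission where

open import Defs
open import Data.Bool using (Bool; true; false; _∧_; _∨_; not; if_then_else_)
open import Data.Bool.ListAction using (any)
open import Data.Bool.Properties using (not-involutive; ∨-identityʳ; ∨-zeroʳ; ∧-zeroʳ; ∧-identityʳ; ∧-comm; ∨-comm)
import Data.Bool.Properties as Boolᴾ
open import Data.Empty using (⊥; ⊥-elim)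
open import Data.Integer as ℤ using (ℤ; +_; -[1+_]; -_; _-_; _*_; 0ℤ; 1ℤ; ∣_∣)
import Data.Integer.Properties as ℤP
open import Data.Integer.Tactic.RingSolver using (solve-∀)
open import Data.List using (List; []; _∷_; _++_; map; drop; length; concatMap; deduplicate)
open import Data.List.Membership.Propositional using (_∈_; _∉_)
open import Data.List.Membership.Propositional.Properties using (∈-++⁺ˡ; ∈-++⁺ʳ; ∈-++⁻; ∈-∃++; ∈-deduplicate⁺; ∈-deduplicate⁻)
import Data.List.Membership.DecPropositional as DecMem
open import Data.List.Properties using (++-assoc; length-++)
open import Data.List.Relation.Unary.All using (All; []; _∷_)
import Data.List.Relation.Unary.All as All
open import Data.List.Relation.Unary.AllPairs using ([]; _∷_)
open import Data.List.Relation.Unary.Any using (here; there)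
open import Data.List.Relation.Unary.Unique.Propositional using (Unique)
import Data.List.Relation.Unary.Unique.Propositional.Properties as UP
import Data.List.Relation.Unary.Unique.DecPropositional.Properties as UDP
open import Data.Nat as ℕ using (ℕ; zero; suc; _%_; _≡ᵇ_; z≤n; s≤s)
import Data.Nat.DivMod as ℕD
import Data.Nat.Properties as ℕP
open import Data.Product using (Σ; _×_; _,_; proj₁; proj₂)
open import Data.Product.Properties using (≡-dec)
open import Data.Sum using (_⊎_; inj₁; inj₂)
open import Data.Unit using (⊤; tt)
open import Function using (flip)
open import Relation.Binary using (DecidableEquality)
open import Relation.Binary.Definitions using (tri<; tri≈; tri>)
open import Relation.Binary.PropositionalEquality
open import Relation.Nullary using (Dec; yes; no; ¬_)
open import Relation.Nullary.Decidable using (⌊_⌋)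

==-true : ∀ {x y} → x ≡ y → (x == y) ≡ true
==-true e = cong ⌊_⌋ (≡-≟-identity ℤ._≟_ e)

==-false : ∀ {x y} → x ≢ y → (x == y) ≡ false
==-false ne = cong ⌊_⌋ (≢-≟-identity ℤ._≟_ ne)

==-refl : ∀ x → (x == x) ≡ true
==-refl x = ==-true refl

==P-true : ∀ {p q} → p ≡ q → (p ==P q) ≡ true
==P-true e = cong ⌊_⌋ (≡-≟-identity _≟P_ e)

==P-false : ∀ {p q} → p ≢ q → (p ==P q) ≡ false
==P-false ne = cong ⌊_⌋ (≢-≟-identity _≟P_ ne)

==P-refl : ∀ p → (p ==P p) ≡ true
==P-refl p = ==P-true refl

==P-sound : ∀ {p q} → (p ==P q) ≡ true → p ≡ q
==P-sound {p} {q} h with p ≟P q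
... | yes e = e
==P-sound () | no _

i+1-1≡i : ∀ x → x ℤ.+ 1ℤ - 1ℤ ≡ x
i+1-1≡i = solve-∀

i-1+1≡i : ∀ x → x - 1ℤ ℤ.+ 1ℤ ≡ x
i-1+1≡i = solve-∀

i≢i+k : ∀ x k → k ≢ 0ℤ → x ≢ x ℤ.+ k
i≢i+k x k k≢0 e = k≢0 (trans (sym (lem x k)) (trans (cong (λ z → z - x) (sym e)) (lem2 x)))
  where
  lem : ∀ x k → x ℤ.+ k - x ≡ k
  lem = solve-∀
  lem2 : ∀ x → x - x ≡ 0ℤ
  lem2 = solve-∀

i≢i+1 : ∀ x → x ≢ x ℤ.+ 1ℤ
i≢i+1 x = i≢i+k x 1ℤ (λ ())

i≢i-1 : ∀ x → x ≢ x - 1ℤ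
i≢i-1 x = i≢i+k x (- 1ℤ) (λ ())

i-1≢i+1 : ∀ x → x - 1ℤ ≢ x ℤ.+ 1ℤ
i-1≢i+1 x e = i≢i+k (x - 1ℤ) (ℤ.+ 2) (λ ()) (trans e (lem x))
  where
  lem : ∀ x → x ℤ.+ 1ℤ ≡ x - 1ℤ ℤ.+ ℤ.+ 2
  lem = solve-∀

even : ℕ → Bool
even zero = true
even (suc n) = not (even n)

n%2≡ᵇ0≡even : ∀ n → (n % 2 ≡ᵇ 0) ≡ even n
n%2≡ᵇ0≡even zero = refl
n%2≡ᵇ0≡even (suc zero) = refl
n%2≡ᵇ0≡even (suc (suc n)) = begin
    (suc (suc n) % 2 ≡ᵇ 0)
  ≡⟨ cong (λ m → m % 2 ≡ᵇ 0) (ℕP.+-comm 2 n) ⟩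
    ((n ℕ.+ 2) % 2 ≡ᵇ 0)
  ≡⟨ cong (_≡ᵇ 0) (ℕD.[m+n]%n≡m%n n 2) ⟩
    (n % 2 ≡ᵇ 0)
  ≡⟨ n%2≡ᵇ0≡even n ⟩
    even n
  ≡⟨ sym (not-involutive (even n)) ⟩
    not (not (even n))
  ∎
  where open ≡-Reasoning

evenℤ : ℤ → Bool
evenℤ z = ∣ z ∣ % 2 ≡ᵇ 0

evenℤ≡even∣∣ : ∀ z → evenℤ z ≡ even ∣ z ∣
evenℤ≡even∣∣ z = n%2≡ᵇ0≡even ∣ z ∣

∣-[1+n]+1∣≡n : ∀ n → ∣ -[1+ n ] ℤ.+ 1ℤ ∣ ≡ n
∣-[1+n]+1∣≡n zero = refl
∣-[1+n]+1∣≡n (suc n) = refl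

evenℤ-+1 : ∀ z → evenℤ (z ℤ.+ 1ℤ) ≡ not (evenℤ z)
evenℤ-+1 (+ n) = begin
    evenℤ (+ n ℤ.+ 1ℤ)
  ≡⟨ evenℤ≡even∣∣ (+ n ℤ.+ 1ℤ) ⟩
    even ∣ + n ℤ.+ 1ℤ ∣
  ≡⟨ cong even (ℕP.+-comm n 1) ⟩
    not (even n)
  ≡⟨ cong not (sym (evenℤ≡even∣∣ (+ n))) ⟩
    not (evenℤ (+ n))
  ∎
  where open ≡-Reasoning
evenℤ-+1 -[1+ n ] = begin
    evenℤ (-[1+ n ] ℤ.+ 1ℤ)
  ≡⟨ evenℤ≡even∣∣ (-[1+ n ] ℤ.+ 1ℤ) ⟩
    even ∣ -[1+ n ] ℤ.+ 1ℤ ∣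
  ≡⟨ cong even (∣-[1+n]+1∣≡n n) ⟩
    even n
  ≡⟨ sym (not-involutive (even n)) ⟩
    not (even (suc n))
  ≡⟨ cong not (sym (evenℤ≡even∣∣ -[1+ n ])) ⟩
    not (evenℤ -[1+ n ])
  ∎
  where open ≡-Reasoning

evenℤ--1 : ∀ z → evenℤ (z - 1ℤ) ≡ not (evenℤ z)
evenℤ--1 z = begin
    evenℤ (z - 1ℤ)
  ≡⟨ sym (not-involutive _) ⟩
    not (not (evenℤ (z - 1ℤ)))
  ≡⟨ cong not (sym (evenℤ-+1 (z - 1ℤ))) ⟩
    not (evenℤ (z - 1ℤ ℤ.+ 1ℤ))
  ≡⟨ cong (λ w → not (evenℤ w)) (i-1+1≡i z) ⟩
    not (evenℤ z)
  ∎
  where open ≡-Reasoning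

isWhite-east : ∀ a b → isWhite (a ℤ.+ 1ℤ , b) ≡ not (isWhite (a , b))
isWhite-east a b = trans (cong evenℤ (lem a b)) (evenℤ-+1 (a ℤ.+ b))
  where
  lem : ∀ a b → a ℤ.+ 1ℤ ℤ.+ b ≡ a ℤ.+ b ℤ.+ 1ℤ
  lem = solve-∀

isWhite-north : ∀ a b → isWhite (a , b ℤ.+ 1ℤ) ≡ not (isWhite (a , b))
isWhite-north a b = trans (cong evenℤ (lem a b)) (evenℤ-+1 (a ℤ.+ b))
  where
  lem : ∀ a b → a ℤ.+ (b ℤ.+ 1ℤ) ≡ a ℤ.+ b ℤ.+ 1ℤ
  lem = solve-∀

isWhite-west : ∀ a b → isWhite (a - 1ℤ , b) ≡ not (isWhite (a , b))
isWhite-west a b = trans (cong evenℤ (lem a b)) (evenℤ--1 (a ℤ.+ b))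
  where
  lem : ∀ a b → a - 1ℤ ℤ.+ b ≡ a ℤ.+ b - 1ℤ
  lem = solve-∀

isWhite-south : ∀ a b → isWhite (a , b - 1ℤ) ≡ not (isWhite (a , b))
isWhite-south a b = trans (cong evenℤ (lem a b)) (evenℤ--1 (a ℤ.+ b))
  where
  lem : ∀ a b → a ℤ.+ (b - 1ℤ) ≡ a ℤ.+ b - 1ℤ
  lem = solve-∀

isLess : ℤ → ℤ → Bool
isLess b y = ⌊ b ℤ.<? y ⌋

isLess-true : ∀ {b y} → b ℤ.< y → isLess b y ≡ true
isLess-true {b} {y} p with b ℤ.<? y
... | yes _ = refl
... | no q = ⊥-elim (q p)

isLess-false : ∀ {b y} → ¬ (b ℤ.< y) → isLess b y ≡ false
isLess-false {b} {y} p with b ℤ.<? y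
... | yes q = ⊥-elim (p q)
... | no _ = refl

i<i+1 : ∀ y → y ℤ.< y ℤ.+ 1ℤ
i<i+1 y = ℤP.suc[i]≤j⇒i<j (ℤP.≤-reflexive (ℤP.+-comm 1ℤ y))

isLess-+k : ∀ k b y → isLess (b ℤ.+ k) (y ℤ.+ k) ≡ isLess b y
isLess-+k k b y with b ℤ.<? y
... | yes p = isLess-true (ℤP.+-monoˡ-< k p)
... | no p = isLess-false (λ q → p (subst₂ ℤ._<_ (lem b k) (lem y k) (ℤP.+-monoˡ-< (- k) q)))
  where
  lem : ∀ b k → b ℤ.+ k ℤ.+ - k ≡ b
  lem = solve-∀

isLess-+1ʳ : ∀ b y → isLess b (y ℤ.+ 1ℤ) ≡ (isLess b y ∨ (y == b))
isLess-+1ʳ b y with ℤP.<-cmp b y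
... | tri< p _ _ rewrite isLess-true p | isLess-true (ℤP.<-trans p (i<i+1 y)) = refl
... | tri≈ _ refl _ rewrite ==-refl b | isLess-true (i<i+1 b) | isLess-false (ℤP.<-irrefl {b} refl) = refl
... | tri> np ne p rewrite isLess-false np | ==-false (λ e → ne (sym e)) =
  isLess-false (λ q → ℤP.<-irrefl refl (ℤP.<-≤-trans q (subst (ℤ._≤ b) (ℤP.+-comm 1ℤ y) (ℤP.i<j⇒suc[i]≤j p))))

isLess-irrefl : ∀ b → isLess b b ≡ false
isLess-irrefl b = isLess-false (ℤP.<-irrefl refl)

isLess-i-i+1 : ∀ b → isLess b (b ℤ.+ 1ℤ) ≡ true
isLess-i-i+1 b = isLess-true (i<i+1 b)

isLess-+1ʳ-≢ : ∀ {b y} → y ≢ b → isLess b (y ℤ.+ 1ℤ) ≡ isLess b y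
isLess-+1ʳ-≢ {b} {y} ne rewrite isLess-+1ʳ b y | ==-false ne = ∨-identityʳ (isLess b y)

isLess--1ʳ-≢ : ∀ {b y} → y ≢ b ℤ.+ 1ℤ → isLess b (y - 1ℤ) ≡ isLess b y
isLess--1ʳ-≢ {b} {y} ne = sym (trans (cong (isLess b) (sym (i-1+1≡i y))) (isLess-+1ʳ-≢ (λ e → ne (trans (sym (i-1+1≡i y)) (cong (ℤ._+ 1ℤ) e)))))

isLess-+1ˡ-≢ : ∀ {b y} → y ≢ b ℤ.+ 1ℤ → isLess (b ℤ.+ 1ℤ) y ≡ isLess b y
isLess-+1ˡ-≢ {b} {y} ne = trans (trans (cong (isLess (b ℤ.+ 1ℤ)) (sym (i-1+1≡i y))) (isLess-+k 1ℤ b (y - 1ℤ))) (isLess--1ʳ-≢ ne)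

==-+1-cancel : ∀ x a → (x ℤ.+ 1ℤ == a ℤ.+ 1ℤ) ≡ (x == a)
==-+1-cancel x a with x ℤ.≟ a
... | yes refl = ==-refl (x ℤ.+ 1ℤ)
... | no ne = ==-false (λ e → ne (trans (sym (i+1-1≡i x)) (trans (cong (_- 1ℤ) e) (i+1-1≡i a))))

-1==⇔==+1 : ∀ x a → (x - 1ℤ == a) ≡ (x == a ℤ.+ 1ℤ)
-1==⇔==+1 x a with x ℤ.≟ a ℤ.+ 1ℤ
... | yes refl = ==-true (i+1-1≡i a)
... | no ne = ==-false (λ e → ne (trans (sym (i-1+1≡i x)) (cong (ℤ._+ 1ℤ) e)))

i+1+1≢i : ∀ a → a ℤ.+ 1ℤ ℤ.+ 1ℤ ≢ a
i+1+1≢i a e = i≢i+k a (ℤ.+ 2) (λ ()) (trans (sym e) (lem a))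
  where
  lem : ∀ a → a ℤ.+ 1ℤ ℤ.+ 1ℤ ≡ a ℤ.+ ℤ.+ 2
  lem = solve-∀

y==b+1∧y+1==b≡false : ∀ y b → ((y == b ℤ.+ 1ℤ) ∧ (y ℤ.+ 1ℤ == b)) ≡ false
y==b+1∧y+1==b≡false y b with y ℤ.≟ b ℤ.+ 1ℤ
... | no ne = refl
... | yes refl = ==-false (i+1+1≢i b)

0-0≡i-i-[0-0] : ∀ z → 0ℤ - 0ℤ ≡ z - z - (0ℤ - 0ℤ)
0-0≡i-i-[0-0] = solve-∀

y==b∧y-1==b+1≡false : ∀ y b → ((y == b) ∧ (y - 1ℤ == b ℤ.+ 1ℤ)) ≡ false
y==b∧y-1==b+1≡false y b with y ℤ.≟ b
... | no ne = refl
... | yes refl = ==-false (i-1≢i+1 y)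

data Dir : Set where
  dE dN dW dS : Dir

move : Dir → Point → Point
move dE (x , y) = (x ℤ.+ 1ℤ , y)
move dN (x , y) = (x , y ℤ.+ 1ℤ)
move dW (x , y) = (x - 1ℤ , y)
move dS (x , y) = (x , y - 1ℤ)

opposite : Dir → Dir
opposite dE = dW
opposite dN = dS
opposite dW = dE
opposite dS = dN

leftCell : Point → Dir → Cell
leftCell (x , y) dE = (x , y)
leftCell (x , y) dN = (x - 1ℤ , y)
leftCell (x , y) dW = (x - 1ℤ , y - 1ℤ)
leftCell (x , y) dS = (x , y - 1ℤ)

rightCell : Point → Dir → Cell
rightCell (x , y) dE = (x , y - 1ℤ)
rightCell (x , y) dN = (x , y)
rightCell (x , y) dW = (x - 1ℤ , y)
rightCell (x , y) dS = (x - 1ℤ , y - 1ℤ)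

leftCell?-move : ∀ d p → leftCell? p (move d p) ≡ (true , leftCell p d)
leftCell?-move dE (x , y) rewrite ==-refl (x ℤ.+ 1ℤ) | ==-refl y = refl
leftCell?-move dW (x , y)
  rewrite ==-false (i-1≢i+1 x) | ==-true (sym (i-1+1≡i x)) | ==-refl y = refl
leftCell?-move dN (x , y)
  rewrite ==-false (i≢i+1 x) | ==-refl (y ℤ.+ 1ℤ) | ==-refl x = refl
leftCell?-move dS (x , y)
  rewrite ==-false (i≢i+1 x) | ==-false (i-1≢i+1 y) | ==-true (sym (i-1+1≡i y)) | ==-refl x = refl

whiteSign : Cell → ℤ
whiteSign c = if isWhite c then 1ℤ else - 1ℤ

sp-move : ∀ d p t u → sp (p , t) (move d p , u) ≡ whiteSign (leftCell p d)
sp-move d p t u rewrite leftCell?-move d p = refl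

==P-pair : ∀ x y x' y' → ((x , y) ==P (x' , y')) ≡ ((x == x') ∧ (y == y'))
==P-pair x y x' y' = aux x y x' y' (x ℤ.≟ x') (y ℤ.≟ y')
  where
  aux : ∀ x y x' y' → Dec (x ≡ x') → Dec (y ≡ y') → ((x , y) ==P (x' , y')) ≡ ((x == x') ∧ (y == y'))
  aux x y .x .y (yes refl) (yes refl) = trans (==P-refl (x , y)) (sym (cong₂ _∧_ (==-refl x) (==-refl y)))
  aux x y .x y' (yes refl) (no ne) = trans (==P-false (λ e → ne (cong proj₂ e))) (sym (cong₂ _∧_ (==-refl x) (==-false ne)))
  aux x y x' y' (no ne) _ = trans (==P-false (λ e → ne (cong proj₁ e))) (sym (cong (_∧ (y == y')) (==-false ne)))

segmentIndicator : Point → Point → Point → Point → ℤ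
segmentIndicator r s p q = if (p ==P r) ∧ (q ==P s) then 1ℤ else 0ℤ

arcIndicator : Point → Point → Vtx → Vtx → ℤ
arcIndicator r s v w = segmentIndicator r s (proj₁ v) (proj₁ w)

windStepNF : Dir → ℤ → ℤ → ℤ → ℤ → ℤ
windStepNF dE a b x y = if isLess b y ∧ (x == a) then - 1ℤ else 0ℤ
windStepNF dW a b x y = if isLess b y ∧ (x - 1ℤ == a) then 1ℤ else 0ℤ
windStepNF dN a b x y = 0ℤ
windStepNF dS a b x y = 0ℤ

windStep-move : ∀ d a b x y t u → windStep (a , b) ((x , y) , t) (move d (x , y) , u) ≡ windStepNF d a b x y
windStep-move dE a b x y t u rewrite ==-refl y | y==b+1∧y+1==b≡false x a with isLess b y
... | false = refl
... | true with x ℤ.≟ a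
...   | yes refl rewrite ==-refl (a ℤ.+ 1ℤ) = refl
...   | no ne = refl
windStep-move dW a b x y t u rewrite ==-refl y with isLess b y
... | false = refl
... | true with x - 1ℤ ℤ.≟ a
...   | yes refl rewrite ==-true (sym (i-1+1≡i x)) = refl
...   | no ne rewrite ==-false {x} {a ℤ.+ 1ℤ} (λ e → ne (trans (cong (_- 1ℤ) e) (i+1-1≡i a)))
          with x ℤ.≟ a
...     | no ne2 = refl
...     | yes refl rewrite ==-false (i-1≢i+1 x) = refl
windStep-move dN a b x y t u rewrite ==-false (i≢i+1 y) = refl
windStep-move dS a b x y t u rewrite ==-false (i≢i-1 y) = refl

-- Discrete Stokes formula: the crossing numbers of two adjacent cells differ by the net
-- number of traversals of the edge between them, up to the gradient of onRay for
-- horizontally adjacent cells.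
windStepNF-vertical-jump : ∀ d a b x y →
  windStepNF d a b x y - windStepNF d a (b ℤ.+ 1ℤ) x y ≡
  segmentIndicator (a ℤ.+ 1ℤ , b ℤ.+ 1ℤ) (a , b ℤ.+ 1ℤ) (x , y) (move d (x , y)) -
  segmentIndicator (a , b ℤ.+ 1ℤ) (a ℤ.+ 1ℤ , b ℤ.+ 1ℤ) (x , y) (move d (x , y))
windStepNF-vertical-jump dE a b x y
  rewrite ==P-pair x y (a ℤ.+ 1ℤ) (b ℤ.+ 1ℤ) | ==P-pair (x ℤ.+ 1ℤ) y a (b ℤ.+ 1ℤ)
        | ==P-pair x y a (b ℤ.+ 1ℤ) | ==P-pair (x ℤ.+ 1ℤ) y (a ℤ.+ 1ℤ) (b ℤ.+ 1ℤ)
        | ==-+1-cancel x a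
        with x ℤ.≟ a
... | yes refl rewrite ==-false (i≢i+1 x) with y ℤ.≟ b ℤ.+ 1ℤ
...   | yes refl rewrite isLess-i-i+1 b | isLess-irrefl (b ℤ.+ 1ℤ) = refl
...   | no ne rewrite isLess-+1ˡ-≢ {b} {y} ne = ℤP.+-inverseʳ (if isLess b y ∧ true then - 1ℤ else 0ℤ)
windStepNF-vertical-jump dE a b x y | no ne rewrite ∧-zeroʳ (isLess b y) | ∧-zeroʳ (isLess (b ℤ.+ 1ℤ) y)
  with x ℤ.≟ a ℤ.+ 1ℤ
... | no ne2 = refl
... | yes refl rewrite ==-false (i+1+1≢i a) | ∧-zeroʳ (y == b ℤ.+ 1ℤ) = refl
windStepNF-vertical-jump dW a b x y
  rewrite ==P-pair x y (a ℤ.+ 1ℤ) (b ℤ.+ 1ℤ) | ==P-pair (x - 1ℤ) y a (b ℤ.+ 1ℤ)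
        | ==P-pair x y a (b ℤ.+ 1ℤ) | ==P-pair (x - 1ℤ) y (a ℤ.+ 1ℤ) (b ℤ.+ 1ℤ)
        | -1==⇔==+1 x a
        with x ℤ.≟ a ℤ.+ 1ℤ
... | yes refl rewrite ==-false (λ e → i≢i+1 a (sym e)) with y ℤ.≟ b ℤ.+ 1ℤ
...   | yes refl rewrite isLess-i-i+1 b | isLess-irrefl (b ℤ.+ 1ℤ) = refl
...   | no ne rewrite isLess-+1ˡ-≢ {b} {y} ne = ℤP.+-inverseʳ (if isLess b y ∧ true then 1ℤ else 0ℤ)
windStepNF-vertical-jump dW a b x y | no ne rewrite ∧-zeroʳ (isLess b y) | ∧-zeroʳ (isLess (b ℤ.+ 1ℤ) y)
  with x ℤ.≟ a
... | no ne2 = refl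
... | yes refl rewrite ==-false (i-1≢i+1 a) | ∧-zeroʳ (y == b ℤ.+ 1ℤ) = refl
windStepNF-vertical-jump dN a b x y
  rewrite ==P-pair x y (a ℤ.+ 1ℤ) (b ℤ.+ 1ℤ) | ==P-pair x (y ℤ.+ 1ℤ) a (b ℤ.+ 1ℤ)
        | ==P-pair x y a (b ℤ.+ 1ℤ) | ==P-pair x (y ℤ.+ 1ℤ) (a ℤ.+ 1ℤ) (b ℤ.+ 1ℤ)
        with x ℤ.≟ a
... | yes refl rewrite ==-false (i≢i+1 x) | ∧-zeroʳ (y == b ℤ.+ 1ℤ) = refl
... | no ne rewrite ∧-zeroʳ ((x == a ℤ.+ 1ℤ) ∧ (y == b ℤ.+ 1ℤ)) = refl
windStepNF-vertical-jump dS a b x y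
  rewrite ==P-pair x y (a ℤ.+ 1ℤ) (b ℤ.+ 1ℤ) | ==P-pair x (y - 1ℤ) a (b ℤ.+ 1ℤ)
        | ==P-pair x y a (b ℤ.+ 1ℤ) | ==P-pair x (y - 1ℤ) (a ℤ.+ 1ℤ) (b ℤ.+ 1ℤ)
        with x ℤ.≟ a
... | yes refl rewrite ==-false (i≢i+1 x) | ∧-zeroʳ (y == b ℤ.+ 1ℤ) = refl
... | no ne rewrite ∧-zeroʳ ((x == a ℤ.+ 1ℤ) ∧ (y == b ℤ.+ 1ℤ)) = refl

onRay : ℤ → ℤ → Point → ℤ
onRay a b (x , y) = if isLess b y ∧ (x == a ℤ.+ 1ℤ) then 1ℤ else 0ℤ

windStepNF-horizontal-jump : ∀ d a b x y →
  windStepNF d (a ℤ.+ 1ℤ) b x y - windStepNF d a b x y ≡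
  (onRay a b (move d (x , y)) - onRay a b (x , y)) -
  (segmentIndicator (a ℤ.+ 1ℤ , b) (a ℤ.+ 1ℤ , b ℤ.+ 1ℤ) (x , y) (move d (x , y)) -
   segmentIndicator (a ℤ.+ 1ℤ , b ℤ.+ 1ℤ) (a ℤ.+ 1ℤ , b) (x , y) (move d (x , y)))
windStepNF-horizontal-jump dE a b x y
  rewrite ==P-pair x y (a ℤ.+ 1ℤ) b | ==P-pair (x ℤ.+ 1ℤ) y (a ℤ.+ 1ℤ) (b ℤ.+ 1ℤ)
        | ==P-pair x y (a ℤ.+ 1ℤ) (b ℤ.+ 1ℤ) | ==P-pair (x ℤ.+ 1ℤ) y (a ℤ.+ 1ℤ) b
        | ==-+1-cancel x a
        with x ℤ.≟ a
... | yes refl rewrite ==-false (i≢i+1 x) | ∧-zeroʳ (isLess b y) | ∧-identityʳ (isLess b y) with isLess b y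
...   | true = refl
...   | false = refl
windStepNF-horizontal-jump dE a b x y | no ne rewrite ∧-zeroʳ (isLess b y)
      | ∧-zeroʳ ((x == a ℤ.+ 1ℤ) ∧ (y == b)) | ∧-zeroʳ ((x == a ℤ.+ 1ℤ) ∧ (y == b ℤ.+ 1ℤ))
      with isLess b y ∧ (x == a ℤ.+ 1ℤ)
...   | true = refl
...   | false = refl
windStepNF-horizontal-jump dW a b x y
  rewrite ==P-pair x y (a ℤ.+ 1ℤ) b | ==P-pair (x - 1ℤ) y (a ℤ.+ 1ℤ) (b ℤ.+ 1ℤ)
        | ==P-pair x y (a ℤ.+ 1ℤ) (b ℤ.+ 1ℤ) | ==P-pair (x - 1ℤ) y (a ℤ.+ 1ℤ) b
        | -1==⇔==+1 x a | -1==⇔==+1 x (a ℤ.+ 1ℤ)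
        with x ℤ.≟ a ℤ.+ 1ℤ
... | yes refl rewrite ==-false (i≢i+1 (a ℤ.+ 1ℤ))
        | ∧-zeroʳ (isLess b y) | ∧-identityʳ (isLess b y)
        | ∧-zeroʳ (y == b) | ∧-zeroʳ (y == b ℤ.+ 1ℤ) with isLess b y
...   | true = refl
...   | false = refl
windStepNF-horizontal-jump dW a b x y | no ne rewrite ∧-zeroʳ (isLess b y) with isLess b y ∧ (x == a ℤ.+ 1ℤ ℤ.+ 1ℤ)
...   | true = refl
...   | false = refl
windStepNF-horizontal-jump dN a b x y
  rewrite ==P-pair x y (a ℤ.+ 1ℤ) b | ==P-pair x (y ℤ.+ 1ℤ) (a ℤ.+ 1ℤ) (b ℤ.+ 1ℤ)
        | ==P-pair x y (a ℤ.+ 1ℤ) (b ℤ.+ 1ℤ) | ==P-pair x (y ℤ.+ 1ℤ) (a ℤ.+ 1ℤ) b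
        with x ℤ.≟ a ℤ.+ 1ℤ
... | no ne rewrite ∧-zeroʳ (isLess b y) | ∧-zeroʳ (isLess b (y ℤ.+ 1ℤ)) = refl
... | yes refl rewrite ∧-identityʳ (isLess b y) | ∧-identityʳ (isLess b (y ℤ.+ 1ℤ))
      | ==-+1-cancel y b
      with y ℤ.≟ b
...   | yes refl rewrite ==-false (i≢i+1 y) | isLess-irrefl y | isLess-i-i+1 y = refl
...   | no ne rewrite isLess-+1ʳ-≢ {b} {y} ne | y==b+1∧y+1==b≡false y b = 0-0≡i-i-[0-0] (if isLess b y then 1ℤ else 0ℤ)
windStepNF-horizontal-jump dS a b x y
  rewrite ==P-pair x y (a ℤ.+ 1ℤ) b | ==P-pair x (y - 1ℤ) (a ℤ.+ 1ℤ) (b ℤ.+ 1ℤ)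
        | ==P-pair x y (a ℤ.+ 1ℤ) (b ℤ.+ 1ℤ) | ==P-pair x (y - 1ℤ) (a ℤ.+ 1ℤ) b
        with x ℤ.≟ a ℤ.+ 1ℤ
... | no ne rewrite ∧-zeroʳ (isLess b y) | ∧-zeroʳ (isLess b (y - 1ℤ)) = refl
... | yes refl rewrite ∧-identityʳ (isLess b y) | ∧-identityʳ (isLess b (y - 1ℤ))
      | -1==⇔==+1 y b
      with y ℤ.≟ b ℤ.+ 1ℤ
...   | no ne rewrite isLess--1ʳ-≢ {b} {y} ne | y==b∧y-1==b+1≡false y b = 0-0≡i-i-[0-0] (if isLess b y then 1ℤ else 0ℤ)
...   | yes refl rewrite ==-false (λ e → i≢i+1 b (sym e)) | i+1-1≡i b | isLess-irrefl b | isLess-i-i+1 b with b ℤ.≟ b ℤ.+ 1ℤ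
...     | no _ = refl
...     | yes e = ⊥-elim (i≢i+1 b e)

AllSteps : (Vtx → Vtx → Set) → List Vtx → Set
AllSteps R [] = ⊤
AllSteps R (v ∷ []) = ⊤
AllSteps R (v ∷ w ∷ vs) = R v w × AllSteps R (w ∷ vs)

AllSteps-map : ∀ {R S : Vtx → Vtx → Set} → (∀ {v w} → R v w → S v w) → ∀ C → AllSteps R C → AllSteps S C
AllSteps-map f [] _ = tt
AllSteps-map f (v ∷ []) _ = tt
AllSteps-map f (v ∷ w ∷ vs) (r , rs) = f r , AllSteps-map f (w ∷ vs) rs

path⇒AllSteps : ∀ {F} C → IsPath F C → AllSteps (Arc F) C
path⇒AllSteps [] ()
path⇒AllSteps (v ∷ []) _ = tt
path⇒AllSteps (v ∷ w ∷ vs) (a , p) = a , path⇒AllSteps (w ∷ vs) p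

UnitStep : Vtx → Vtx → Set
UnitStep v w = Σ Dir λ d → proj₁ w ≡ move d (proj₁ v)

pathSum-+ : ∀ (f g : Vtx → Vtx → ℤ) C → pathSum (λ v w → f v w ℤ.+ g v w) C ≡ pathSum f C ℤ.+ pathSum g C
pathSum-+ f g [] = refl
pathSum-+ f g (v ∷ []) = refl
pathSum-+ f g (v ∷ w ∷ vs) rewrite pathSum-+ f g (w ∷ vs) = lem (f v w) (g v w) (pathSum f (w ∷ vs)) (pathSum g (w ∷ vs))
  where
  lem : ∀ a b c d → a ℤ.+ b ℤ.+ (c ℤ.+ d) ≡ a ℤ.+ c ℤ.+ (b ℤ.+ d)
  lem = solve-∀

pathSum-- : ∀ (f g : Vtx → Vtx → ℤ) C → pathSum (λ v w → f v w - g v w) C ≡ pathSum f C - pathSum g C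
pathSum-- f g [] = refl
pathSum-- f g (v ∷ []) = refl
pathSum-- f g (v ∷ w ∷ vs) rewrite pathSum-- f g (w ∷ vs) = lem (f v w) (g v w) (pathSum f (w ∷ vs)) (pathSum g (w ∷ vs))
  where
  lem : ∀ a b c d → a - b ℤ.+ (c - d) ≡ a ℤ.+ c - (b ℤ.+ d)
  lem = solve-∀

pathSum-*ˡ : ∀ k (f : Vtx → Vtx → ℤ) C → pathSum (λ v w → k * f v w) C ≡ k * pathSum f C
pathSum-*ˡ k f [] = sym (ℤP.*-zeroʳ k)
pathSum-*ˡ k f (v ∷ []) = sym (ℤP.*-zeroʳ k)
pathSum-*ˡ k f (v ∷ w ∷ vs) rewrite pathSum-*ˡ k f (w ∷ vs) = sym (ℤP.*-distribˡ-+ k (f v w) (pathSum f (w ∷ vs)))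

pathSum-0 : ∀ C → pathSum (λ v w → 0ℤ) C ≡ 0ℤ
pathSum-0 [] = refl
pathSum-0 (v ∷ []) = refl
pathSum-0 (v ∷ w ∷ vs) = trans (ℤP.+-identityˡ _) (pathSum-0 (w ∷ vs))

pathSum-*ʳ : ∀ (f : Vtx → Vtx → ℤ) k C → pathSum (λ v w → f v w * k) C ≡ pathSum f C * k
pathSum-*ʳ f k [] = sym (ℤP.*-zeroˡ k)
pathSum-*ʳ f k (v ∷ []) = sym (ℤP.*-zeroˡ k)
pathSum-*ʳ f k (v ∷ w ∷ vs) rewrite pathSum-*ʳ f k (w ∷ vs) = sym (ℤP.*-distribʳ-+ k (f v w) (pathSum f (w ∷ vs)))

pathSum-neg : ∀ (f : Vtx → Vtx → ℤ) C → pathSum (λ v w → - f v w) C ≡ - pathSum f C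
pathSum-neg f [] = refl
pathSum-neg f (v ∷ []) = refl
pathSum-neg f (v ∷ w ∷ vs) rewrite pathSum-neg f (w ∷ vs) = sym (ℤP.neg-distrib-+ (f v w) (pathSum f (w ∷ vs)))

pathSum-ext : ∀ (f g : Vtx → Vtx → ℤ) → (∀ v w → f v w ≡ g v w) → ∀ C → pathSum f C ≡ pathSum g C
pathSum-ext f g e [] = refl
pathSum-ext f g e (v ∷ []) = refl
pathSum-ext f g e (v ∷ w ∷ vs) = cong₂ ℤ._+_ (e v w) (pathSum-ext f g e (w ∷ vs))

pathSum-cong : ∀ {R : Vtx → Vtx → Set} (f g : Vtx → Vtx → ℤ) → (∀ {v w} → R v w → f v w ≡ g v w) →
         ∀ C → AllSteps R C → pathSum f C ≡ pathSum g C
pathSum-cong f g e [] _ = refl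
pathSum-cong f g e (v ∷ []) _ = refl
pathSum-cong f g e (v ∷ w ∷ vs) (r , rs) = cong₂ ℤ._+_ (e r) (pathSum-cong f g e (w ∷ vs) rs)

pathSum-telescope : ∀ (H : Vtx → ℤ) v vs → pathSum (λ a b → H b - H a) (v ∷ vs) ≡ H (lastOr v vs) - H v
pathSum-telescope H v [] = sym (ℤP.+-inverseʳ (H v))
pathSum-telescope H v (w ∷ vs) rewrite pathSum-telescope H w vs = lem (H w) (H v) (H (lastOr w vs))
  where
  lem : ∀ a b c → a - b ℤ.+ (c - a) ≡ c - b
  lem = solve-∀

Closed : List Vtx → Set
Closed [] = ⊥
Closed (v ∷ vs) = lastOr v vs ≡ v

pathSum-telescope-closed : ∀ (H : Vtx → ℤ) C → Closed C → pathSum (λ a b → H b - H a) C ≡ 0ℤ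
pathSum-telescope-closed H (v ∷ vs) cl rewrite pathSum-telescope H v vs | cl = ℤP.+-inverseʳ (H v)

arcCount : Point → Point → List Vtx → ℤ
arcCount r s C = pathSum (arcIndicator r s) C

windStep-vertical-jump : ∀ a b {v w} → UnitStep v w →
  windStep (a , b) v w - windStep (a , b ℤ.+ 1ℤ) v w ≡
  arcIndicator (a ℤ.+ 1ℤ , b ℤ.+ 1ℤ) (a , b ℤ.+ 1ℤ) v w - arcIndicator (a , b ℤ.+ 1ℤ) (a ℤ.+ 1ℤ , b ℤ.+ 1ℤ) v w
windStep-vertical-jump a b {(x , y) , t} {q , u} (d , refl) =
  trans (cong₂ _-_ (windStep-move d a b x y t u) (windStep-move d a (b ℤ.+ 1ℤ) x y t u)) (windStepNF-vertical-jump d a b x y)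

winding-vertical-jump : ∀ a b C → AllSteps UnitStep C →
  winding C (a , b) - winding C (a , b ℤ.+ 1ℤ) ≡
  arcCount (a ℤ.+ 1ℤ , b ℤ.+ 1ℤ) (a , b ℤ.+ 1ℤ) C - arcCount (a , b ℤ.+ 1ℤ) (a ℤ.+ 1ℤ , b ℤ.+ 1ℤ) C
winding-vertical-jump a b C arcs =
  trans (sym (pathSum-- (windStep (a , b)) (windStep (a , b ℤ.+ 1ℤ)) C))
  (trans (pathSum-cong {UnitStep} (λ v w → windStep (a , b) v w - windStep (a , b ℤ.+ 1ℤ) v w)
    (λ v w → arcIndicator (a ℤ.+ 1ℤ , b ℤ.+ 1ℤ) (a , b ℤ.+ 1ℤ) v w - arcIndicator (a , b ℤ.+ 1ℤ) (a ℤ.+ 1ℤ , b ℤ.+ 1ℤ) v w)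
    (λ {v} {w} u → windStep-vertical-jump a b {v} {w} u) C arcs)
         (pathSum-- (arcIndicator (a ℤ.+ 1ℤ , b ℤ.+ 1ℤ) (a , b ℤ.+ 1ℤ)) (arcIndicator (a , b ℤ.+ 1ℤ) (a ℤ.+ 1ℤ , b ℤ.+ 1ℤ)) C))

windStep-horizontal-jump : ∀ a b {v w} → UnitStep v w →
  windStep (a ℤ.+ 1ℤ , b) v w - windStep (a , b) v w ≡
  (onRay a b (proj₁ w) - onRay a b (proj₁ v)) -
  (arcIndicator (a ℤ.+ 1ℤ , b) (a ℤ.+ 1ℤ , b ℤ.+ 1ℤ) v w - arcIndicator (a ℤ.+ 1ℤ , b ℤ.+ 1ℤ) (a ℤ.+ 1ℤ , b) v w)
windStep-horizontal-jump a b {(x , y) , t} {q , u} (d , refl) =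
  trans (cong₂ _-_ (windStep-move d (a ℤ.+ 1ℤ) b x y t u) (windStep-move d a b x y t u)) (windStepNF-horizontal-jump d a b x y)

winding-horizontal-jump : ∀ a b C → AllSteps UnitStep C → Closed C →
  winding C (a ℤ.+ 1ℤ , b) - winding C (a , b) ≡
  0ℤ - (arcCount (a ℤ.+ 1ℤ , b) (a ℤ.+ 1ℤ , b ℤ.+ 1ℤ) C - arcCount (a ℤ.+ 1ℤ , b ℤ.+ 1ℤ) (a ℤ.+ 1ℤ , b) C)
winding-horizontal-jump a b C arcs cl =
  trans (sym (pathSum-- (windStep (a ℤ.+ 1ℤ , b)) (windStep (a , b)) C))
  (trans (pathSum-cong {UnitStep} (λ v w → windStep (a ℤ.+ 1ℤ , b) v w - windStep (a , b) v w)
    (λ v w → (onRay a b (proj₁ w) - onRay a b (proj₁ v)) -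
      (arcIndicator (a ℤ.+ 1ℤ , b) (a ℤ.+ 1ℤ , b ℤ.+ 1ℤ) v w - arcIndicator (a ℤ.+ 1ℤ , b ℤ.+ 1ℤ) (a ℤ.+ 1ℤ , b) v w))
    (λ {v} {w} u → windStep-horizontal-jump a b {v} {w} u) C arcs)
  (trans (pathSum-- (λ v w → onRay a b (proj₁ w) - onRay a b (proj₁ v)) _ C)
  (cong₂ _-_ (pathSum-telescope-closed (λ v → onRay a b (proj₁ v)) C cl)
             (pathSum-- (arcIndicator (a ℤ.+ 1ℤ , b) (a ℤ.+ 1ℤ , b ℤ.+ 1ℤ)) (arcIndicator (a ℤ.+ 1ℤ , b ℤ.+ 1ℤ) (a ℤ.+ 1ℤ , b)) C))))

SideInfo : Point → Point → Cell → Set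
SideInfo p q c = Σ Dir λ d → (q ≡ move d p) × (c ≡ leftCell p d ⊎ c ≡ rightCell p d)

pair≡ : ∀ {a b c d : ℤ} → a ≡ c → b ≡ d → (a , b) ≡ (c , d)
pair≡ refl refl = refl

sideInfo : ∀ {p q c} → (p , q) ∈ sides c → SideInfo p q c
sideInfo {c = a , b} (here refl) = dE , refl , inj₁ refl
sideInfo {c = a , b} (there (here refl)) = dW , pair≡ (sym (i+1-1≡i a)) refl , inj₂ (pair≡ (sym (i+1-1≡i a)) refl)
sideInfo {c = a , b} (there (there (here refl))) = dN , refl , inj₁ (pair≡ (sym (i+1-1≡i a)) refl)
sideInfo {c = a , b} (there (there (there (here refl)))) =
  dS , pair≡ refl (sym (i+1-1≡i b)) , inj₂ (pair≡ (sym (i+1-1≡i a)) (sym (i+1-1≡i b)))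
sideInfo {c = a , b} (there (there (there (there (here refl))))) =
  dW , pair≡ (sym (i+1-1≡i a)) refl , inj₁ (pair≡ (sym (i+1-1≡i a)) (sym (i+1-1≡i b)))
sideInfo {c = a , b} (there (there (there (there (there (here refl)))))) =
  dE , refl , inj₂ (pair≡ refl (sym (i+1-1≡i b)))
sideInfo {c = a , b} (there (there (there (there (there (there (here refl))))))) =
  dS , pair≡ refl (sym (i+1-1≡i b)) , inj₁ (pair≡ refl (sym (i+1-1≡i b)))
sideInfo {c = a , b} (there (there (there (there (there (there (there (here refl)))))))) =
  dN , refl , inj₂ refl
sideInfo {c = a , b} (there (there (there (there (there (there (there (there ()))))))))

sides-sym : ∀ {p q c} → (p , q) ∈ sides c → (q , p) ∈ sides c
sides-sym (here refl) = there (here refl)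
sides-sym (there (here refl)) = here refl
sides-sym (there (there (here refl))) = there (there (there (here refl)))
sides-sym (there (there (there (here refl)))) = there (there (here refl))
sides-sym (there (there (there (there (here refl))))) = there (there (there (there (there (here refl)))))
sides-sym (there (there (there (there (there (here refl)))))) = there (there (there (there (here refl))))
sides-sym (there (there (there (there (there (there (here refl))))))) =
  there (there (there (there (there (there (there (here refl)))))))
sides-sym (there (there (there (there (there (there (there (here refl)))))))) =
  there (there (there (there (there (there (here refl))))))
sides-sym (there (there (there (there (there (there (there (there ()))))))))

Arc-sym : ∀ {F v w} → Arc F v w → Arc F w v
Arc-sym (c , cF , s , t1 , t2) = c , cF , sides-sym s , t2 , t1

Arc⇒UnitStep : ∀ {F v w} → Arc F v w → UnitStep v w
Arc⇒UnitStep (c , cF , s , _ , _) with sideInfo s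
... | d , e , _ = d , e

move-opposite : ∀ d p → move (opposite d) (move d p) ≡ p
move-opposite dE (x , y) = pair≡ (i+1-1≡i x) refl
move-opposite dN (x , y) = pair≡ refl (i+1-1≡i y)
move-opposite dW (x , y) = pair≡ (i-1+1≡i x) refl
move-opposite dS (x , y) = pair≡ refl (i-1+1≡i y)

leftCell-opposite : ∀ d p → leftCell p d ≡ rightCell (move d p) (opposite d)
leftCell-opposite dE (x , y) = pair≡ (sym (i+1-1≡i x)) refl
leftCell-opposite dN (x , y) = pair≡ refl (sym (i+1-1≡i y))
leftCell-opposite dW (x , y) = refl
leftCell-opposite dS (x , y) = refl

rightCell-opposite : ∀ d p → rightCell p d ≡ leftCell (move d p) (opposite d)
rightCell-opposite dE (x , y) = pair≡ (sym (i+1-1≡i x)) refl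
rightCell-opposite dN (x , y) = pair≡ refl (sym (i+1-1≡i y))
rightCell-opposite dW (x , y) = refl
rightCell-opposite dS (x , y) = refl

move-injective : ∀ {d d'} p → move d p ≡ move d' p → d ≡ d'
move-injective {dE} {dE} _ _ = refl
move-injective {dN} {dN} _ _ = refl
move-injective {dW} {dW} _ _ = refl
move-injective {dS} {dS} _ _ = refl
move-injective {dE} {dN} (x , y) e = ⊥-elim (i≢i+1 x (sym (cong proj₁ e)))
move-injective {dE} {dW} (x , y) e = ⊥-elim (i-1≢i+1 x (sym (cong proj₁ e)))
move-injective {dE} {dS} (x , y) e = ⊥-elim (i≢i+1 x (sym (cong proj₁ e)))
move-injective {dN} {dE} (x , y) e = ⊥-elim (i≢i+1 x (cong proj₁ e))
move-injective {dN} {dW} (x , y) e = ⊥-elim (i≢i-1 x (cong proj₁ e))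
move-injective {dN} {dS} (x , y) e = ⊥-elim (i-1≢i+1 y (sym (cong proj₂ e)))
move-injective {dW} {dE} (x , y) e = ⊥-elim (i-1≢i+1 x (cong proj₁ e))
move-injective {dW} {dN} (x , y) e = ⊥-elim (i≢i-1 x (sym (cong proj₁ e)))
move-injective {dW} {dS} (x , y) e = ⊥-elim (i≢i-1 x (sym (cong proj₁ e)))
move-injective {dS} {dE} (x , y) e = ⊥-elim (i≢i+1 x (cong proj₁ e))
move-injective {dS} {dN} (x , y) e = ⊥-elim (i-1≢i+1 y (cong proj₂ e))
move-injective {dS} {dW} (x , y) e = ⊥-elim (i≢i-1 x (cong proj₁ e))

move-≢ : ∀ d p → move d p ≢ p
move-≢ dE (x , y) e = i≢i+1 x (sym (cong proj₁ e))
move-≢ dN (x , y) e = i≢i+1 y (sym (cong proj₂ e))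
move-≢ dW (x , y) e = i≢i-1 x (sym (cong proj₁ e))
move-≢ dS (x , y) e = i≢i-1 y (sym (cong proj₂ e))

open DecMem _≟P_ using () renaming (_∈?_ to _∈ᴾ?_)

∈ᵇ-true : ∀ {c cs} → c ∈ cs → (c ∈ᵇ cs) ≡ true
∈ᵇ-true {c} {cs} m with c ∈ᴾ? cs
... | yes _ = refl
... | no nm = ⊥-elim (nm m)

pinchPattern : Bool → Bool → Bool → Bool → Bool
pinchPattern ne nw sw se = (ne ∧ sw ∧ not nw ∧ not se) ∨ (nw ∧ se ∧ not ne ∧ not sw)

pinchPattern-ne-se : ∀ nw sw → pinchPattern true nw sw true ≡ false
pinchPattern-ne-se false false = refl
pinchPattern-ne-se false true = refl
pinchPattern-ne-se true false = refl
pinchPattern-ne-se true true = refl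

pinchPattern-ne-nw : ∀ sw se → pinchPattern true true sw se ≡ false
pinchPattern-ne-nw false false = refl
pinchPattern-ne-nw false true = refl
pinchPattern-ne-nw true false = refl
pinchPattern-ne-nw true true = refl

pinchPattern-nw-sw : ∀ ne se → pinchPattern ne true true se ≡ false
pinchPattern-nw-sw false false = refl
pinchPattern-nw-sw false true = refl
pinchPattern-nw-sw true false = refl
pinchPattern-nw-sw true true = refl

pinchPattern-sw-se : ∀ ne nw → pinchPattern ne nw true true ≡ false
pinchPattern-sw-se false false = refl
pinchPattern-sw-se false true = refl
pinchPattern-sw-se true false = refl
pinchPattern-sw-se true true = refl

both-sides⇒¬pinch : ∀ F d p → leftCell p d ∈ cells F → rightCell p d ∈ cells F → isPinch F p ≡ false
both-sides⇒¬pinch F dE (x , y) mL mR rewrite ∈ᵇ-true mL | ∈ᵇ-true mR =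
  pinchPattern-ne-se ((x - 1ℤ , y) ∈ᵇ cells F) ((x - 1ℤ , y - 1ℤ) ∈ᵇ cells F)
both-sides⇒¬pinch F dN (x , y) mL mR rewrite ∈ᵇ-true mL | ∈ᵇ-true mR =
  pinchPattern-ne-nw ((x - 1ℤ , y - 1ℤ) ∈ᵇ cells F) ((x , y - 1ℤ) ∈ᵇ cells F)
both-sides⇒¬pinch F dW (x , y) mL mR rewrite ∈ᵇ-true mL | ∈ᵇ-true mR =
  pinchPattern-nw-sw ((x , y) ∈ᵇ cells F) ((x , y - 1ℤ) ∈ᵇ cells F)
both-sides⇒¬pinch F dS (x , y) mL mR rewrite ∈ᵇ-true mL | ∈ᵇ-true mR =
  pinchPattern-sw-se ((x , y) ∈ᵇ cells F) ((x - 1ℤ , y) ∈ᵇ cells F)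

leftTag : Figure → Point → Dir → Bool
leftTag F p dE = isPinch F p
leftTag F p dN = false
leftTag F p dW = false
leftTag F p dS = isPinch F p

rightTag : Figure → Point → Dir → Bool
rightTag F p dE = isPinch F p
rightTag F p dN = isPinch F p
rightTag F p dW = false
rightTag F p dS = false

tag-leftCell : ∀ F d p → tag F p (leftCell p d) ≡ leftTag F p d
tag-leftCell F dE (x , y) rewrite ==-refl x = ∧-identityʳ _
tag-leftCell F dN (x , y) rewrite ==-false (λ e → i≢i-1 x (sym e)) = ∧-zeroʳ _
tag-leftCell F dW (x , y) rewrite ==-false (λ e → i≢i-1 x (sym e)) = ∧-zeroʳ _
tag-leftCell F dS (x , y) rewrite ==-refl x = ∧-identityʳ _

tag-rightCell : ∀ F d p → tag F p (rightCell p d) ≡ rightTag F p d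
tag-rightCell F dE (x , y) rewrite ==-refl x = ∧-identityʳ _
tag-rightCell F dN (x , y) rewrite ==-refl x = ∧-identityʳ _
tag-rightCell F dW (x , y) rewrite ==-false (λ e → i≢i-1 x (sym e)) = ∧-zeroʳ _
tag-rightCell F dS (x , y) rewrite ==-false (λ e → i≢i-1 x (sym e)) = ∧-zeroʳ _

tag-left≡right : ∀ F d p → leftCell p d ∈ cells F → rightCell p d ∈ cells F → tag F p (leftCell p d) ≡ tag F p (rightCell p d)
tag-left≡right F d p mL mR rewrite tag-leftCell F d p | tag-rightCell F d p = aux d mL mR
  where
  aux : ∀ d → leftCell p d ∈ cells F → rightCell p d ∈ cells F → leftTag F p d ≡ rightTag F p d
  aux dE _ _ = refl
  aux dN mL mR = sym (both-sides⇒¬pinch F dN p mL mR)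
  aux dW _ _ = refl
  aux dS mL mR = both-sides⇒¬pinch F dS p mL mR

ArcInfo : Figure → Vtx → Vtx → Set
ArcInfo F (p , t) (q , u) = Σ Dir λ d → (q ≡ move d p) ×
  ((leftCell p d ∈ cells F × t ≡ tag F p (leftCell p d) × u ≡ tag F q (leftCell p d)) ⊎
   (rightCell p d ∈ cells F × t ≡ tag F p (rightCell p d) × u ≡ tag F q (rightCell p d)))

arcInfo : ∀ {F p t q u} → Arc F (p , t) (q , u) → ArcInfo F (p , t) (q , u)
arcInfo (c , cF , s , t1 , t2) with sideInfo s
... | d , e , inj₁ refl = d , e , inj₁ (cF , t1 , t2)
... | d , e , inj₂ refl = d , e , inj₂ (cF , t1 , t2)

Arc-tags-determined : ∀ {F p t t' q u u'} → Arc F (p , t) (q , u) → Arc F (p , t') (q , u') → (t ≡ t') × (u ≡ u')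
Arc-tags-determined {F} {p} {t} {t'} {q} {u} {u'} a1 a2 with arcInfo {F} {p} {t} {q} {u} a1 | arcInfo {F} {p} {t'} {q} {u'} a2
... | d , e , s1 | d' , e' , s2 with move-injective {d} {d'} p (trans (sym e) e')
... | refl = go s1 s2
  where
  Lq : leftCell p d ≡ rightCell q (opposite d)
  Lq = trans (leftCell-opposite d p) (cong (λ z → rightCell z (opposite d)) (sym e))
  Rq : rightCell p d ≡ leftCell q (opposite d)
  Rq = trans (rightCell-opposite d p) (cong (λ z → leftCell z (opposite d)) (sym e))
  atq : leftCell p d ∈ cells F → rightCell p d ∈ cells F → tag F q (rightCell p d) ≡ tag F q (leftCell p d)
  atq mL mR = trans (cong (tag F q) Rq)
              (trans (tag-left≡right F (opposite d) q (subst (_∈ cells F) Rq mR) (subst (_∈ cells F) Lq mL))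
                     (cong (tag F q) (sym Lq)))
  go : _ → _ → (t ≡ t') × (u ≡ u')
  go (inj₁ (_ , x1 , y1)) (inj₁ (_ , x2 , y2)) = trans x1 (sym x2) , trans y1 (sym y2)
  go (inj₂ (_ , x1 , y1)) (inj₂ (_ , x2 , y2)) = trans x1 (sym x2) , trans y1 (sym y2)
  go (inj₁ (mL , x1 , y1)) (inj₂ (mR , x2 , y2)) =
    trans x1 (trans (tag-left≡right F d p mL mR) (sym x2)) , trans y1 (trans (sym (atq mL mR)) (sym y2))
  go (inj₂ (mR , x1 , y1)) (inj₁ (mL , x2 , y2)) =
    trans x1 (trans (sym (tag-left≡right F d p mL mR)) (sym x2)) , trans y1 (trans (atq mL mR) (sym y2))

SideTag : Figure → Point → Dir → Bool → Set
SideTag F q d t = (leftCell q d ∈ cells F × t ≡ tag F q (leftCell q d)) ⊎ (rightCell q d ∈ cells F × t ≡ tag F q (rightCell q d))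

opposite-sides⇒¬pinch : ∀ F d q t → SideTag F q d t → SideTag F q (opposite d) t → isPinch F q ≡ false
opposite-sides⇒¬pinch F dE q t s1 s2 = trans (sym (a s1)) (b s2)
  where
  a : SideTag F q dE t → t ≡ isPinch F q
  a (inj₁ (_ , e)) = trans e (tag-leftCell F dE q)
  a (inj₂ (_ , e)) = trans e (tag-rightCell F dE q)
  b : SideTag F q dW t → t ≡ false
  b (inj₁ (_ , e)) = trans e (tag-leftCell F dW q)
  b (inj₂ (_ , e)) = trans e (tag-rightCell F dW q)
opposite-sides⇒¬pinch F dW q t s1 s2 = trans (sym (a s2)) (b s1)
  where
  a : SideTag F q dE t → t ≡ isPinch F q
  a (inj₁ (_ , e)) = trans e (tag-leftCell F dE q)
  a (inj₂ (_ , e)) = trans e (tag-rightCell F dE q)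
  b : SideTag F q dW t → t ≡ false
  b (inj₁ (_ , e)) = trans e (tag-leftCell F dW q)
  b (inj₂ (_ , e)) = trans e (tag-rightCell F dW q)
opposite-sides⇒¬pinch F dN (x , y) t (inj₁ (m1 , e1)) (inj₁ (m2 , e2)) =
  trans (sym (trans e2 (tag-leftCell F dS (x , y)))) (trans e1 (tag-leftCell F dN (x , y)))
opposite-sides⇒¬pinch F dN (x , y) t (inj₁ (m1 , e1)) (inj₂ (m2 , e2)) = both-sides⇒¬pinch F dW (x , y) m2 m1
opposite-sides⇒¬pinch F dN (x , y) t (inj₂ (m1 , e1)) (inj₁ (m2 , e2)) = both-sides⇒¬pinch F dE (x , y) m1 m2
opposite-sides⇒¬pinch F dN (x , y) t (inj₂ (m1 , e1)) (inj₂ (m2 , e2)) =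
  trans (sym (trans e1 (tag-rightCell F dN (x , y)))) (trans e2 (tag-rightCell F dS (x , y)))
opposite-sides⇒¬pinch F dS (x , y) t (inj₁ (m1 , e1)) (inj₁ (m2 , e2)) =
  trans (sym (trans e1 (tag-leftCell F dS (x , y)))) (trans e2 (tag-leftCell F dN (x , y)))
opposite-sides⇒¬pinch F dS (x , y) t (inj₁ (m1 , e1)) (inj₂ (m2 , e2)) = both-sides⇒¬pinch F dE (x , y) m2 m1
opposite-sides⇒¬pinch F dS (x , y) t (inj₂ (m1 , e1)) (inj₁ (m2 , e2)) = both-sides⇒¬pinch F dW (x , y) m1 m2
opposite-sides⇒¬pinch F dS (x , y) t (inj₂ (m1 , e1)) (inj₂ (m2 , e2)) =
  trans (sym (trans e2 (tag-rightCell F dN (x , y)))) (trans e1 (tag-rightCell F dS (x , y)))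

sideTag-of : ∀ {F q t pz tz} d → Arc F (q , t) (pz , tz) → pz ≡ move d q → SideTag F q d t
sideTag-of {F} {q} {t} {pz} {tz} d a e with arcInfo {F} {q} {t} {pz} {tz} a
... | d' , e' , s with move-injective {d'} {d} q (trans (sym e') e)
... | refl with s
... | inj₁ (m , x , _) = inj₁ (m , x)
... | inj₂ (m , x , _) = inj₂ (m , x)

-- Hence a point that a cycle goes straight through has a single copy in G_F, and no
-- other arc of an elementary cycle can touch it.
straight⇒¬pinch : ∀ {F pu tu q t pz tz} d → Arc F (pu , tu) (q , t) → Arc F (q , t) (pz , tz) →
           q ≡ move d pu → pz ≡ move d q → isPinch F q ≡ false
straight⇒¬pinch {F} {pu} {tu} {q} {t} {pz} {tz} d a1 a2 e1 e2 =
  opposite-sides⇒¬pinch F d q t (sideTag-of {F} {q} {t} {pz} {tz} d a2 e2)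
    (sideTag-of {F} {q} {t} {pu} {tu} (opposite d) (Arc-sym {F} {pu , tu} {q , t} a1)
       (trans (sym (move-opposite d pu)) (cong (move (opposite d)) (sym e1))))

¬pinch⇒source-tag : ∀ {F q t w} → Arc F (q , t) w → isPinch F q ≡ false → t ≡ false
¬pinch⇒source-tag {F} {q} (c , _ , _ , t1 , _) np rewrite np = t1

¬pinch⇒target-tag : ∀ {F v q t} → Arc F v (q , t) → isPinch F q ≡ false → t ≡ false
¬pinch⇒target-tag {F} {v} {q} (c , _ , _ , _ , t2) np rewrite np = t2

arcsOf : List Vtx → List (Vtx × Vtx)
arcsOf [] = []
arcsOf (v ∷ []) = []
arcsOf (v ∷ w ∷ vs) = (v , w) ∷ arcsOf (w ∷ vs)

map-proj₁-arcsOf : ∀ C → map proj₁ (arcsOf C) ≡ dropLast C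
map-proj₁-arcsOf [] = refl
map-proj₁-arcsOf (v ∷ []) = refl
map-proj₁-arcsOf (v ∷ w ∷ vs) = cong (v ∷_) (map-proj₁-arcsOf (w ∷ vs))

map-proj₂-arcsOf : ∀ C → map proj₂ (arcsOf C) ≡ drop 1 C
map-proj₂-arcsOf [] = refl
map-proj₂-arcsOf (v ∷ []) = refl
map-proj₂-arcsOf (v ∷ w ∷ vs) = cong (w ∷_) (map-proj₂-arcsOf (w ∷ vs))

AllSteps-lookup : ∀ {R} C → AllSteps R C → ∀ {v w} → (v , w) ∈ arcsOf C → R v w
AllSteps-lookup [] _ ()
AllSteps-lookup (v ∷ []) _ ()
AllSteps-lookup (v ∷ w ∷ vs) (r , rs) (here refl) = r
AllSteps-lookup (v ∷ w ∷ vs) (r , rs) (there m) = AllSteps-lookup (w ∷ vs) rs m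

∈-map : ∀ {A B : Set} (f : A → B) {x xs} → x ∈ xs → f x ∈ map f xs
∈-map f (here refl) = here refl
∈-map f (there m) = there (∈-map f m)

Unique-map⇒injective : ∀ {A B : Set} (f : A → B) {xs : List A} → Unique (map f xs) →
           ∀ {a b} → a ∈ xs → b ∈ xs → f a ≡ f b → a ≡ b
Unique-map⇒injective f {x ∷ xs} (nx ∷ u) (here refl) (here refl) e = refl
Unique-map⇒injective f {x ∷ xs} (nx ∷ u) (here refl) (there mb) e = ⊥-elim (All.lookup nx (∈-map f mb) e)
Unique-map⇒injective f {x ∷ xs} (nx ∷ u) (there ma) (here refl) e = ⊥-elim (All.lookup nx (∈-map f ma) (sym e))
Unique-map⇒injective f {x ∷ xs} (nx ∷ u) (there ma) (there mb) e = Unique-map⇒injective f u ma mb e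

All-++ : ∀ {A : Set} {P : A → Set} {xs ys} → All P xs → All P ys → All P (xs ++ ys)
All-++ [] q = q
All-++ (p ∷ ps) q = p ∷ All-++ ps q

Unique-rotate : ∀ {A : Set} {v : A} {xs} → Unique (v ∷ xs) → Unique (xs ++ (v ∷ []))
Unique-rotate {xs = []} _ = [] ∷ []
Unique-rotate {v = v} {xs = x ∷ xs} (nv ∷ (nx ∷ u)) =
  All-++ nx ((λ e → All.head nv (sym e)) ∷ []) ∷ Unique-rotate (All.tail nv ∷ u)

dropLast-++-lastOr : ∀ v vs → v ∷ vs ≡ dropLast (v ∷ vs) ++ (lastOr v vs ∷ [])
dropLast-++-lastOr v [] = refl
dropLast-++-lastOr v (w ∷ vs) = cong (v ∷_) (dropLast-++-lastOr w vs)

Unique-tail : ∀ C → Closed C → Unique (dropLast C) → Unique (drop 1 C)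
Unique-tail (v ∷ []) cl u = []
Unique-tail (v ∷ w ∷ vs) cl (nv ∷ u) =
  subst Unique (sym (trans (dropLast-++-lastOr w vs) (cong (λ z → dropLast (w ∷ vs) ++ (z ∷ [])) cl)))
    (Unique-rotate (nv ∷ u))

Unique-sources : ∀ C → Unique (dropLast C) → Unique (map proj₁ (arcsOf C))
Unique-sources C u = subst Unique (sym (map-proj₁-arcsOf C)) u

Unique-targets : ∀ C → Closed C → Unique (dropLast C) → Unique (map proj₂ (arcsOf C))
Unique-targets C cl u = subst Unique (sym (map-proj₂-arcsOf C)) (Unique-tail C cl u)

same-source⇒same-target : ∀ C → Unique (dropLast C) → ∀ {a b b'} → (a , b) ∈ arcsOf C → (a , b') ∈ arcsOf C → b ≡ b'
same-source⇒same-target C u m m' = cong proj₂ (Unique-map⇒injective proj₁ (Unique-sources C u) m m' refl)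

same-target⇒same-source : ∀ C → Closed C → Unique (dropLast C) → ∀ {a a' b} → (a , b) ∈ arcsOf C → (a' , b) ∈ arcsOf C → a ≡ a'
same-target⇒same-source C cl u m m' = cong proj₁ (Unique-map⇒injective proj₂ (Unique-targets C cl u) m m' refl)

pt : Vtx → Point
pt = proj₁

arcIndicator-cases : ∀ r s v w → (pt v ≡ r × pt w ≡ s × arcIndicator r s v w ≡ 1ℤ) ⊎ (¬ (pt v ≡ r × pt w ≡ s) × arcIndicator r s v w ≡ 0ℤ)
arcIndicator-cases r s v w = aux (pt v ≟P r) (pt w ≟P s)
  where
  aux : Dec (pt v ≡ r) → Dec (pt w ≡ s) →
        (pt v ≡ r × pt w ≡ s × arcIndicator r s v w ≡ 1ℤ) ⊎ (¬ (pt v ≡ r × pt w ≡ s) × arcIndicator r s v w ≡ 0ℤ)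
  aux (yes e1) (yes e2) = inj₁ (e1 , e2 , cong₂ (λ a b → if a ∧ b then 1ℤ else 0ℤ) (==P-true e1) (==P-true e2))
  aux (yes e1) (no n2) = inj₂ ((λ p → n2 (proj₂ p)) , cong₂ (λ a b → if a ∧ b then 1ℤ else 0ℤ) (==P-true e1) (==P-false n2))
  aux (no n1) _ = inj₂ ((λ p → n1 (proj₁ p)) , cong (λ a → if a ∧ (pt w ==P s) then 1ℤ else 0ℤ) (==P-false n1))

HasArc : Point → Point → List Vtx → Set
HasArc r s C = Σ Vtx λ v → Σ Vtx λ w → (v , w) ∈ arcsOf C × pt v ≡ r × pt w ≡ s

arcCount-cases : ∀ r s C → arcCount r s C ≡ 0ℤ ⊎ HasArc r s C
arcCount-cases r s [] = inj₁ refl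
arcCount-cases r s (v ∷ []) = inj₁ refl
arcCount-cases r s (v ∷ w ∷ vs) = stp (arcIndicator-cases r s v w) (arcCount-cases r s (w ∷ vs))
  where
  stp : _ → arcCount r s (w ∷ vs) ≡ 0ℤ ⊎ HasArc r s (w ∷ vs) → arcCount r s (v ∷ w ∷ vs) ≡ 0ℤ ⊎ HasArc r s (v ∷ w ∷ vs)
  stp (inj₁ (e1 , e2 , _)) _ = inj₂ (v , w , here refl , e1 , e2)
  stp (inj₂ (_ , z)) (inj₁ z') = inj₁ (cong₂ ℤ._+_ z z')
  stp (inj₂ (_ , z)) (inj₂ (a , b , m , e1 , e2)) = inj₂ (a , b , there m , e1 , e2)

arcCount-zero : ∀ r s C → ¬ HasArc r s C → arcCount r s C ≡ 0ℤ
arcCount-zero r s C na with arcCount-cases r s C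
... | inj₁ z = z
... | inj₂ a = ⊥-elim (na a)

arcCount-nonneg : ∀ r s C → 0ℤ ℤ.≤ arcCount r s C
arcCount-nonneg r s [] = ℤP.≤-refl
arcCount-nonneg r s (v ∷ []) = ℤP.≤-refl
arcCount-nonneg r s (v ∷ w ∷ vs) = stp (arcIndicator-cases r s v w) (arcCount-nonneg r s (w ∷ vs))
  where
  stp : _ → 0ℤ ℤ.≤ arcCount r s (w ∷ vs) → 0ℤ ℤ.≤ arcCount r s (v ∷ w ∷ vs)
  stp (inj₁ (_ , _ , e)) h = subst (λ z → 0ℤ ℤ.≤ z ℤ.+ arcCount r s (w ∷ vs)) (sym e) (ℤP.≤-trans h (ℤP.i≤j+i _ 1ℤ))
  stp (inj₂ (_ , e)) h = subst (λ z → 0ℤ ℤ.≤ z ℤ.+ arcCount r s (w ∷ vs)) (sym e) (subst (0ℤ ℤ.≤_) (sym (ℤP.+-identityˡ _)) h)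

∈arcs⇒∈drop : ∀ C {v w} → (v , w) ∈ arcsOf C → v ∈ dropLast C
∈arcs⇒∈drop C m = subst (_ ∈_) (map-proj₁-arcsOf C) (∈-map proj₁ m)

arcCount-one : ∀ r s C → Unique (dropLast C) → ∀ {v w} → (v , w) ∈ arcsOf C → pt v ≡ r → pt w ≡ s →
          (∀ {v' w'} → (v' , w') ∈ arcsOf C → pt v' ≡ r → pt w' ≡ s → v' ≡ v) → arcCount r s C ≡ 1ℤ
arcCount-one r s [] _ ()
arcCount-one r s (a ∷ []) _ ()
arcCount-one r s (a ∷ b ∷ vs) (na ∷ u) {v} {w} m e1 e2 all with arcIndicator-cases r s a b
... | inj₁ (f1 , f2 , i) = trans (cong₂ ℤ._+_ i rest0) refl
  where
  av : a ≡ v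
  av = all (here refl) f1 f2
  rest0 : arcCount r s (b ∷ vs) ≡ 0ℤ
  rest0 = arcCount-zero r s (b ∷ vs) λ { (v' , w' , m' , g1 , g2) →
    All.lookup na (∈arcs⇒∈drop (b ∷ vs) m') (trans av (sym (all (there m') g1 g2))) }
... | inj₂ (nf , i) with m
...   | here refl = ⊥-elim (nf (e1 , e2))
...   | there m' = trans (cong₂ ℤ._+_ i (arcCount-one r s (b ∷ vs) u m' e1 e2 (λ mm → all (there mm)))) (ℤP.+-identityˡ 1ℤ)

All-dropLast : ∀ {P : Vtx → Set} C → All P C → All P (dropLast C)
All-dropLast [] [] = []
All-dropLast (v ∷ []) (p ∷ []) = []
All-dropLast (v ∷ w ∷ vs) (p ∷ ps) = p ∷ All-dropLast (w ∷ vs) ps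

pigeonhole-2 : ∀ {a b : Vtx} xs → Unique xs → All (λ x → x ≡ a ⊎ x ≡ b) xs → length xs ℕ.≤ 2
pigeonhole-2 [] _ _ = z≤n
pigeonhole-2 (x ∷ []) _ _ = s≤s z≤n
pigeonhole-2 (x ∷ y ∷ []) _ _ = s≤s (s≤s z≤n)
pigeonhole-2 (x ∷ y ∷ z ∷ rest) ((nxy ∷ nxz ∷ _) ∷ (nyz ∷ _) ∷ _) (px ∷ py ∷ pz ∷ _) = ⊥-elim (go px py pz)
  where
  go : _ → _ → _ → ⊥
  go (inj₁ refl) (inj₁ refl) _ = nxy refl
  go (inj₂ refl) (inj₂ refl) _ = nxy refl
  go (inj₁ refl) (inj₂ refl) (inj₁ refl) = nxz refl
  go (inj₁ refl) (inj₂ refl) (inj₂ refl) = nyz refl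
  go (inj₂ refl) (inj₁ refl) (inj₁ refl) = nyz refl
  go (inj₂ refl) (inj₁ refl) (inj₂ refl) = nxz refl

module BackAndForth (C : List Vtx) (cl : Closed C) (u : Unique (dropLast C)) {v w : Vtx}
                 (m1 : (v , w) ∈ arcsOf C) (m2 : (w , v) ∈ arcsOf C) where

  S : Vtx → Set
  S x = x ≡ v ⊎ x ≡ w

  clo : ∀ {x y} → (x , y) ∈ arcsOf C → S x → S y
  clo m (inj₁ refl) = inj₂ (same-source⇒same-target C u m m1)
  clo m (inj₂ refl) = inj₁ (same-source⇒same-target C u m m2)

  Sub : List Vtx → Set
  Sub P = ∀ {x y} → (x , y) ∈ arcsOf P → (x , y) ∈ arcsOf C

  allS : ∀ x P → Sub (x ∷ P) → S x → All S (x ∷ P)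
  allS x [] sub s = s ∷ []
  allS x (y ∷ P) sub s = s ∷ allS y P (λ mm → sub (there mm)) (clo (sub (here refl)) s)

  lastS : ∀ x P → Sub (x ∷ P) → S x → S (lastOr x P)
  lastS x [] sub s = s
  lastS x (y ∷ P) sub s = lastS y P (λ mm → sub (there mm)) (clo (sub (here refl)) s)

  findS : ∀ x P → Sub (x ∷ P) → ∀ {a b} → (a , b) ∈ arcsOf (x ∷ P) → S a → S (lastOr x P)
  findS x [] sub ()
  findS x (y ∷ P) sub (here refl) s = lastS x (y ∷ P) sub s
  findS x (y ∷ P) sub (there mm) s = findS y P (λ m' → sub (there m')) mm s

back-and-forth⇒short : ∀ c cs → (cl : Closed (c ∷ cs)) → (u : Unique (dropLast (c ∷ cs))) → ∀ {v w} →
  (v , w) ∈ arcsOf (c ∷ cs) → (w , v) ∈ arcsOf (c ∷ cs) → length (dropLast (c ∷ cs)) ℕ.≤ 2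
back-and-forth⇒short c cs cl u {v} {w} m1 m2 =
  pigeonhole-2 (dropLast (c ∷ cs)) u (All-dropLast (c ∷ cs) (allS c cs (λ m → m) sc))
  where
  open BackAndForth (c ∷ cs) cl u m1 m2
  sc : S c
  sc = subst S cl (findS c cs (λ m → m) m1 (inj₁ refl))

Vtx-≡ : ∀ {v v' : Vtx} → proj₁ v ≡ proj₁ v' → proj₂ v ≡ proj₂ v' → v ≡ v'
Vtx-≡ refl refl = refl

i-j≡k⇒i≡j+k : ∀ {a b k} → a - b ≡ k → a ≡ b ℤ.+ k
i-j≡k⇒i≡j+k {a} {b} {k} e = trans (sym (lem a b)) (cong (λ z → b ℤ.+ z) e)
  where
  lem : ∀ a b → b ℤ.+ (a - b) ≡ a
  lem = solve-∀

back-and-forth⇒short′ : ∀ C → Closed C → Unique (dropLast C) → ∀ {v w} →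
  (v , w) ∈ arcsOf C → (w , v) ∈ arcsOf C → length (dropLast C) ℕ.≤ 2
back-and-forth⇒short′ (c ∷ cs) cl u m1 m2 = back-and-forth⇒short c cs cl u m1 m2

j-i≡k⇒i-j≡-k : ∀ {a b k} → b - a ≡ k → a - b ≡ - k
j-i≡k⇒i-j≡-k {a} {b} {k} e = trans (sym (lem a b)) (cong -_ e)
  where
  lem : ∀ a b → - (b - a) ≡ a - b
  lem = solve-∀

i-k≡j-k⇒i≡j : ∀ {a b c k} → a - c ≡ k → b - c ≡ k → a ≡ b
i-k≡j-k⇒i≡j {a} {b} {c} e1 e2 = trans (i-j≡k⇒i≡j+k e1) (sym (i-j≡k⇒i≡j+k e2))

k-i≡k-j⇒i≡j : ∀ {a b c k} → c - a ≡ k → c - b ≡ k → a ≡ b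
k-i≡k-j⇒i≡j {a} {b} {c} {k} e1 e2 = trans (sym (lem a c)) (trans (cong (λ w → c - w) (trans e1 (sym e2))) (lem b c))
  where
  lem : ∀ a c → c - (c - a) ≡ a
  lem = solve-∀

i-j≡0⇒i≡j : ∀ {a b} → a - b ≡ 0ℤ → a ≡ b
i-j≡0⇒i≡j {a} {b} e = trans (i-j≡k⇒i≡j+k e) (ℤP.+-identityʳ b)

i-j≡k⇒j-l≡-k⇒i≡l : ∀ {a b c k} → a - b ≡ k → b - c ≡ - k → a ≡ c
i-j≡k⇒j-l≡-k⇒i≡l {a} {b} {c} {k} e1 e2 = trans (i-j≡k⇒i≡j+k e1) (trans (cong (ℤ._+ k) (i-j≡k⇒i≡j+k {b} {c} { - k} e2)) (lem c k))
  where
  lem : ∀ c k → c ℤ.+ - k ℤ.+ k ≡ c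
  lem = solve-∀

coordBound : List Vtx → ℕ
coordBound [] = 0
coordBound (((x , y) , t) ∷ vs) = ℤ.∣ x ∣ ℕ.+ ℤ.∣ y ∣ ℕ.+ coordBound vs

i≤∣i∣ : ∀ i → i ℤ.≤ + ℤ.∣ i ∣
i≤∣i∣ (+ n) = ℤP.≤-refl
i≤∣i∣ ℤ.-[1+ n ] = ℤ.-≤+

-∣i∣≤i : ∀ i → - (+ ℤ.∣ i ∣) ℤ.≤ i
-∣i∣≤i (+ n) = ℤP.neg-≤-pos
-∣i∣≤i ℤ.-[1+ n ] = ℤP.≤-refl

+mono : ∀ {m n} → m ℕ.≤ n → + m ℤ.≤ + n
+mono = ℤ.+≤+

coordBound-x : ∀ {v} C → v ∈ C → ℤ.∣ proj₁ (pt v) ∣ ℕ.≤ coordBound C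
coordBound-x (((x , y) , t) ∷ vs) (here refl) = ℕP.≤-trans (ℕP.m≤m+n ℤ.∣ x ∣ ℤ.∣ y ∣) (ℕP.m≤m+n _ (coordBound vs))
coordBound-x (((x , y) , t) ∷ vs) (there m) = ℕP.≤-trans (coordBound-x vs m) (ℕP.m≤n+m (coordBound vs) _)

coordBound-y : ∀ {v} C → v ∈ C → ℤ.∣ proj₂ (pt v) ∣ ℕ.≤ coordBound C
coordBound-y (((x , y) , t) ∷ vs) (here refl) = ℕP.≤-trans (ℕP.m≤n+m ℤ.∣ y ∣ ℤ.∣ x ∣) (ℕP.m≤m+n _ (coordBound vs))
coordBound-y (((x , y) , t) ∷ vs) (there m) = ℕP.≤-trans (coordBound-y vs m) (ℕP.m≤n+m (coordBound vs) _)

y≤coordBound : ∀ {v} C → v ∈ C → proj₂ (pt v) ℤ.≤ + coordBound C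
y≤coordBound C m = ℤP.≤-trans (i≤∣i∣ _) (+mono (coordBound-y C m))

windStep-below : ∀ a b v w → ¬ (b ℤ.< proj₂ (pt v)) → windStep (a , b) v w ≡ 0ℤ
windStep-below a b ((x , y) , t) ((x' , y') , u) nlt rewrite isLess-false nlt | ∧-zeroʳ (y == y') = refl

winding-above-path : ∀ a b P → (∀ {v} → v ∈ P → ¬ (b ℤ.< proj₂ (pt v))) → pathSum (windStep (a , b)) P ≡ 0ℤ
winding-above-path a b [] h = refl
winding-above-path a b (v ∷ []) h = refl
winding-above-path a b (v ∷ w ∷ vs) h =
  trans (cong₂ ℤ._+_ (windStep-below a b v w (h (here refl))) (winding-above-path a b (w ∷ vs) (λ m → h (there m)))) refl

-- Winding numbers of an elementary cycle

-- The winding number jumps by one across every arc; at each vertex the cells on the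
-- right of the incoming and the outgoing arc have the same winding number, so it is a
-- constant k0 on the right of the whole cycle and k0 + 1 on its left.  Walking up a
-- column, the winding number only changes across the cycle, and it is 0 high above it:
-- every winding number is k0 or k0 + 1, and one of them is 0.
module ElementaryCycle (F : Figure) (C : List Vtx) (path : IsPath F C) (cl : Closed C)
              (u : Unique (dropLast C)) (long : 3 ℕ.≤ length (dropLast C)) where

  arcs : AllSteps (Arc F) C
  arcs = path⇒AllSteps C path

  uarcs : AllSteps UnitStep C
  uarcs = AllSteps-map (λ {v} {w} a → Arc⇒UnitStep {F} {v} {w} a) C arcs

  arcOf : ∀ {v w} → (v , w) ∈ arcsOf C → Arc F v w
  arcOf m = AllSteps-lookup C arcs m

  ¬short : length (dropLast C) ℕ.≤ 2 → ⊥
  ¬short le = ℕP.<-irrefl refl (ℕP.≤-trans long le)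

  no-back-and-forth : ∀ {v w} → (v , w) ∈ arcsOf C → (w , v) ∈ arcsOf C → ⊥
  no-back-and-forth {v} {w} m1 m2 = ¬short (back-and-forth⇒short′ C cl u m1 m2)

  arcCount-arc : ∀ {v w} → (v , w) ∈ arcsOf C → arcCount (pt v) (pt w) C ≡ 1ℤ
  arcCount-arc {v} {w} m = arcCount-one (pt v) (pt w) C u m refl refl λ {v'} {w'} m' e1 e2 →
    Vtx-≡ e1 (proj₁ (Arc-tags-determined {F} {pt v} {proj₂ v'} {proj₂ v} {pt w} {proj₂ w'} {proj₂ w} (subst₂ (Arc F) (Vtx-≡ {v'} {pt v , proj₂ v'} e1 refl) (Vtx-≡ {w'} {pt w , proj₂ w'} e2 refl) (arcOf m'))
                           (arcOf m)))

  arcCount-reversed-arc : ∀ {v w} → (v , w) ∈ arcsOf C → arcCount (pt w) (pt v) C ≡ 0ℤ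
  arcCount-reversed-arc {v} {w} m = arcCount-zero (pt w) (pt v) C λ { (v' , w' , m' , e1 , e2) →
    let a1 = subst₂ (Arc F) (Vtx-≡ {v'} {pt w , proj₂ v'} e1 refl) (Vtx-≡ {w'} {pt v , proj₂ w'} e2 refl) (arcOf m')
        td = Arc-tags-determined {F} {pt w} {proj₂ w} {proj₂ v'} {pt v} {proj₂ v} {proj₂ w'} (Arc-sym {F} {v} {w} (arcOf m)) a1
        ev' : v' ≡ w
        ev' = Vtx-≡ e1 (sym (proj₁ td))
        ew' : w' ≡ v
        ew' = Vtx-≡ e2 (sym (proj₂ td))
    in no-back-and-forth m (subst₂ (λ a b → (a , b) ∈ arcsOf C) ev' ew' m') }

  winding-left≡right+1 : ∀ {v w} → (v , w) ∈ arcsOf C → ∀ d → pt w ≡ move d (pt v) →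
        winding C (leftCell (pt v) d) ≡ winding C (rightCell (pt v) d) ℤ.+ 1ℤ
  winding-left≡right+1 {(x , y) , t} {w} m d e = go d e
    where
    c1 : arcCount (x , y) (pt w) C ≡ 1ℤ
    c1 = arcCount-arc m
    c0 : arcCount (pt w) (x , y) C ≡ 0ℤ
    c0 = arcCount-reversed-arc m
    go : ∀ d → pt w ≡ move d (x , y) → winding C (leftCell (x , y) d) ≡ winding C (rightCell (x , y) d) ℤ.+ 1ℤ
    go dE e = i-j≡k⇒i≡j+k {winding C (x , y)} {winding C (x , y - 1ℤ)} {1ℤ} (j-i≡k⇒i-j≡-k {winding C (x , y)} {winding C (x , y - 1ℤ)} {0ℤ - 1ℤ} (trans h (cong₂ _-_ (subst (λ z → arcCount z (x , y) C ≡ 0ℤ) e c0) (subst (λ z → arcCount (x , y) z C ≡ 1ℤ) e c1))))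
      where
      h : winding C (x , y - 1ℤ) - winding C (x , y) ≡ arcCount (x ℤ.+ 1ℤ , y) (x , y) C - arcCount (x , y) (x ℤ.+ 1ℤ , y) C
      h = subst (λ z → winding C (x , y - 1ℤ) - winding C (x , z) ≡ arcCount (x ℤ.+ 1ℤ , z) (x , z) C - arcCount (x , z) (x ℤ.+ 1ℤ , z) C)
                (i-1+1≡i y) (winding-vertical-jump x (y - 1ℤ) C uarcs)
    go dW e = i-j≡k⇒i≡j+k (trans h (cong₂ _-_ (subst (λ z → arcCount (x , y) z C ≡ 1ℤ) e c1) (subst (λ z → arcCount z (x , y) C ≡ 0ℤ) e c0)))
      where
      h : winding C (x - 1ℤ , y - 1ℤ) - winding C (x - 1ℤ , y) ≡ arcCount (x , y) (x - 1ℤ , y) C - arcCount (x - 1ℤ , y) (x , y) C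
      h = subst (λ z → winding C (x - 1ℤ , y - 1ℤ) - winding C (x - 1ℤ , y) ≡ arcCount (z , y) (x - 1ℤ , y) C - arcCount (x - 1ℤ , y) (z , y) C)
                (i-1+1≡i x)
          (subst (λ z → winding C (x - 1ℤ , y - 1ℤ) - winding C (x - 1ℤ , z) ≡ arcCount (x - 1ℤ ℤ.+ 1ℤ , z) (x - 1ℤ , z) C - arcCount (x - 1ℤ , z) (x - 1ℤ ℤ.+ 1ℤ , z) C)
                (i-1+1≡i y) (winding-vertical-jump (x - 1ℤ) (y - 1ℤ) C uarcs))
    go dN e = i-j≡k⇒i≡j+k {winding C (x - 1ℤ , y)} {winding C (x , y)} {1ℤ} (j-i≡k⇒i-j≡-k {winding C (x - 1ℤ , y)} {winding C (x , y)} {0ℤ - (1ℤ - 0ℤ)} (trans h (cong (λ z → 0ℤ - z) (cong₂ _-_ (subst (λ z → arcCount (x , y) z C ≡ 1ℤ) e c1) (subst (λ z → arcCount z (x , y) C ≡ 0ℤ) e c0)))))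
      where
      h : winding C (x , y) - winding C (x - 1ℤ , y) ≡ 0ℤ - (arcCount (x , y) (x , y ℤ.+ 1ℤ) C - arcCount (x , y ℤ.+ 1ℤ) (x , y) C)
      h = subst (λ z → winding C (z , y) - winding C (x - 1ℤ , y) ≡ 0ℤ - (arcCount (z , y) (z , y ℤ.+ 1ℤ) C - arcCount (z , y ℤ.+ 1ℤ) (z , y) C))
                (i-1+1≡i x) (winding-horizontal-jump (x - 1ℤ) y C uarcs cl)
    go dS e = i-j≡k⇒i≡j+k (trans h (cong (λ z → 0ℤ - z) (cong₂ _-_ (subst (λ z → arcCount z (x , y) C ≡ 0ℤ) e c0) (subst (λ z → arcCount (x , y) z C ≡ 1ℤ) e c1))))
      where
      h : winding C (x , y - 1ℤ) - winding C (x - 1ℤ , y - 1ℤ) ≡ 0ℤ - (arcCount (x , y - 1ℤ) (x , y) C - arcCount (x , y) (x , y - 1ℤ) C)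
      h = subst (λ z → winding C (x , y - 1ℤ) - winding C (x - 1ℤ , y - 1ℤ) ≡ 0ℤ - (arcCount (x , y - 1ℤ) (x , z) C - arcCount (x , z) (x , y - 1ℤ) C))
                (i-1+1≡i y)
          (subst (λ z → winding C (z , y - 1ℤ) - winding C (x - 1ℤ , y - 1ℤ) ≡ 0ℤ - (arcCount (z , y - 1ℤ) (z , y - 1ℤ ℤ.+ 1ℤ) C - arcCount (z , y - 1ℤ ℤ.+ 1ℤ) (z , y - 1ℤ) C))
                (i-1+1≡i x) (winding-horizontal-jump (x - 1ℤ) (y - 1ℤ) C uarcs cl))

  netFlow : Point → Dir → ℤ
  netFlow q Z = arcCount (move Z q) q C - arcCount q (move Z q) C

  jump-north : ∀ x y → winding C (x , y) - winding C (x - 1ℤ , y) ≡ netFlow (x , y) dN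
  jump-north x y = trans h (lem (arcCount (x , y) (x , y ℤ.+ 1ℤ) C) (arcCount (x , y ℤ.+ 1ℤ) (x , y) C))
    where
    lem : ∀ a b → 0ℤ - (a - b) ≡ b - a
    lem = solve-∀
    h : winding C (x , y) - winding C (x - 1ℤ , y) ≡ 0ℤ - (arcCount (x , y) (x , y ℤ.+ 1ℤ) C - arcCount (x , y ℤ.+ 1ℤ) (x , y) C)
    h = subst (λ z → winding C (z , y) - winding C (x - 1ℤ , y) ≡ 0ℤ - (arcCount (z , y) (z , y ℤ.+ 1ℤ) C - arcCount (z , y ℤ.+ 1ℤ) (z , y) C))
              (i-1+1≡i x) (winding-horizontal-jump (x - 1ℤ) y C uarcs cl)

  jump-south : ∀ x y → winding C (x , y - 1ℤ) - winding C (x - 1ℤ , y - 1ℤ) ≡ 0ℤ - netFlow (x , y) dS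
  jump-south x y = subst (λ z → winding C (x , y - 1ℤ) - winding C (x - 1ℤ , y - 1ℤ) ≡ 0ℤ - (arcCount (x , y - 1ℤ) (x , z) C - arcCount (x , z) (x , y - 1ℤ) C))
                (i-1+1≡i y)
          (subst (λ z → winding C (z , y - 1ℤ) - winding C (x - 1ℤ , y - 1ℤ) ≡ 0ℤ - (arcCount (z , y - 1ℤ) (z , y - 1ℤ ℤ.+ 1ℤ) C - arcCount (z , y - 1ℤ ℤ.+ 1ℤ) (z , y - 1ℤ) C))
                (i-1+1≡i x) (winding-horizontal-jump (x - 1ℤ) (y - 1ℤ) C uarcs cl))

  jump-east : ∀ x y → winding C (x , y - 1ℤ) - winding C (x , y) ≡ netFlow (x , y) dE
  jump-east x y = subst (λ z → winding C (x , y - 1ℤ) - winding C (x , z) ≡ arcCount (x ℤ.+ 1ℤ , z) (x , z) C - arcCount (x , z) (x ℤ.+ 1ℤ , z) C)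
                (i-1+1≡i y) (winding-vertical-jump x (y - 1ℤ) C uarcs)

  jump-west : ∀ x y → winding C (x - 1ℤ , y - 1ℤ) - winding C (x - 1ℤ , y) ≡ 0ℤ - netFlow (x , y) dW
  jump-west x y = trans h (lem (arcCount (x , y) (x - 1ℤ , y) C) (arcCount (x - 1ℤ , y) (x , y) C))
    where
    lem : ∀ a b → a - b ≡ 0ℤ - (b - a)
    lem = solve-∀
    h : winding C (x - 1ℤ , y - 1ℤ) - winding C (x - 1ℤ , y) ≡ arcCount (x , y) (x - 1ℤ , y) C - arcCount (x - 1ℤ , y) (x , y) C
    h = subst (λ z → winding C (x - 1ℤ , y - 1ℤ) - winding C (x - 1ℤ , y) ≡ arcCount (z , y) (x - 1ℤ , y) C - arcCount (x - 1ℤ , y) (z , y) C)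
                (i-1+1≡i x)
          (subst (λ z → winding C (x - 1ℤ , y - 1ℤ) - winding C (x - 1ℤ , z) ≡ arcCount (x - 1ℤ ℤ.+ 1ℤ , z) (x - 1ℤ , z) C - arcCount (x - 1ℤ , z) (x - 1ℤ ℤ.+ 1ℤ , z) C)
                (i-1+1≡i y) (winding-vertical-jump (x - 1ℤ) (y - 1ℤ) C uarcs))

  netFlow-in : ∀ {u' v} → (u' , v) ∈ arcsOf C → ∀ d → pt v ≡ move d (pt u') → netFlow (pt v) (opposite d) ≡ 1ℤ
  netFlow-in {u'} {v} m d e = subst (λ p → arcCount p (pt v) C - arcCount (pt v) p C ≡ 1ℤ) (sym pe)
                          (cong₂ _-_ (arcCount-arc m) (arcCount-reversed-arc m))
    where
    pe : move (opposite d) (pt v) ≡ pt u'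
    pe = trans (cong (move (opposite d)) e) (move-opposite d (pt u'))

  netFlow-out : ∀ {v z} → (v , z) ∈ arcsOf C → ∀ d → pt z ≡ move d (pt v) → netFlow (pt v) d ≡ - 1ℤ
  netFlow-out {v} {z} m d e = subst (λ p → arcCount p (pt v) C - arcCount (pt v) p C ≡ - 1ℤ) e
                          (cong₂ _-_ (arcCount-reversed-arc m) (arcCount-arc m))

  netFlow-side : ∀ {u' v z} → (u' , v) ∈ arcsOf C → (v , z) ∈ arcsOf C → ∀ d →
             pt v ≡ move d (pt u') → pt z ≡ move d (pt v) →
             ∀ Z → Z ≢ opposite d → Z ≢ d → netFlow (pt v) Z ≡ 0ℤ
  netFlow-side {u'} {v} {z} m1 m2 d e1 e2 Z n1 n2 = cong₂ _-_ cin cout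
    where
    q = pt v
    np : isPinch F q ≡ false
    np = straight⇒¬pinch {F} {pt u'} {proj₂ u'} {pt v} {proj₂ v} {pt z} {proj₂ z} d (arcOf m1) (arcOf m2) e1 e2
    tv : proj₂ v ≡ false
    tv = ¬pinch⇒source-tag {F} {pt v} {proj₂ v} {z} (arcOf m2) np
    cin : arcCount (move Z q) q C ≡ 0ℤ
    cin = arcCount-zero (move Z q) q C λ { (a , b , mm , g1 , g2) →
      let bv : b ≡ v
          bv = Vtx-≡ (trans g2 refl) (trans (¬pinch⇒target-tag {F} {a} {pt b} {proj₂ b} (arcOf mm) (subst (λ p → isPinch F p ≡ false) (sym g2) np)) (sym tv))
          au : a ≡ u'
          au = same-target⇒same-source C cl u (subst (λ w → (a , w) ∈ arcsOf C) bv mm) m1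
      in n1 (move-injective q (trans (sym g1) (trans (cong pt au) (sym (trans (cong (move (opposite d)) e1) (move-opposite d (pt u'))))))) }
    cout : arcCount q (move Z q) C ≡ 0ℤ
    cout = arcCount-zero q (move Z q) C λ { (a , b , mm , g1 , g2) →
      let av : a ≡ v
          av = Vtx-≡ g1 (trans (¬pinch⇒source-tag {F} {pt a} {proj₂ a} {b} (arcOf mm) (subst (λ p → isPinch F p ≡ false) (sym g1) np)) (sym tv))
          bz : b ≡ z
          bz = same-source⇒same-target C u (subst (λ w → (w , b) ∈ arcsOf C) av mm) m2
      in n2 (move-injective q (trans (sym g2) (trans (cong pt bz) e2))) }

  winding-at-turn : ∀ {u' v z} → (u' , v) ∈ arcsOf C → (v , z) ∈ arcsOf C → ∀ d1 d2 →
    pt v ≡ move d1 (pt u') → pt z ≡ move d2 (pt v) →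
    winding C (leftCell (pt v) (opposite d1)) ≡ winding C (rightCell (pt v) d2)
  winding-at-turn {u'} {(x , y) , t} {z} m1 m2 d1 d2 e1 e2 = go d1 d2 e1 e2
    where
    v = (x , y) , t
    1≢-1 : ∀ {a : ℤ} → a ≡ 1ℤ → a ≡ - 1ℤ → ⊥
    1≢-1 e e' with trans (sym e) e'
    ... | ()
    go : ∀ d1 d2 → pt v ≡ move d1 (pt u') → pt z ≡ move d2 (pt v) →
         winding C (leftCell (x , y) (opposite d1)) ≡ winding C (rightCell (x , y) d2)
    go dE dE e1 e2 = sym (i-j≡0⇒i≡j (trans (jump-south x y) (cong (λ w → 0ℤ - w) (netFlow-side m1 m2 dE e1 e2 dS (λ ()) (λ ())))))
    go dE dN e1 e2 = i-k≡j-k⇒i≡j (trans (jump-west x y) (cong (λ w → 0ℤ - w) (netFlow-in m1 dE e1))) (trans (jump-north x y) (netFlow-out m2 dN e2))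
    go dE dS e1 e2 = refl
    go dE dW e1 e2 = ⊥-elim (1≢-1 (netFlow-in m1 dE e1) (netFlow-out m2 dW e2))
    go dN dN e1 e2 = i-j≡0⇒i≡j (trans (jump-east x y) (netFlow-side m1 m2 dN e1 e2 dE (λ ()) (λ ())))
    go dN dE e1 e2 = refl
    go dN dW e1 e2 = i-j≡k⇒j-l≡-k⇒i≡l (trans (jump-south x y) (cong (λ w → 0ℤ - w) (netFlow-in m1 dN e1))) (trans (jump-west x y) (cong (λ w → 0ℤ - w) (netFlow-out m2 dW e2)))
    go dN dS e1 e2 = ⊥-elim (1≢-1 (netFlow-in m1 dN e1) (netFlow-out m2 dS e2))
    go dW dW e1 e2 = i-j≡0⇒i≡j (trans (jump-north x y) (netFlow-side m1 m2 dW e1 e2 dN (λ ()) (λ ())))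
    go dW dN e1 e2 = refl
    go dW dS e1 e2 = k-i≡k-j⇒i≡j {winding C (x , y)} {winding C (x - 1ℤ , y - 1ℤ)} {winding C (x , y - 1ℤ)} (trans (jump-east x y) (netFlow-in m1 dW e1)) (trans (jump-south x y) (cong (λ w → 0ℤ - w) (netFlow-out m2 dS e2)))
    go dW dE e1 e2 = ⊥-elim (1≢-1 (netFlow-in m1 dW e1) (netFlow-out m2 dE e2))
    go dS dS e1 e2 = sym (i-j≡0⇒i≡j (trans (jump-west x y) (cong (λ w → 0ℤ - w) (netFlow-side m1 m2 dS e1 e2 dW (λ ()) (λ ())))))
    go dS dW e1 e2 = refl
    go dS dE e1 e2 = sym (i-j≡k⇒j-l≡-k⇒i≡l (trans (jump-east x y) (netFlow-out m2 dE e2)) (trans (jump-north x y) (netFlow-in m1 dS e1)))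
    go dS dN e1 e2 = ⊥-elim (1≢-1 (netFlow-in m1 dS e1) (netFlow-out m2 dN e2))

  winding-right-consecutive : ∀ {u' v z} → (u' , v) ∈ arcsOf C → (v , z) ∈ arcsOf C → ∀ d1 d2 →
    pt v ≡ move d1 (pt u') → pt z ≡ move d2 (pt v) →
    winding C (rightCell (pt u') d1) ≡ winding C (rightCell (pt v) d2)
  winding-right-consecutive {u'} {v} {z} m1 m2 d1 d2 e1 e2 =
    trans (cong (winding C) (trans (rightCell-opposite d1 (pt u')) (cong (λ p → leftCell p (opposite d1)) (sym e1))))
          (winding-at-turn m1 m2 d1 d2 e1 e2)

  dirOf : ∀ {v w} → (v , w) ∈ arcsOf C → Σ Dir λ d → pt w ≡ move d (pt v)
  dirOf m = AllSteps-lookup C uarcs m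

  SubC : List Vtx → Set
  SubC P = ∀ {x y} → (x , y) ∈ arcsOf P → (x , y) ∈ arcsOf C

  winding-right-along : ∀ a b rest → SubC (a ∷ b ∷ rest) → ∀ d0 → pt b ≡ move d0 (pt a) →
         ∀ {v w} → (v , w) ∈ arcsOf (a ∷ b ∷ rest) → ∀ d → pt w ≡ move d (pt v) →
         winding C (rightCell (pt v) d) ≡ winding C (rightCell (pt a) d0)
  winding-right-along a b rest sub d0 e0 (here refl) d e with move-injective {d} {d0} (pt a) (trans (sym e) e0)
  ... | refl = refl
  winding-right-along a b (c ∷ rest) sub d0 e0 (there m) d e with dirOf (sub (there (here refl)))
  ... | d1 , e1 = trans (winding-right-along b c rest (λ mm → sub (there mm)) d1 e1 m d e)
                        (sym (winding-right-consecutive (sub (here refl)) (sub (there (here refl))) d0 d1 e0 e1))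

  decomp : ∀ P → 3 ℕ.≤ length (dropLast P) → Σ Vtx λ a → Σ Vtx λ b → Σ (List Vtx) λ rest → P ≡ a ∷ b ∷ rest
  decomp (a ∷ b ∷ rest) _ = a , b , rest , refl

  a0 = proj₁ (decomp C long)
  b0 = proj₁ (proj₂ (decomp C long))
  r0 = proj₁ (proj₂ (proj₂ (decomp C long)))
  eqC : C ≡ a0 ∷ b0 ∷ r0
  eqC = proj₂ (proj₂ (proj₂ (decomp C long)))

  m0 : (a0 , b0) ∈ arcsOf C
  m0 = subst (λ P → (a0 , b0) ∈ arcsOf P) (sym eqC) (here refl)

  d0 = proj₁ (dirOf m0)
  e0 = proj₂ (dirOf m0)

  k0 : ℤ
  k0 = winding C (rightCell (pt a0) d0)

  winding-right≡k0 : ∀ {v w} → (v , w) ∈ arcsOf C → ∀ d → pt w ≡ move d (pt v) → winding C (rightCell (pt v) d) ≡ k0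
  winding-right≡k0 m d e = winding-right-along a0 b0 r0 (λ mm → subst (λ P → _ ∈ arcsOf P) (sym eqC) mm) d0 e0
                  (subst (λ P → _ ∈ arcsOf P) eqC m) d e

  winding-left≡k0+1 : ∀ {v w} → (v , w) ∈ arcsOf C → ∀ d → pt w ≡ move d (pt v) → winding C (leftCell (pt v) d) ≡ k0 ℤ.+ 1ℤ
  winding-left≡k0+1 m d e = trans (winding-left≡right+1 m d e) (cong (ℤ._+ 1ℤ) (winding-right≡k0 m d e))

  IsLevel : ℤ → Set
  IsLevel z = z ≡ k0 ⊎ z ≡ k0 ℤ.+ 1ℤ

  column-step : ∀ a b → winding C (a , b) ≡ winding C (a , b ℤ.+ 1ℤ) ⊎ (IsLevel (winding C (a , b)) × IsLevel (winding C (a , b ℤ.+ 1ℤ)))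
  column-step a b with arcCount-cases (a ℤ.+ 1ℤ , b ℤ.+ 1ℤ) (a , b ℤ.+ 1ℤ) C | arcCount-cases (a , b ℤ.+ 1ℤ) (a ℤ.+ 1ℤ , b ℤ.+ 1ℤ) C
  ... | inj₁ z1 | inj₁ z2 = inj₁ (i-j≡0⇒i≡j (trans (winding-vertical-jump a b C uarcs) (cong₂ _-_ z1 z2)))
  ... | inj₂ (v , w , m , g1 , g2) | _ = inj₂ (inj₂ L , inj₁ R)
    where
    dd = dirOf m
    mvW : move dW (a ℤ.+ 1ℤ , b ℤ.+ 1ℤ) ≡ (a , b ℤ.+ 1ℤ)
    mvW = pair≡ (i+1-1≡i a) refl
    dW≡ : proj₁ dd ≡ dW
    dW≡ = move-injective (a ℤ.+ 1ℤ , b ℤ.+ 1ℤ) (trans (sym (subst (λ p → pt w ≡ move (proj₁ dd) p) g1 (proj₂ dd))) (trans g2 (sym mvW)))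
    e' : pt w ≡ move dW (pt v)
    e' = subst (λ d → pt w ≡ move d (pt v)) dW≡ (proj₂ dd)
    L : winding C (a , b) ≡ k0 ℤ.+ 1ℤ
    L = trans (cong (winding C) (sym (trans (cong (λ p → leftCell p dW) g1) (pair≡ (i+1-1≡i a) (i+1-1≡i b))))) (winding-left≡k0+1 m dW e')
    R : winding C (a , b ℤ.+ 1ℤ) ≡ k0
    R = trans (cong (winding C) (sym (trans (cong (λ p → rightCell p dW) g1) (pair≡ (i+1-1≡i a) refl)))) (winding-right≡k0 m dW e')
  ... | inj₁ _ | inj₂ (v , w , m , g1 , g2) = inj₂ (inj₁ R , inj₂ L)
    where
    dd = dirOf m
    dE≡ : proj₁ dd ≡ dE
    dE≡ = move-injective (a , b ℤ.+ 1ℤ) (trans (sym (subst (λ p → pt w ≡ move (proj₁ dd) p) g1 (proj₂ dd))) g2)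
    e' : pt w ≡ move dE (pt v)
    e' = subst (λ d → pt w ≡ move d (pt v)) dE≡ (proj₂ dd)
    L : winding C (a , b ℤ.+ 1ℤ) ≡ k0 ℤ.+ 1ℤ
    L = trans (cong (winding C) (sym (cong (λ p → leftCell p dE) g1))) (winding-left≡k0+1 m dE e')
    R : winding C (a , b) ≡ k0
    R = trans (cong (winding C) (sym (trans (cong (λ p → rightCell p dE) g1) (pair≡ refl (i+1-1≡i b))))) (winding-right≡k0 m dE e')

  B : ℤ
  B = + coordBound C

  winding-high : ∀ a b → B ℤ.≤ b → winding C (a , b) ≡ 0ℤ
  winding-high a b le = winding-above-path a b C λ m below → ℤP.<-irrefl refl (ℤP.<-≤-trans below (ℤP.≤-trans (y≤coordBound C m) le))

  shiftle : ∀ b n → B ℤ.≤ b ℤ.+ + suc n → B ℤ.≤ (b ℤ.+ 1ℤ) ℤ.+ + n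
  shiftle b n le = subst (B ℤ.≤_) (lem b n) le
    where
    lem : ∀ b n → b ℤ.+ + suc n ≡ b ℤ.+ 1ℤ ℤ.+ + n
    lem b n = trans (cong (λ z → b ℤ.+ z) (ℤP.pos-+ 1 n)) (sym (ℤP.+-assoc b 1ℤ (+ n)))

  column-level-or-zero : ∀ n a b → B ℤ.≤ b ℤ.+ + n → IsLevel (winding C (a , b)) ⊎ winding C (a , b) ≡ 0ℤ
  column-level-or-zero zero a b le = inj₂ (winding-high a b (subst (B ℤ.≤_) (ℤP.+-identityʳ b) le))
  column-level-or-zero (suc n) a b le with column-step a b
  ... | inj₂ (s , _) = inj₁ s
  ... | inj₁ e with column-level-or-zero n a (b ℤ.+ 1ℤ) (shiftle b n le)
  ...   | inj₁ s = inj₁ (subst IsLevel (sym e) s)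
  ...   | inj₂ z = inj₂ (trans e z)

  column-reaches-level : ∀ n a b → IsLevel (winding C (a , b)) → B ℤ.≤ b ℤ.+ + n → IsLevel 0ℤ
  column-reaches-level zero a b s le = subst IsLevel (winding-high a b (subst (B ℤ.≤_) (ℤP.+-identityʳ b) le)) s
  column-reaches-level (suc n) a b s le with column-step a b
  ... | inj₂ (_ , s') = column-reaches-level n a (b ℤ.+ 1ℤ) s' (shiftle b n le)
  ... | inj₁ e = column-reaches-level n a (b ℤ.+ 1ℤ) (subst IsLevel e s) (shiftle b n le)

  reach : ∀ b → B ℤ.≤ b ℤ.+ + ℤ.∣ B - b ∣
  reach b = ℤP.≤-trans (ℤP.≤-reflexive (sym (lem B b))) (ℤP.+-monoʳ-≤ b (i≤∣i∣ (B - b)))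
    where
    lem : ∀ B b → b ℤ.+ (B - b) ≡ B
    lem = solve-∀

  zero-isLevel : IsLevel 0ℤ
  zero-isLevel = column-reaches-level ℤ.∣ B - proj₂ (rightCell (pt a0) d0) ∣ (proj₁ (rightCell (pt a0) d0)) (proj₂ (rightCell (pt a0) d0)) (inj₁ refl) (reach (proj₂ (rightCell (pt a0) d0)))

  all-isLevel : ∀ c → IsLevel (winding C c)
  all-isLevel (a , b) with column-level-or-zero ℤ.∣ B - b ∣ a b (reach b)
  ... | inj₁ s = s
  ... | inj₂ z = subst IsLevel (sym z) zero-isLevel

-- Green's formula for the shoelace sum

sumRange : (ℤ → ℤ) → ℤ → ℕ → ℤ
sumRange g z zero = 0ℤ
sumRange g z (suc n) = g z ℤ.+ sumRange g (z ℤ.+ 1ℤ) n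

sumRange-cong : ∀ {g h} → (∀ a → g a ≡ h a) → ∀ z n → sumRange g z n ≡ sumRange h z n
sumRange-cong e z zero = refl
sumRange-cong e z (suc n) = cong₂ ℤ._+_ (e z) (sumRange-cong e (z ℤ.+ 1ℤ) n)

sumRange-pathSum : ∀ (G : ℤ → Vtx → Vtx → ℤ) C z n →
  sumRange (λ a → pathSum (G a) C) z n ≡ pathSum (λ v w → sumRange (λ a → G a v w) z n) C
sumRange-pathSum G C z zero = sym (pathSum-0 C)
sumRange-pathSum G C z (suc n) =
  trans (cong (λ s → pathSum (G z) C ℤ.+ s) (sumRange-pathSum G C (z ℤ.+ 1ℤ) n))
        (sym (pathSum-+ (G z) (λ v w → sumRange (λ a → G a v w) (z ℤ.+ 1ℤ) n) C))

sumRange-0 : ∀ z n → sumRange (λ _ → 0ℤ) z n ≡ 0ℤ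
sumRange-0 z zero = refl
sumRange-0 z (suc n) = trans (ℤP.+-identityˡ _) (sumRange-0 (z ℤ.+ 1ℤ) n)

sumRange-* : ∀ k g z n → sumRange (λ a → k * g a) z n ≡ k * sumRange g z n
sumRange-* k g z zero = sym (ℤP.*-zeroʳ k)
sumRange-* k g z (suc n) rewrite sumRange-* k g (z ℤ.+ 1ℤ) n = sym (ℤP.*-distribˡ-+ k (g z) (sumRange g (z ℤ.+ 1ℤ) n))

sumRange-isLess : ∀ m y0 y → y0 ℤ.≤ y → y ℤ.≤ y0 ℤ.+ + m → sumRange (λ b → if isLess b y then 1ℤ else 0ℤ) y0 m ≡ y - y0
sumRange-isLess zero y0 y le1 le2 = sym (trans (cong (_- y0) (ℤP.≤-antisym le2' le1)) (ℤP.+-inverseʳ y0))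
  where
  le2' : y ℤ.≤ y0
  le2' = subst (y ℤ.≤_) (ℤP.+-identityʳ y0) le2
sumRange-isLess (suc m) y0 y le1 le2 with y0 ℤ.≟ y
... | yes refl = trans (cong₂ ℤ._+_ (cong (λ c → if c then 1ℤ else 0ℤ) (isLess-irrefl y0)) (allz m (y0 ℤ.+ 1ℤ) (ℤP.<⇒≤ (i<i+1 y0)))) (sym (ℤP.+-inverseʳ y0))
  where
  allz : ∀ m z → y0 ℤ.≤ z → sumRange (λ b → if isLess b y0 then 1ℤ else 0ℤ) z m ≡ 0ℤ
  allz zero z _ = refl
  allz (suc m) z le = trans (cong₂ ℤ._+_ (cong (λ c → if c then 1ℤ else 0ℤ) (isLess-false (λ p → ℤP.<-irrefl refl (ℤP.≤-<-trans le p)))) (allz m (z ℤ.+ 1ℤ) (ℤP.≤-trans le (ℤP.<⇒≤ (i<i+1 z))))) refl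
... | no ne = trans (cong₂ ℤ._+_ (cong (λ c → if c then 1ℤ else 0ℤ) (isLess-true lt0))
                       (sumRange-isLess m (y0 ℤ.+ 1ℤ) y (subst (ℤ._≤ y) (ℤP.+-comm 1ℤ y0) (ℤP.i<j⇒suc[i]≤j lt0)) le2'))
                 (lem y y0)
  where
  lt0 : y0 ℤ.< y
  lt0 = ℤP.≤∧≢⇒< le1 ne
  le2' : y ℤ.≤ y0 ℤ.+ 1ℤ ℤ.+ + m
  le2' = subst (y ℤ.≤_) (trans (cong (λ z → y0 ℤ.+ z) (ℤP.pos-+ 1 m)) (sym (ℤP.+-assoc y0 1ℤ (+ m)))) le2
  lem : ∀ y y0 → 1ℤ ℤ.+ (y - (y0 ℤ.+ 1ℤ)) ≡ y - y0
  lem = solve-∀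

sumRange-==-outside : ∀ n z x K → x ℤ.< z → sumRange (λ a → if x == a then K else 0ℤ) z n ≡ 0ℤ
sumRange-==-outside zero z x K lt = refl
sumRange-==-outside (suc n) z x K lt =
  trans (cong₂ ℤ._+_ (cong (λ c → if c then K else 0ℤ) (==-false (λ e → ℤP.<-irrefl e lt)))
                     (sumRange-==-outside n (z ℤ.+ 1ℤ) x K (ℤP.<-trans lt (i<i+1 z))))
        refl

sumRange-==-inside : ∀ n z x K → z ℤ.≤ x → x ℤ.< z ℤ.+ + n → sumRange (λ a → if x == a then K else 0ℤ) z n ≡ K
sumRange-==-inside zero z x K le lt = ⊥-elim (ℤP.<-irrefl refl (ℤP.<-≤-trans lt (subst (ℤ._≤ x) (sym (ℤP.+-identityʳ z)) le)))
sumRange-==-inside (suc n) z x K le lt with x ℤ.≟ z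
... | yes refl = trans (cong (λ w → K ℤ.+ w) (sumRange-==-outside n (x ℤ.+ 1ℤ) x K (i<i+1 x))) (ℤP.+-identityʳ K)
... | no ne = trans (cong (λ w → 0ℤ ℤ.+ w)
                        (sumRange-==-inside n (z ℤ.+ 1ℤ) x K (subst (ℤ._≤ x) (ℤP.+-comm 1ℤ z) (ℤP.i<j⇒suc[i]≤j (ℤP.≤∧≢⇒< le (λ e → ne (sym e)))))
                              (subst (x ℤ.<_) (trans (cong (λ w → z ℤ.+ w) (ℤP.pos-+ 1 n)) (sym (ℤP.+-assoc z 1ℤ (+ n)))) lt)))
                  (ℤP.+-identityˡ K)

sumRange-isLess∧ : ∀ m y0 y k c → y0 ℤ.≤ y → y ℤ.≤ y0 ℤ.+ + m →
        sumRange (λ b → if isLess b y ∧ c then k else 0ℤ) y0 m ≡ (if c then k * (y - y0) else 0ℤ)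
sumRange-isLess∧ m y0 y k false le1 le2 = trans (sumRange-cong (λ b → cong (λ c → if c then k else 0ℤ) (∧-zeroʳ (isLess b y))) y0 m) (sumRange-0 y0 m)
sumRange-isLess∧ m y0 y k true le1 le2 =
  trans (sumRange-cong (λ b → trans (cong (λ c → if c then k else 0ℤ) (∧-identityʳ (isLess b y))) (f (isLess b y))) y0 m)
        (trans (sumRange-* k (λ b → if isLess b y then 1ℤ else 0ℤ) y0 m) (cong (k *_) (sumRange-isLess m y0 y le1 le2)))
  where
  f : ∀ c → (if c then k else 0ℤ) ≡ k * (if c then 1ℤ else 0ℤ)
  f true = sym (ℤP.*-identityʳ k)
  f false = sym (ℤP.*-zeroʳ k)

record Box : Set where
  constructor box
  field
    x0 : ℤ
    n : ℕ
    y0 : ℤ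
    m : ℕ
open Box public

boxSum : Box → (Cell → ℤ) → ℤ
boxSum bx f = sumRange (λ a → sumRange (λ b → f (a , b)) (y0 bx) (m bx)) (x0 bx) (n bx)

InBox : Box → Point → Set
InBox bx (x , y) = (x0 bx ℤ.≤ x - 1ℤ) × (x ℤ.< x0 bx ℤ.+ + n bx) × (y0 bx ℤ.≤ y) × (y ℤ.≤ y0 bx ℤ.+ + m bx)

shoelaceNF : Dir → ℤ → ℤ → ℤ
shoelaceNF dE y y0 = - 1ℤ * (y - y0)
shoelaceNF dW y y0 = 1ℤ * (y - y0)
shoelaceNF dN y y0 = 0ℤ
shoelaceNF dS y y0 = 0ℤ

boxSum-windStepNF : ∀ bx d x y → InBox bx (x , y) →
  sumRange (λ a → sumRange (λ b → windStepNF d a b x y) (y0 bx) (m bx)) (x0 bx) (n bx) ≡ shoelaceNF d y (y0 bx)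
boxSum-windStepNF (box X0 N Y0 M) dE x y (l1 , l2 , l3 , l4) =
  trans (sumRange-cong (λ a → sumRange-isLess∧ M Y0 y (- 1ℤ) (x == a) l3 l4) X0 N)
        (sumRange-==-inside N X0 x (- 1ℤ * (y - Y0)) (ℤP.≤-trans l1 (ℤP.<⇒≤ (subst (ℤ._< x) refl (ℤP.≤-<-trans ℤP.≤-refl (lemx x))))) l2)
  where
  lemx : ∀ x → x - 1ℤ ℤ.< x
  lemx x = subst (x - 1ℤ ℤ.<_) (i-1+1≡i x) (i<i+1 (x - 1ℤ))
boxSum-windStepNF (box X0 N Y0 M) dW x y (l1 , l2 , l3 , l4) =
  trans (sumRange-cong (λ a → sumRange-isLess∧ M Y0 y 1ℤ (x - 1ℤ == a) l3 l4) X0 N)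
        (sumRange-==-inside N X0 (x - 1ℤ) (1ℤ * (y - Y0)) l1 (ℤP.<-trans (subst (x - 1ℤ ℤ.<_) (i-1+1≡i x) (i<i+1 (x - 1ℤ))) l2))
boxSum-windStepNF (box X0 N Y0 M) dN x y _ = trans (sumRange-cong (λ a → sumRange-0 Y0 M) X0 N) (sumRange-0 X0 N)
boxSum-windStepNF (box X0 N Y0 M) dS x y _ = trans (sumRange-cong (λ a → sumRange-0 Y0 M) X0 N) (sumRange-0 X0 N)

-- Along a unit step, shoelaceStep is twice the crossing count summed over the cells of
-- a box, plus the gradient of shoelacePotential.
shoelacePotential : ℤ → Point → ℤ
shoelacePotential y0 (x , y) = x * y - ℤ.+ 2 * y0 * x

shoelace-move : ∀ d x y y0 t u →
  shoelaceStep ((x , y) , t) (move d (x , y) , u) ≡ ℤ.+ 2 * shoelaceNF d y y0 ℤ.+ (shoelacePotential y0 (move d (x , y)) - shoelacePotential y0 (x , y))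
shoelace-move dE x y y0 t u = lem x y y0
  where
  lem : ∀ x y y0 → x * y - (x ℤ.+ 1ℤ) * y ≡ ℤ.+ 2 * (- 1ℤ * (y - y0)) ℤ.+ (((x ℤ.+ 1ℤ) * y - ℤ.+ 2 * y0 * (x ℤ.+ 1ℤ)) - (x * y - ℤ.+ 2 * y0 * x))
  lem = solve-∀
shoelace-move dW x y y0 t u = lem x y y0
  where
  lem : ∀ x y y0 → x * y - (x - 1ℤ) * y ≡ ℤ.+ 2 * (1ℤ * (y - y0)) ℤ.+ (((x - 1ℤ) * y - ℤ.+ 2 * y0 * (x - 1ℤ)) - (x * y - ℤ.+ 2 * y0 * x))
  lem = solve-∀
shoelace-move dN x y y0 t u = lem x y y0
  where
  lem : ∀ x y y0 → x * (y ℤ.+ 1ℤ) - x * y ≡ ℤ.+ 2 * 0ℤ ℤ.+ ((x * (y ℤ.+ 1ℤ) - ℤ.+ 2 * y0 * x) - (x * y - ℤ.+ 2 * y0 * x))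
  lem = solve-∀
shoelace-move dS x y y0 t u = lem x y y0
  where
  lem : ∀ x y y0 → x * (y - 1ℤ) - x * y ≡ ℤ.+ 2 * 0ℤ ℤ.+ ((x * (y - 1ℤ) - ℤ.+ 2 * y0 * x) - (x * y - ℤ.+ 2 * y0 * x))
  lem = solve-∀

boxWindStep : Box → Vtx → Vtx → ℤ
boxWindStep bx v w = sumRange (λ a → sumRange (λ b → windStep (a , b) v w) (y0 bx) (m bx)) (x0 bx) (n bx)

UnitStepInBox : Box → Vtx → Vtx → Set
UnitStepInBox bx v w = UnitStep v w × InBox bx (proj₁ v)

boxWindStep-move : ∀ bx {v w} → (ub : UnitStepInBox bx v w) → boxWindStep bx v w ≡ shoelaceNF (proj₁ (proj₁ ub)) (proj₂ (proj₁ v)) (y0 bx)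
boxWindStep-move bx {(x , y) , t} {q , u} ((d , refl) , ib) =
  trans (sumRange-cong (λ a → sumRange-cong (λ b → windStep-move d a b x y t u) (y0 bx) (m bx)) (x0 bx) (n bx))
        (boxSum-windStepNF bx d x y ib)

shoelace-unitStep : ∀ bx {v w} → UnitStepInBox bx v w →
  shoelaceStep v w ≡ ℤ.+ 2 * boxWindStep bx v w ℤ.+ (shoelacePotential (y0 bx) (proj₁ w) - shoelacePotential (y0 bx) (proj₁ v))
shoelace-unitStep bx {(x , y) , t} {q , u} ((d , refl) , ib) =
  trans (shoelace-move d x y (y0 bx) t u) (cong (λ z → ℤ.+ 2 * z ℤ.+ (shoelacePotential (y0 bx) (move d (x , y)) - shoelacePotential (y0 bx) (x , y))) (sym (boxWindStep-move bx {(x , y) , t} {move d (x , y) , u} ((d , refl) , ib))))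

shoelace≡2*boxSum-winding : ∀ bx C → Closed C → AllSteps (UnitStepInBox bx) C → pathSum shoelaceStep C ≡ ℤ.+ 2 * boxSum bx (winding C)
shoelace≡2*boxSum-winding bx C cl arcs =
  trans (pathSum-cong {UnitStepInBox bx} shoelaceStep (λ v w → ℤ.+ 2 * boxWindStep bx v w ℤ.+ (shoelacePotential (y0 bx) (proj₁ w) - shoelacePotential (y0 bx) (proj₁ v)))
                (λ {v} {w} ub → shoelace-unitStep bx {v} {w} ub) C arcs)
  (trans (pathSum-+ (λ v w → ℤ.+ 2 * boxWindStep bx v w) (λ v w → shoelacePotential (y0 bx) (proj₁ w) - shoelacePotential (y0 bx) (proj₁ v)) C)
  (trans (cong₂ ℤ._+_ (pathSum-*ˡ (ℤ.+ 2) (boxWindStep bx) C) (pathSum-telescope-closed (λ v → shoelacePotential (y0 bx) (proj₁ v)) C cl))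
  (trans (ℤP.+-identityʳ _)
  (cong (ℤ.+ 2 *_) (sym
    (trans (sumRange-cong (λ a → sumRange-pathSum (λ b → windStep (a , b)) C (y0 bx) (m bx)) (x0 bx) (n bx))
           (sumRange-pathSum (λ a v w → sumRange (λ b → windStep (a , b) v w) (y0 bx) (m bx)) C (x0 bx) (n bx))))))))

sumRange-nonneg : ∀ g z n → (∀ a → 0ℤ ℤ.≤ g a) → 0ℤ ℤ.≤ sumRange g z n
sumRange-nonneg g z zero h = ℤP.≤-refl
sumRange-nonneg g z (suc n) h = ℤP.+-mono-≤ (h z) (sumRange-nonneg g (z ℤ.+ 1ℤ) n h)

sumRange-pos : ∀ g z n → (∀ a → 0ℤ ℤ.≤ g a) → ∀ a → z ℤ.≤ a → a ℤ.< z ℤ.+ + n → 0ℤ ℤ.< g a → 0ℤ ℤ.< sumRange g z n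
sumRange-pos g z zero h a le lt pos = ⊥-elim (ℤP.<-irrefl refl (ℤP.<-≤-trans lt (subst (ℤ._≤ a) (sym (ℤP.+-identityʳ z)) le)))
sumRange-pos g z (suc n) h a le lt pos with a ℤ.≟ z
... | yes refl = ℤP.+-mono-<-≤ pos (sumRange-nonneg g (a ℤ.+ 1ℤ) n h)
... | no ne = ℤP.+-mono-≤-< (h z) (sumRange-pos g (z ℤ.+ 1ℤ) n h a
                 (subst (ℤ._≤ a) (ℤP.+-comm 1ℤ z) (ℤP.i<j⇒suc[i]≤j (ℤP.≤∧≢⇒< le (λ e → ne (sym e)))))
                 (subst (a ℤ.<_) (trans (cong (λ w → z ℤ.+ w) (ℤP.pos-+ 1 n)) (sym (ℤP.+-assoc z 1ℤ (+ n)))) lt) pos)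

sumRange-neg : ∀ g z n → sumRange (λ a → - g a) z n ≡ - sumRange g z n
sumRange-neg g z zero = refl
sumRange-neg g z (suc n) rewrite sumRange-neg g (z ℤ.+ 1ℤ) n = sym (ℤP.neg-distrib-+ (g z) (sumRange g (z ℤ.+ 1ℤ) n))

boxSum-pos : ∀ bx f → (∀ c → 0ℤ ℤ.≤ f c) → ∀ a b →
  x0 bx ℤ.≤ a → a ℤ.< x0 bx ℤ.+ + n bx → y0 bx ℤ.≤ b → b ℤ.< y0 bx ℤ.+ + m bx →
  0ℤ ℤ.< f (a , b) → 0ℤ ℤ.< boxSum bx f
boxSum-pos bx f h a b l1 l2 l3 l4 pos =
  sumRange-pos _ (x0 bx) (n bx) (λ a' → sumRange-nonneg _ (y0 bx) (m bx) (λ b' → h (a' , b'))) a l1 l2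
    (sumRange-pos _ (y0 bx) (m bx) (λ b' → h (a , b')) b l3 l4 pos)

boxSum-neg : ∀ bx f → boxSum bx (λ c → - f c) ≡ - boxSum bx f
boxSum-neg bx f = trans (sumRange-cong (λ a → sumRange-neg (λ b → f (a , b)) (y0 bx) (m bx)) (x0 bx) (n bx))
                        (sumRange-neg _ (x0 bx) (n bx))

AllSteps-with-source : ∀ {R : Vtx → Vtx → Set} {P : Vtx → Set} C → AllSteps R C → (∀ {v} → v ∈ C → P v) →
           AllSteps (λ v w → R v w × P v) C
AllSteps-with-source [] _ _ = _
AllSteps-with-source (v ∷ []) _ _ = _
AllSteps-with-source (v ∷ w ∷ vs) (r , rs) h = (r , h (here refl)) , AllSteps-with-source (w ∷ vs) rs (λ m → h (there m))

module CycleOrientation (F : Figure) (C : List Vtx) (path : IsPath F C) (cl : Closed C)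
              (u : Unique (dropLast C)) (long : 3 ℕ.≤ length (dropLast C)) where

  open ElementaryCycle F C path cl u long

  Bn : ℕ
  Bn = coordBound C

  X0 : ℤ
  X0 = - (+ Bn) - 1ℤ

  N : ℕ
  N = suc (suc (Bn ℕ.+ Bn))

  bx : Box
  bx = box X0 N X0 N

  topEq : X0 ℤ.+ + N ≡ + Bn ℤ.+ 1ℤ
  topEq = trans (cong (λ z → X0 ℤ.+ z) (trans (ℤP.pos-+ 1 (suc (Bn ℕ.+ Bn)))
                                        (cong (λ w → 1ℤ ℤ.+ w) (trans (ℤP.pos-+ 1 (Bn ℕ.+ Bn)) (cong (λ w → 1ℤ ℤ.+ w) (ℤP.pos-+ Bn Bn))))))
                (lem (+ Bn))
    where
    lem : ∀ b → (- b - 1ℤ) ℤ.+ (1ℤ ℤ.+ (1ℤ ℤ.+ (b ℤ.+ b))) ≡ b ℤ.+ 1ℤ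
    lem = solve-∀

  record Bounded (x : ℤ) : Set where
    constructor bd
    field
      lo : - (+ Bn) ℤ.≤ x
      hi : x ℤ.≤ + Bn

  bounded : ∀ {z} → ℤ.∣ z ∣ ℕ.≤ Bn → Bounded z
  bounded {z} le = bd (ℤP.≤-trans (ℤP.neg-mono-≤ (ℤ.+≤+ le)) (-∣i∣≤i z)) (ℤP.≤-trans (i≤∣i∣ z) (ℤ.+≤+ le))

  lowL : ∀ {x} → Bounded x → X0 ℤ.≤ x - 1ℤ
  lowL (bd lo hi) = ℤP.+-monoˡ-≤ (- 1ℤ) lo

  low : ∀ {x} → Bounded x → X0 ℤ.≤ x
  low {x} b = ℤP.≤-trans (lowL b) (ℤP.<⇒≤ (subst (x - 1ℤ ℤ.<_) (i-1+1≡i x) (i<i+1 (x - 1ℤ))))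

  high : ∀ {x} → Bounded x → x ℤ.< X0 ℤ.+ + N
  high (bd lo hi) = subst (_ ℤ.<_) (sym topEq) (ℤP.≤-<-trans hi (i<i+1 (+ Bn)))

  highL : ∀ {x} → Bounded x → x - 1ℤ ℤ.< X0 ℤ.+ + N
  highL {x} b = ℤP.<-trans (subst (x - 1ℤ ℤ.<_) (i-1+1≡i x) (i<i+1 (x - 1ℤ))) (high b)

  highE : ∀ {x} → Bounded x → x ℤ.≤ X0 ℤ.+ + N
  highE b = ℤP.<⇒≤ (high b)

  ptB : ∀ {v} → v ∈ C → Bounded (proj₁ (pt v)) × Bounded (proj₂ (pt v))
  ptB m = bounded (coordBound-x C m) , bounded (coordBound-y C m)

  inbox : ∀ {v} → v ∈ C → InBox bx (pt v)
  inbox m = lowL (proj₁ (ptB m)) , high (proj₁ (ptB m)) , low (proj₂ (ptB m)) , highE (proj₂ (ptB m))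

  shoeEq : pathSum shoelaceStep C ≡ ℤ.+ 2 * boxSum bx (winding C)
  shoeEq = shoelace≡2*boxSum-winding bx C cl (AllSteps-with-source {UnitStep} {λ v → InBox bx (pt v)} C uarcs inbox)

  CellIn : Cell → Set
  CellIn (a , b) = (X0 ℤ.≤ a) × (a ℤ.< X0 ℤ.+ + N) × (X0 ℤ.≤ b) × (b ℤ.< X0 ℤ.+ + N)

  nearL : ∀ d {x y} → Bounded x → Bounded y → CellIn (leftCell (x , y) d)
  nearL dE bx' by' = low bx' , high bx' , low by' , high by'
  nearL dN bx' by' = lowL bx' , highL bx' , low by' , high by'
  nearL dW bx' by' = lowL bx' , highL bx' , lowL by' , highL by'
  nearL dS bx' by' = low bx' , high bx' , lowL by' , highL by'

  nearR : ∀ d {x y} → Bounded x → Bounded y → CellIn (rightCell (x , y) d)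
  nearR dE bx' by' = low bx' , high bx' , lowL by' , highL by'
  nearR dN bx' by' = low bx' , high bx' , low by' , high by'
  nearR dW bx' by' = lowL bx' , highL bx' , low by' , high by'
  nearR dS bx' by' = lowL bx' , highL bx' , lowL by' , highL by'

  a0∈ : a0 ∈ C
  a0∈ = subst (a0 ∈_) (sym eqC) (here refl)

  pos2 : ∀ {s} → 0ℤ ℤ.< s → 0ℤ ℤ.< ℤ.+ 2 * s
  pos2 {s} p = subst (0ℤ ℤ.<_) (lem s) (ℤP.+-mono-< p p)
    where
    lem : ∀ s → s ℤ.+ s ≡ ℤ.+ 2 * s
    lem = solve-∀

  neg2 : ∀ {s} → 0ℤ ℤ.< - s → ℤ.+ 2 * s ℤ.< 0ℤ
  neg2 {s} p = subst (ℤ.+ 2 * s ℤ.<_) refl (ℤP.neg-cancel-< (subst (0ℤ ℤ.<_) (lem s) (pos2 p)))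
    where
    lem : ∀ s → ℤ.+ 2 * (- s) ≡ - (ℤ.+ 2 * s)
    lem = solve-∀

  k0-neg : 0ℤ ≡ k0 ℤ.+ 1ℤ → k0 ≡ - 1ℤ
  k0-neg e = trans (sym (i+1-1≡i k0)) (cong (_- 1ℤ) (sym e))

  orient : (k0 ≡ - 1ℤ × pathSum shoelaceStep C ℤ.< 0ℤ) ⊎ (k0 ≡ 0ℤ × 0ℤ ℤ.< pathSum shoelaceStep C)
  orient with zero-isLevel
  ... | inj₁ e = inj₂ (sym e , subst (0ℤ ℤ.<_) (sym shoeEq) (pos2 bpos))
    where
    nn : ∀ c → 0ℤ ℤ.≤ winding C c
    nn c with all-isLevel c
    ... | inj₁ w = subst (0ℤ ℤ.≤_) (sym (trans w (sym e))) ℤP.≤-refl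
    ... | inj₂ w = subst (0ℤ ℤ.≤_) (sym (trans w (cong (ℤ._+ 1ℤ) (sym e)))) (ℤ.+≤+ ℕ.z≤n)
    cL = leftCell (pt a0) d0
    inL : CellIn cL
    inL = nearL d0 (proj₁ (ptB a0∈)) (proj₂ (ptB a0∈))
    bpos : 0ℤ ℤ.< boxSum bx (winding C)
    bpos = boxSum-pos bx (winding C) nn (proj₁ cL) (proj₂ cL)
             (proj₁ inL) (proj₁ (proj₂ inL)) (proj₁ (proj₂ (proj₂ inL))) (proj₂ (proj₂ (proj₂ inL)))
             (subst (0ℤ ℤ.<_) (sym (trans (winding-left≡k0+1 m0 d0 e0) (cong (ℤ._+ 1ℤ) (sym e)))) (ℤ.+<+ (ℕ.s≤s ℕ.z≤n)))
  ... | inj₂ e = inj₁ (k0-neg e , subst (ℤ._< 0ℤ) (sym shoeEq) (neg2 (subst (0ℤ ℤ.<_) (boxSum-neg bx (winding C)) bpos)))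
    where
    km = k0-neg e
    nn : ∀ c → 0ℤ ℤ.≤ - winding C c
    nn c with all-isLevel c
    ... | inj₁ w = subst (λ z → 0ℤ ℤ.≤ - z) (sym (trans w km)) (ℤ.+≤+ ℕ.z≤n)
    ... | inj₂ w = subst (λ z → 0ℤ ℤ.≤ - z) (sym (trans w (cong (ℤ._+ 1ℤ) km))) ℤP.≤-refl
    cR = rightCell (pt a0) d0
    inR : CellIn cR
    inR = nearR d0 (proj₁ (ptB a0∈)) (proj₂ (ptB a0∈))
    bpos : 0ℤ ℤ.< boxSum bx (λ c → - winding C c)
    bpos = boxSum-pos bx (λ c → - winding C c) nn (proj₁ cR) (proj₂ cR)
             (proj₁ inR) (proj₁ (proj₂ inR)) (proj₁ (proj₂ (proj₂ inR))) (proj₂ (proj₂ (proj₂ inR)))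
             (subst (λ z → 0ℤ ℤ.< - z) (sym km) (ℤ.+<+ (ℕ.s≤s ℕ.z≤n)))

  clockwise⇒winding∈0-1 : pathSum shoelaceStep C ℤ.< 0ℤ → ∀ c → winding C c ≡ 0ℤ ⊎ winding C c ≡ - 1ℤ
  clockwise⇒winding∈0-1 neg c with orient
  ... | inj₂ (_ , pos) = ⊥-elim (ℤP.<-asym neg pos)
  ... | inj₁ (km , _) with all-isLevel c
  ...   | inj₁ w = inj₂ (trans w km)
  ...   | inj₂ w = inj₁ (trans w (cong (ℤ._+ 1ℤ) km))

  shoelace≢0 : pathSum shoelaceStep C ≢ 0ℤ
  shoelace≢0 z with orient
  ... | inj₁ (_ , neg) = ℤP.<-irrefl z neg
  ... | inj₂ (_ , pos) = ℤP.<-irrefl (sym z) pos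

-- Dominoes and tilings

sumList : ∀ {A : Set} → (A → ℤ) → List A → ℤ
sumList f [] = 0ℤ
sumList f (x ∷ xs) = f x ℤ.+ sumList f xs

sumCells≡sumList : ∀ f cs → sumCells f cs ≡ sumList f cs
sumCells≡sumList f [] = refl
sumCells≡sumList f (c ∷ cs) = cong (λ w → f c ℤ.+ w) (sumCells≡sumList f cs)

sumCells-cong : ∀ {f g : Cell → ℤ} cs → (∀ c → f c ≡ g c) → sumCells f cs ≡ sumCells g cs
sumCells-cong [] h = refl
sumCells-cong (c ∷ cs) h = cong₂ ℤ._+_ (h c) (sumCells-cong cs h)

sumCells-neg : ∀ (f : Cell → ℤ) cs → sumCells (λ c → - f c) cs ≡ - sumCells f cs
sumCells-neg f [] = refl
sumCells-neg f (c ∷ cs) rewrite sumCells-neg f cs = sym (ℤP.neg-distrib-+ (f c) (sumCells f cs))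

sumList-++ : ∀ {A : Set} (f : A → ℤ) xs ys → sumList f (xs ++ ys) ≡ sumList f xs ℤ.+ sumList f ys
sumList-++ f [] ys = sym (ℤP.+-identityˡ _)
sumList-++ f (x ∷ xs) ys rewrite sumList-++ f xs ys = sym (ℤP.+-assoc (f x) (sumList f xs) (sumList f ys))

sumList-concatMap : ∀ {A B : Set} (f : B → ℤ) (g : A → List B) xs →
  sumList f (concatMap g xs) ≡ sumList (λ a → sumList f (g a)) xs
sumList-concatMap f g [] = refl
sumList-concatMap f g (x ∷ xs) = trans (sumList-++ f (g x) (concatMap g xs)) (cong (λ w → sumList f (g x) ℤ.+ w) (sumList-concatMap f g xs))

sumList-cong : ∀ {A : Set} {f g : A → ℤ} xs → (∀ {x} → x ∈ xs → f x ≡ g x) → sumList f xs ≡ sumList g xs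
sumList-cong [] h = refl
sumList-cong (x ∷ xs) h = cong₂ ℤ._+_ (h (here refl)) (sumList-cong xs (λ m → h (there m)))

sumList-+ : ∀ {A : Set} (f g : A → ℤ) xs → sumList (λ x → f x ℤ.+ g x) xs ≡ sumList f xs ℤ.+ sumList g xs
sumList-+ f g [] = refl
sumList-+ f g (x ∷ xs) rewrite sumList-+ f g xs = lem (f x) (g x) (sumList f xs) (sumList g xs)
  where
  lem : ∀ a b c d → a ℤ.+ b ℤ.+ (c ℤ.+ d) ≡ a ℤ.+ c ℤ.+ (b ℤ.+ d)
  lem = solve-∀

sumList-0 : ∀ {A : Set} (f : A → ℤ) xs → (∀ {x} → x ∈ xs → f x ≡ 0ℤ) → sumList f xs ≡ 0ℤ
sumList-0 f [] h = refl
sumList-0 f (x ∷ xs) h = trans (cong₂ ℤ._+_ (h (here refl)) (sumList-0 f xs (λ m → h (there m)))) refl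

sumList-pathSum : ∀ {A : Set} (G : A → Vtx → Vtx → ℤ) xs C →
  sumList (λ a → pathSum (G a) C) xs ≡ pathSum (λ v w → sumList (λ a → G a v w) xs) C
sumList-pathSum G [] C = sym (pathSum-0 C)
sumList-pathSum G (x ∷ xs) C = trans (cong (λ w → pathSum (G x) C ℤ.+ w) (sumList-pathSum G xs C))
                              (sym (pathSum-+ (G x) (λ v w → sumList (λ a → G a v w) xs) C))

module _ {A : Set} where
  Unique-remove : ∀ (ys zs : List A) {x} → Unique (ys ++ x ∷ zs) → Unique (ys ++ zs) × x ∉ (ys ++ zs)
  Unique-remove [] zs (nx ∷ u) = u , λ m → All.lookup nx m refl
  Unique-remove (y ∷ ys) zs {x} (ny ∷ u) with Unique-remove ys zs u
  ... | u' , nx = (dropA ys ny ∷ u') , λ { (here refl) → All.lookup ny (∈-++⁺ʳ ys (here refl)) refl ; (there m) → nx m }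
    where
    dropA : ∀ ys → All (y ≢_) (ys ++ x ∷ zs) → All (y ≢_) (ys ++ zs)
    dropA [] (_ ∷ a) = a
    dropA (_ ∷ ys) (p ∷ a) = p ∷ dropA ys a

  sumList-same-elements : ∀ (f : A → ℤ) xs ys → Unique xs → Unique ys →
    (∀ {z} → z ∈ xs → z ∈ ys) → (∀ {z} → z ∈ ys → z ∈ xs) → sumList f xs ≡ sumList f ys
  sumList-same-elements f [] [] _ _ _ _ = refl
  sumList-same-elements f [] (y ∷ ys) _ _ _ h = ⊥-elim (¬[] (h (here refl)))
    where
    ¬[] : y ∉ []
    ¬[] ()
  sumList-same-elements f (x ∷ xs) ys (nx ∷ ux) uy h1 h2 with ∈-∃++ (h1 (here refl))
  ... | ys1 , ys2 , refl with Unique-remove ys1 ys2 uy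
  ... | uy' , x∉ =
    trans (cong (λ w → f x ℤ.+ w) (sumList-same-elements f xs (ys1 ++ ys2) ux uy' fwd bwd))
          (trans (cong (λ w → f x ℤ.+ w) (sumList-++ f ys1 ys2)) (trans (lem (f x) (sumList f ys1) (sumList f ys2))
                 (sym (sumList-++ f ys1 (x ∷ ys2)))))
    where
    lem : ∀ a b c → a ℤ.+ (b ℤ.+ c) ≡ b ℤ.+ (a ℤ.+ c)
    lem = solve-∀
    fwd : ∀ {z} → z ∈ xs → z ∈ ys1 ++ ys2
    fwd {z} m with ∈-++⁻ ys1 (h1 (there m))
    ... | inj₁ m1 = ∈-++⁺ˡ m1
    ... | inj₂ (here refl) = ⊥-elim (All.lookup nx m refl)
    ... | inj₂ (there m2) = ∈-++⁺ʳ ys1 m2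
    bwd : ∀ {z} → z ∈ ys1 ++ ys2 → z ∈ xs
    bwd {z} m with ∈-++⁻ ys1 m
    ... | inj₁ m1 with h2 (∈-++⁺ˡ m1)
    ...   | here refl = ⊥-elim (x∉ m)
    ...   | there mm = mm
    bwd {z} m | inj₂ m2 with h2 (∈-++⁺ʳ ys1 (there m2))
    ...   | here refl = ⊥-elim (x∉ m)
    ...   | there mm = mm

_≟O_ : DecidableEquality Orientation
horizontal ≟O horizontal = yes refl
horizontal ≟O vertical = no (λ ())
vertical ≟O horizontal = no (λ ())
vertical ≟O vertical = yes refl

_≟D_ : DecidableEquality Domino
_≟D_ = ≡-dec _≟P_ _≟O_

∨-true : ∀ {a b} → (a ∨ b) ≡ true → a ≡ true ⊎ b ≡ true
∨-true {true} _ = inj₁ refl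
∨-true {false} h = inj₂ h

∧-true : ∀ {a b} → (a ∧ b) ≡ true → a ≡ true × b ≡ true
∧-true {true} {true} _ = refl , refl

isAxis-sound : ∀ p q d → isAxis p q d ≡ true →
  (p ≡ proj₁ (axis d) × q ≡ proj₂ (axis d)) ⊎ (p ≡ proj₂ (axis d) × q ≡ proj₁ (axis d))
isAxis-sound p q ((a , b) , horizontal) h with ∨-true h
... | inj₁ h1 = inj₁ (==P-sound (proj₁ (∧-true h1)) , ==P-sound (proj₂ (∧-true h1)))
... | inj₂ h2 = inj₂ (==P-sound (proj₁ (∧-true h2)) , ==P-sound (proj₂ (∧-true h2)))
isAxis-sound p q ((a , b) , vertical) h with ∨-true h
... | inj₁ h1 = inj₁ (==P-sound (proj₁ (∧-true h1)) , ==P-sound (proj₂ (∧-true h1)))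
... | inj₂ h2 = inj₂ (==P-sound (proj₁ (∧-true h2)) , ==P-sound (proj₂ (∧-true h2)))

dominoWithAxis : Point → Dir → Domino
dominoWithAxis (x , y) dN = (x - 1ℤ , y) , horizontal
dominoWithAxis (x , y) dS = (x - 1ℤ , y - 1ℤ) , horizontal
dominoWithAxis (x , y) dE = (x , y - 1ℤ) , vertical
dominoWithAxis (x , y) dW = (x - 1ℤ , y - 1ℤ) , vertical

,≡ : ∀ {a b c d : ℤ} → (a , b) ≡ (c , d) → a ≡ c × b ≡ d
,≡ refl = refl , refl

a≡x-1 : ∀ {a x} → x ≡ a ℤ.+ 1ℤ → a ≡ x - 1ℤ
a≡x-1 {a} refl = sym (i+1-1≡i a)

isAxis⇒dominoWithAxis : ∀ dir p d → isAxis p (move dir p) d ≡ true → d ≡ dominoWithAxis p dir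
isAxis⇒dominoWithAxis dir (x , y) ((a , b) , o) h with isAxis-sound (x , y) (move dir (x , y)) ((a , b) , o) h
isAxis⇒dominoWithAxis dN (x , y) ((a , b) , horizontal) h | inj₁ (e1 , e2) with ,≡ e1
... | ex , refl = cong (λ z → (z , y) , horizontal) (a≡x-1 ex)
isAxis⇒dominoWithAxis dN (x , y) ((a , b) , horizontal) h | inj₂ (e1 , e2) with ,≡ e1 | ,≡ e2
... | _ , ey1 | _ , ey2 = ⊥-elim (i+1+1≢i b (trans (cong (ℤ._+ 1ℤ) (sym ey1)) ey2))
isAxis⇒dominoWithAxis dS (x , y) ((a , b) , horizontal) h | inj₁ (e1 , e2) with ,≡ e1 | ,≡ e2
... | _ , ey1 | _ , ey2 = ⊥-elim (i-1≢i+1 y (trans ey2 (cong (ℤ._+ 1ℤ) (sym ey1))))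
isAxis⇒dominoWithAxis dS (x , y) ((a , b) , horizontal) h | inj₂ (e1 , e2) with ,≡ e1 | ,≡ e2
... | ex , _ | _ , ey2 = cong₂ (λ z w → (z , w) , horizontal) (a≡x-1 ex) (sym ey2)
isAxis⇒dominoWithAxis dE (x , y) ((a , b) , horizontal) h | inj₁ (e1 , e2) with ,≡ e1 | ,≡ e2
... | ex1 , _ | ex2 , _ = ⊥-elim (i≢i+1 x (trans ex1 (sym ex2)))
isAxis⇒dominoWithAxis dE (x , y) ((a , b) , horizontal) h | inj₂ (e1 , e2) with ,≡ e1 | ,≡ e2
... | ex1 , _ | ex2 , _ = ⊥-elim (i≢i+1 x (trans ex1 (sym ex2)))
isAxis⇒dominoWithAxis dW (x , y) ((a , b) , horizontal) h | inj₁ (e1 , e2) with ,≡ e1 | ,≡ e2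
... | ex1 , _ | ex2 , _ = ⊥-elim (i≢i-1 x (trans ex1 (sym ex2)))
isAxis⇒dominoWithAxis dW (x , y) ((a , b) , horizontal) h | inj₂ (e1 , e2) with ,≡ e1 | ,≡ e2
... | ex1 , _ | ex2 , _ = ⊥-elim (i≢i-1 x (trans ex1 (sym ex2)))
isAxis⇒dominoWithAxis dE (x , y) ((a , b) , vertical) h | inj₁ (e1 , e2) with ,≡ e1
... | refl , ey = cong (λ z → (x , z) , vertical) (a≡x-1 ey)
isAxis⇒dominoWithAxis dE (x , y) ((a , b) , vertical) h | inj₂ (e1 , e2) with ,≡ e1 | ,≡ e2
... | ex1 , _ | ex2 , _ = ⊥-elim (i+1+1≢i a (trans (cong (ℤ._+ 1ℤ) (sym ex1)) ex2))
isAxis⇒dominoWithAxis dW (x , y) ((a , b) , vertical) h | inj₁ (e1 , e2) with ,≡ e1 | ,≡ e2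
... | ex1 , _ | ex2 , _ = ⊥-elim (i-1≢i+1 x (trans ex2 (cong (ℤ._+ 1ℤ) (sym ex1))))
isAxis⇒dominoWithAxis dW (x , y) ((a , b) , vertical) h | inj₂ (e1 , e2) with ,≡ e1 | ,≡ e2
... | ex1 , ey1 | ex2 , _ = cong₂ (λ z w → (z , w) , vertical) (sym ex2) (a≡x-1 ey1)
isAxis⇒dominoWithAxis dN (x , y) ((a , b) , vertical) h | inj₁ (e1 , e2) with ,≡ e1 | ,≡ e2
... | _ , ey1 | _ , ey2 = ⊥-elim (i≢i+1 y (trans ey1 (sym ey2)))
isAxis⇒dominoWithAxis dN (x , y) ((a , b) , vertical) h | inj₂ (e1 , e2) with ,≡ e1 | ,≡ e2
... | _ , ey1 | _ , ey2 = ⊥-elim (i≢i+1 y (trans ey1 (sym ey2)))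
isAxis⇒dominoWithAxis dS (x , y) ((a , b) , vertical) h | inj₁ (e1 , e2) with ,≡ e1 | ,≡ e2
... | _ , ey1 | _ , ey2 = ⊥-elim (i≢i-1 y (trans ey1 (sym ey2)))
isAxis⇒dominoWithAxis dS (x , y) ((a , b) , vertical) h | inj₂ (e1 , e2) with ,≡ e1 | ,≡ e2
... | _ , ey1 | _ , ey2 = ⊥-elim (i≢i-1 y (trans ey1 (sym ey2)))

any-true⁻ : ∀ {A : Set} (P : A → Bool) xs → any P xs ≡ true → Σ A λ x → x ∈ xs × P x ≡ true
any-true⁻ P (x ∷ xs) h with P x in e
... | true = x , here refl , e
... | false with any-true⁻ P xs h
...   | y , m , py = y , there m , py

any-true⁺ : ∀ {A : Set} (P : A → Bool) {x} xs → x ∈ xs → P x ≡ true → any P xs ≡ true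
any-true⁺ P (x ∷ xs) (here refl) px rewrite px = refl
any-true⁺ P (y ∷ xs) (there m) px rewrite any-true⁺ P xs m px = ∨-zeroʳ (P y)

any-same : ∀ {A : Set} (P : A → Bool) xs ys → (∀ {z} → z ∈ xs → z ∈ ys) → (∀ {z} → z ∈ ys → z ∈ xs) →
           any P xs ≡ any P ys
any-same P xs ys f g with any P xs in e1 | any P ys in e2
... | true | true = refl
... | false | false = refl
... | true | false with any-true⁻ P xs e1
...   | z , m , pz = sym (trans (sym e2) (any-true⁺ P ys (f m) pz))
any-same P xs ys f g | false | true with any-true⁻ P ys e2
...   | z , m , pz = trans (sym e1) (any-true⁺ P xs (g m) pz)

indicator : Bool → ℤ
indicator b = if b then 1ℤ else 0ℤ

indicator-any-unique : ∀ (T' : List Domino) → Unique T' → ∀ dir p →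
  indicator (any (isAxis p (move dir p)) T') ≡ sumList (λ d → indicator (isAxis p (move dir p) d)) T'
indicator-any-unique [] _ dir p = refl
indicator-any-unique (d ∷ T') (nd ∷ u) dir p with isAxis p (move dir p) d in e
... | false = trans (indicator-any-unique T' u dir p) (sym (ℤP.+-identityˡ _))
... | true = sym (trans (cong (λ w → 1ℤ ℤ.+ w) (sumList-0 _ T' zero')) refl)
  where
  zero' : ∀ {d'} → d' ∈ T' → indicator (isAxis p (move dir p) d') ≡ 0ℤ
  zero' {d'} m with isAxis p (move dir p) d' in e'
  ... | false = refl
  ... | true = ⊥-elim (All.lookup nd m (trans (isAxis⇒dominoWithAxis dir p d e) (sym (isAxis⇒dominoWithAxis dir p d' e'))))

χ₁ : Domino → Vtx → Vtx → ℤ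
χ₁ d v w = indicator (isAxis (proj₁ v) (proj₁ w) d)

indicator-∨ : ∀ A B → (A ≡ true → B ≡ true → ⊥) → indicator (A ∨ B) ≡ indicator A ℤ.+ indicator B
indicator-∨ true true h = ⊥-elim (h refl refl)
indicator-∨ true false h = refl
indicator-∨ false true h = refl
indicator-∨ false false h = refl

indicator-segment : ∀ p q r s → r ≢ s →
  indicator (((p ==P r) ∧ (q ==P s)) ∨ ((p ==P s) ∧ (q ==P r))) ≡ segmentIndicator r s p q ℤ.+ segmentIndicator s r p q
indicator-segment p q r s ne = indicator-∨ ((p ==P r) ∧ (q ==P s)) ((p ==P s) ∧ (q ==P r))
  (λ h1 h2 → ne (trans (sym (==P-sound {p} {r} (proj₁ (∧-true {p ==P r} {q ==P s} h1))))
                       (==P-sound {p} {s} (proj₁ (∧-true {p ==P s} {q ==P r} h2)))))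

indicator-isAxis : ∀ p q d → proj₁ (axis d) ≢ proj₂ (axis d) →
  indicator (isAxis p q d) ≡ segmentIndicator (proj₁ (axis d)) (proj₂ (axis d)) p q ℤ.+ segmentIndicator (proj₂ (axis d)) (proj₁ (axis d)) p q
indicator-isAxis p q ((a , b) , horizontal) ne = indicator-segment p q (a ℤ.+ 1ℤ , b) (a ℤ.+ 1ℤ , b ℤ.+ 1ℤ) ne
indicator-isAxis p q ((a , b) , vertical) ne = indicator-segment p q (a , b ℤ.+ 1ℤ) (a ℤ.+ 1ℤ , b ℤ.+ 1ℤ) ne

spin : Point → Point → ℤ
spin p q = sp (p , false) (q , false)

sp-arcIndicator : ∀ r s v w → sp v w * arcIndicator r s v w ≡ spin r s * arcIndicator r s v w
sp-arcIndicator r s v w with arcIndicator-cases r s v w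
... | inj₁ (e1 , e2 , i) = cong (λ z → z * arcIndicator r s v w) (aux v w e1 e2)
  where
  aux : ∀ (v w : Vtx) → proj₁ v ≡ r → proj₁ w ≡ s → sp v w ≡ spin r s
  aux (p , t) (q , u) refl refl = refl
... | inj₂ (_ , i) rewrite i = trans (ℤP.*-zeroʳ (sp v w)) (sym (ℤP.*-zeroʳ (spin r s)))

whiteSign≡-colourSign : ∀ c → whiteSign c ≡ - colourSign c
whiteSign≡-colourSign c with isWhite c
... | true = refl
... | false = refl

whiteSign-flip : ∀ c c' → isWhite c' ≡ not (isWhite c) → whiteSign c' ≡ colourSign c
whiteSign-flip c c' e rewrite e with isWhite c
... | true = refl
... | false = refl

colourSign-flip : ∀ c c' → isWhite c' ≡ not (isWhite c) → colourSign c' ≡ - colourSign c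
colourSign-flip c c' e rewrite e with isWhite c
... | true = refl
... | false = refl

spin-move : ∀ d p → spin p (move d p) ≡ whiteSign (leftCell p d)
spin-move d p = sp-move d p false false

spin-χ₁-horizontal : ∀ a b v w →
  sp v w * χ₁ ((a , b) , horizontal) v w ≡
  - colourSign (a , b) * (arcIndicator (a ℤ.+ 1ℤ , b) (a ℤ.+ 1ℤ , b ℤ.+ 1ℤ) v w - arcIndicator (a ℤ.+ 1ℤ , b ℤ.+ 1ℤ) (a ℤ.+ 1ℤ , b) v w)
spin-χ₁-horizontal a b v w =
  trans (cong (sp v w *_) (indicator-isAxis (proj₁ v) (proj₁ w) ((a , b) , horizontal) (λ e → i≢i+1 b (cong proj₂ e))))
  (trans (ℤP.*-distribˡ-+ (sp v w) (arcIndicator r s v w) (arcIndicator s r v w))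
  (trans (cong₂ ℤ._+_ (sp-arcIndicator r s v w) (sp-arcIndicator s r v w))
  (trans (cong₂ (λ x y → x * arcIndicator r s v w ℤ.+ y * arcIndicator s r v w) e1 e2)
         (lem (colourSign (a , b)) (arcIndicator r s v w) (arcIndicator s r v w)))))
  where
  r = (a ℤ.+ 1ℤ , b)
  s = (a ℤ.+ 1ℤ , b ℤ.+ 1ℤ)
  e1 : spin r s ≡ - colourSign (a , b)
  e1 = trans (spin-move dN r) (trans (cong whiteSign (pair≡ {a ℤ.+ 1ℤ - 1ℤ} {b} {a} {b} (i+1-1≡i a) refl)) (whiteSign≡-colourSign (a , b)))
  e2 : spin s r ≡ colourSign (a , b)
  e2 = trans (cong (spin s) (pair≡ {a ℤ.+ 1ℤ} {b} {a ℤ.+ 1ℤ} {b ℤ.+ 1ℤ - 1ℤ} refl (sym (i+1-1≡i b))))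
       (trans (spin-move dS s) (trans (cong whiteSign (pair≡ {a ℤ.+ 1ℤ} {b ℤ.+ 1ℤ - 1ℤ} {a ℤ.+ 1ℤ} {b} refl (i+1-1≡i b))) (whiteSign-flip (a , b) (a ℤ.+ 1ℤ , b) (isWhite-east a b))))
  lem : ∀ k i j → - k * i ℤ.+ k * j ≡ - k * (i - j)
  lem = solve-∀

spin-χ₁-vertical : ∀ a b v w →
  sp v w * χ₁ ((a , b) , vertical) v w ≡
  - colourSign (a , b) * (arcIndicator (a ℤ.+ 1ℤ , b ℤ.+ 1ℤ) (a , b ℤ.+ 1ℤ) v w - arcIndicator (a , b ℤ.+ 1ℤ) (a ℤ.+ 1ℤ , b ℤ.+ 1ℤ) v w)
spin-χ₁-vertical a b v w =
  trans (cong (sp v w *_) (indicator-isAxis (proj₁ v) (proj₁ w) ((a , b) , vertical) (λ e → i≢i+1 a (cong proj₁ e))))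
  (trans (ℤP.*-distribˡ-+ (sp v w) (arcIndicator r s v w) (arcIndicator s r v w))
  (trans (cong₂ ℤ._+_ (sp-arcIndicator r s v w) (sp-arcIndicator s r v w))
  (trans (cong₂ (λ x y → x * arcIndicator r s v w ℤ.+ y * arcIndicator s r v w) e1 e2)
         (lem (colourSign (a , b)) (arcIndicator r s v w) (arcIndicator s r v w)))))
  where
  r = (a , b ℤ.+ 1ℤ)
  s = (a ℤ.+ 1ℤ , b ℤ.+ 1ℤ)
  e1 : spin r s ≡ colourSign (a , b)
  e1 = trans (spin-move dE r) (whiteSign-flip (a , b) (a , b ℤ.+ 1ℤ) (isWhite-north a b))
  e2 : spin s r ≡ - colourSign (a , b)
  e2 = trans (cong (spin s) (pair≡ {a} {b ℤ.+ 1ℤ} {a ℤ.+ 1ℤ - 1ℤ} {b ℤ.+ 1ℤ} (sym (i+1-1≡i a)) refl))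
       (trans (spin-move dW s) (trans (cong whiteSign (pair≡ {a ℤ.+ 1ℤ - 1ℤ} {b ℤ.+ 1ℤ - 1ℤ} {a} {b} (i+1-1≡i a) (i+1-1≡i b))) (whiteSign≡-colourSign (a , b))))
  lem : ∀ k i j → k * i ℤ.+ - k * j ≡ - k * (j - i)
  lem = solve-∀

dominoFlux : Domino → Vtx → Vtx → ℤ
dominoFlux d v w = sumList (λ c → windStep c v w * colourSign c) (domCells d) ℤ.+ sp v w * χ₁ d v w

dominoPotential : Domino → Point → ℤ
dominoPotential ((a , b) , horizontal) p = - colourSign (a , b) * onRay a b p
dominoPotential ((a , b) , vertical) p = 0ℤ

dominoFlux-telescopes : ∀ d {v w} → UnitStep v w → dominoFlux d v w ≡ dominoPotential d (proj₁ w) - dominoPotential d (proj₁ v)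
dominoFlux-telescopes ((a , b) , horizontal) {v} {w} un =
  trans (cong₂ (λ k s → windStep (a , b) v w * colourSign (a , b) ℤ.+ (windStep (a ℤ.+ 1ℤ , b) v w * k ℤ.+ 0ℤ) ℤ.+ s)
               (colourSign-flip (a , b) (a ℤ.+ 1ℤ , b) (isWhite-east a b)) (spin-χ₁-horizontal a b v w))
  (trans (cong (λ z → windStep (a , b) v w * colourSign (a , b) ℤ.+ (z * - colourSign (a , b) ℤ.+ 0ℤ) ℤ.+ - colourSign (a , b) * vc)
               (i-j≡k⇒i≡j+k {windStep (a ℤ.+ 1ℤ , b) v w} {windStep (a , b) v w} (windStep-horizontal-jump a b {v} {w} un)))
         (lem (windStep (a , b) v w) (colourSign (a , b)) (onRay a b (proj₁ w)) (onRay a b (proj₁ v)) vc))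
  where
  vc = arcIndicator (a ℤ.+ 1ℤ , b) (a ℤ.+ 1ℤ , b ℤ.+ 1ℤ) v w - arcIndicator (a ℤ.+ 1ℤ , b ℤ.+ 1ℤ) (a ℤ.+ 1ℤ , b) v w
  lem : ∀ w₀ κ r r' e → w₀ * κ ℤ.+ ((w₀ ℤ.+ ((r - r') - e)) * - κ ℤ.+ 0ℤ) ℤ.+ - κ * e ≡ - κ * r - - κ * r'
  lem = solve-∀
dominoFlux-telescopes ((a , b) , vertical) {v} {w} un =
  trans (cong₂ (λ k s → windStep (a , b) v w * colourSign (a , b) ℤ.+ (windStep (a , b ℤ.+ 1ℤ) v w * k ℤ.+ 0ℤ) ℤ.+ s)
               (colourSign-flip (a , b) (a , b ℤ.+ 1ℤ) (isWhite-north a b)) (spin-χ₁-vertical a b v w))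
  (trans (cong (λ z → z * colourSign (a , b) ℤ.+ (windStep (a , b ℤ.+ 1ℤ) v w * - colourSign (a , b) ℤ.+ 0ℤ) ℤ.+ - colourSign (a , b) * hx)
               (i-j≡k⇒i≡j+k {windStep (a , b) v w} {windStep (a , b ℤ.+ 1ℤ) v w} (windStep-vertical-jump a b {v} {w} un)))
         (lem (windStep (a , b ℤ.+ 1ℤ) v w) (colourSign (a , b)) hx))
  where
  hx = arcIndicator (a ℤ.+ 1ℤ , b ℤ.+ 1ℤ) (a , b ℤ.+ 1ℤ) v w - arcIndicator (a , b ℤ.+ 1ℤ) (a ℤ.+ 1ℤ , b ℤ.+ 1ℤ) v w
  lem : ∀ w1 κ hx → (w1 ℤ.+ hx) * κ ℤ.+ (w1 * - κ ℤ.+ 0ℤ) ℤ.+ - κ * hx ≡ 0ℤ - 0ℤ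
  lem = solve-∀

spinχ₁ : Domino → Vtx → Vtx → ℤ
spinχ₁ d v w = sp v w * χ₁ d v w

-- The crossing numbers of the two cells of a domino differ by the signed traversals of
-- its central axis, up to a gradient; with opposite colours this cancels the spin term.
domino-balance : ∀ d C → Closed C → AllSteps UnitStep C →
  sumList (λ c → winding C c * colourSign c) (domCells d) ℤ.+ pathSum (spinχ₁ d) C ≡ 0ℤ
domino-balance d C cl arcs =
  trans (cong (ℤ._+ pathSum (spinχ₁ d) C)
          (trans (sumList-cong (domCells d) (λ {c} _ → sym (pathSum-*ʳ (windStep c) (colourSign c) C)))
                 (sumList-pathSum (λ c v w → windStep c v w * colourSign c) (domCells d) C)))
  (trans (sym (pathSum-+ (λ v w → sumList (λ c → windStep c v w * colourSign c) (domCells d)) (spinχ₁ d) C))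
  (trans (pathSum-cong {UnitStep} (dominoFlux d) (λ v w → dominoPotential d (proj₁ w) - dominoPotential d (proj₁ v)) (λ {v} {w} un → dominoFlux-telescopes d {v} {w} un) C arcs)
         (pathSum-telescope-closed (λ v → dominoPotential d (proj₁ v)) C cl)))

∈-concatMap⁻ : ∀ {A B : Set} (g : A → List B) xs {c} → c ∈ concatMap g xs → Σ A λ d → d ∈ xs × c ∈ g d
∈-concatMap⁻ g (x ∷ xs) m with ∈-++⁻ (g x) m
... | inj₁ m1 = x , here refl , m1
... | inj₂ m2 with ∈-concatMap⁻ g xs m2
...   | d , md , mc = d , there md , mc

∈-concatMap⁺ : ∀ {A B : Set} (g : A → List B) {xs d c} → d ∈ xs → c ∈ g d → c ∈ concatMap g xs
∈-concatMap⁺ g {x ∷ xs} (here refl) mc = ∈-++⁺ˡ mc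
∈-concatMap⁺ g {x ∷ xs} (there md) mc = ∈-++⁺ʳ (g x) (∈-concatMap⁺ g md mc)

Unique-domCells : ∀ d → Unique (domCells d)
Unique-domCells ((a , b) , horizontal) = ((λ e → i≢i+1 a (cong proj₁ e)) ∷ []) ∷ ([] ∷ [])
Unique-domCells ((a , b) , vertical) = ((λ e → i≢i+1 b (cong proj₂ e)) ∷ []) ∷ ([] ∷ [])

sumList-* : ∀ {A : Set} k (f : A → ℤ) xs → k * sumList f xs ≡ sumList (λ x → k * f x) xs
sumList-* k f [] = ℤP.*-zeroʳ k
sumList-* k f (x ∷ xs) = trans (ℤP.*-distribˡ-+ k (f x) (sumList f xs)) (cong (λ w → k * f x ℤ.+ w) (sumList-* k f xs))

module Tiled (F : Figure) (T : List Domino) (til : IsTiling F T) where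

  open IsTiling til

  -- A tiling may list the same domino several times.
  T' : List Domino
  T' = deduplicate _≟D_ T

  Unique-T' : Unique T'
  Unique-T' = UDP.deduplicate-! _≟D_ T

  T'⊆T : ∀ {d} → d ∈ T' → d ∈ T
  T'⊆T m = ∈-deduplicate⁻ _≟D_ T m

  Unique-concatMap-domCells : ∀ L → Unique L → (∀ {d} → d ∈ L → d ∈ T) → Unique (concatMap domCells L)
  Unique-concatMap-domCells [] _ _ = []
  Unique-concatMap-domCells (d ∷ L) (nd ∷ u) sub =
    UP.++⁺ (Unique-domCells d) (Unique-concatMap-domCells L u (λ m → sub (there m)))
      λ { (m1 , m2) → let (d' , md' , mc') = ∈-concatMap⁻ domCells L m2
                      in All.lookup nd md' (disjoint (sub (here refl)) (sub (there md')) m1 mc') }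

  sumCells-tiling : ∀ (f : Cell → ℤ) → sumCells f (cells F) ≡ sumList (λ d → sumList f (domCells d)) T'
  sumCells-tiling f = trans (sumCells≡sumList f (cells F))
    (trans (sumList-same-elements f (cells F) (concatMap domCells T') (unique F) (Unique-concatMap-domCells T' Unique-T' T'⊆T)
             (λ m → let (d , md , mc) = covers m in ∈-concatMap⁺ domCells (∈-deduplicate⁺ _≟D_ md) mc)
             (λ m → let (d , md , mc) = ∈-concatMap⁻ domCells T' m in inside (T'⊆T md) mc))
           (sumList-concatMap f domCells T'))

  spinχ-sum : ∀ {v w} → UnitStep v w → sp v w * χ T v w ≡ sumList (λ d → spinχ₁ d v w) T'
  spinχ-sum {(p , t)} {(q , u)} (dir , refl) =
    trans (cong (λ z → sp (p , t) (move dir p , u) * indicator z)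
                (any-same (isAxis p (move dir p)) T T' (∈-deduplicate⁺ _≟D_) T'⊆T))
    (trans (cong (sp (p , t) (move dir p , u) *_) (indicator-any-unique T' Unique-T' dir p))
           (sumList-* (sp (p , t) (move dir p , u)) (λ d → indicator (isAxis p (move dir p) d)) T'))

  tiling-balance : ∀ C → Closed C → AllSteps UnitStep C →
    sumCells (λ c → winding C c * colourSign c) (cells F) ℤ.+ pathSum (λ v w → sp v w * χ T v w) C ≡ 0ℤ
  tiling-balance C cl arcs =
    trans (cong₂ ℤ._+_ (sumCells-tiling (λ c → winding C c * colourSign c))
                 (trans (pathSum-cong {UnitStep} (λ v w → sp v w * χ T v w) (λ v w → sumList (λ d → spinχ₁ d v w) T')
                                (λ {v} {w} un → spinχ-sum {v} {w} un) C arcs)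
                        (sym (sumList-pathSum spinχ₁ T' C))))
    (trans (sym (sumList-+ (λ d → sumList (λ c → winding C c * colourSign c) (domCells d)) (λ d → pathSum (spinχ₁ d) C) T'))
           (sumList-0 _ T' (λ {d} _ → domino-balance d C cl arcs)))

whiteSign-not : ∀ c c' → isWhite c' ≡ not (isWhite c) → whiteSign c' ≡ - whiteSign c
whiteSign-not c c' e rewrite e with isWhite c
... | true = refl
... | false = refl

whiteSign-right : ∀ d p → whiteSign (rightCell p d) ≡ - whiteSign (leftCell p d)
whiteSign-right dE (x , y) = whiteSign-not (x , y) (x , y - 1ℤ) (isWhite-south x y)
whiteSign-right dN (x , y) = trans (sym (ℤP.neg-involutive _)) (cong -_ (sym (whiteSign-not (x , y) (x - 1ℤ , y) (isWhite-west x y))))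
whiteSign-right dW (x , y) = trans (sym (ℤP.neg-involutive _)) (cong -_ (sym (whiteSign-not (x - 1ℤ , y) (x - 1ℤ , y - 1ℤ) (isWhite-south (x - 1ℤ) y))))
whiteSign-right dS (x , y) = whiteSign-not (x , y - 1ℤ) (x - 1ℤ , y - 1ℤ) (isWhite-west x (y - 1ℤ))

sp-skew : ∀ {v w} → UnitStep v w → sp w v ≡ - sp v w
sp-skew {p , t} {q , u} (d , refl) =
  trans (cong (λ z → sp (move d p , u) (z , t)) (sym (move-opposite d p)))
  (trans (sp-move (opposite d) (move d p) u t)
  (trans (cong whiteSign (sym (rightCell-opposite d p)))
  (trans (whiteSign-right d p) (cong -_ (sym (sp-move d p t u))))))

isAxis-sym : ∀ p q d → isAxis q p d ≡ isAxis p q d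
isAxis-sym p q ((a , b) , horizontal) =
  trans (cong₂ _∨_ (∧-comm (q ==P (a ℤ.+ 1ℤ , b)) (p ==P (a ℤ.+ 1ℤ , b ℤ.+ 1ℤ))) (∧-comm (q ==P (a ℤ.+ 1ℤ , b ℤ.+ 1ℤ)) (p ==P (a ℤ.+ 1ℤ , b))))
        (∨-comm ((p ==P (a ℤ.+ 1ℤ , b ℤ.+ 1ℤ)) ∧ (q ==P (a ℤ.+ 1ℤ , b))) ((p ==P (a ℤ.+ 1ℤ , b)) ∧ (q ==P (a ℤ.+ 1ℤ , b ℤ.+ 1ℤ))))
isAxis-sym p q ((a , b) , vertical) =
  trans (cong₂ _∨_ (∧-comm (q ==P (a , b ℤ.+ 1ℤ)) (p ==P (a ℤ.+ 1ℤ , b ℤ.+ 1ℤ))) (∧-comm (q ==P (a ℤ.+ 1ℤ , b ℤ.+ 1ℤ)) (p ==P (a , b ℤ.+ 1ℤ))))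
        (∨-comm ((p ==P (a ℤ.+ 1ℤ , b ℤ.+ 1ℤ)) ∧ (q ==P (a , b ℤ.+ 1ℤ))) ((p ==P (a , b ℤ.+ 1ℤ)) ∧ (q ==P (a ℤ.+ 1ℤ , b ℤ.+ 1ℤ))))

any-sym : ∀ p q (T : List Domino) → any (isAxis q p) T ≡ any (isAxis p q) T
any-sym p q [] = refl
any-sym p q (d ∷ T) = cong₂ _∨_ (isAxis-sym p q d) (any-sym p q T)

χ-sym : ∀ T v w → χ T w v ≡ χ T v w
χ-sym T (p , t) (q , u) = cong indicator (any-sym p q T)

gT-skew : ∀ {F} T eqf → IsEquilibrium F eqf → ∀ {v w} → Arc F v w → gT T eqf w v ≡ - gT T eqf v w
gT-skew {F} T eqf eqp {v} {w} a =
  trans (cong₂ (λ e s → e - s ℤ.+ ℤ.+ 2 * s * (1ℤ - ℤ.+ 2 * χ T w v)) (IsEquilibrium.skew eqp v w a) (sp-skew {v} {w} (Arc⇒UnitStep {F} {v} {w} a)))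
  (trans (cong (λ c → - eqf v w - - sp v w ℤ.+ ℤ.+ 2 * - sp v w * (1ℤ - ℤ.+ 2 * c)) (χ-sym T v w))
         (lem (eqf v w) (sp v w) (χ T v w)))
  where
  lem : ∀ e s c → - e - - s ℤ.+ ℤ.+ 2 * - s * (1ℤ - ℤ.+ 2 * c) ≡ - (e - s ℤ.+ ℤ.+ 2 * s * (1ℤ - ℤ.+ 2 * c))
  lem = solve-∀

gT-form : ∀ T eqf v w → gT T eqf v w ≡ eqf v w ℤ.+ sp v w - ℤ.+ 4 * (sp v w * χ T v w)
gT-form T eqf v w = lem (eqf v w) (sp v w) (χ T v w)
  where
  lem : ∀ e s c → e - s ℤ.+ ℤ.+ 2 * s * (1ℤ - ℤ.+ 2 * c) ≡ e ℤ.+ s - ℤ.+ 4 * (s * c)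
  lem = solve-∀

reverseVtx : List Vtx → List Vtx
reverseVtx [] = []
reverseVtx (x ∷ xs) = reverseVtx xs ++ x ∷ []

lastOr-snoc : ∀ z zs w → lastOr z (zs ++ w ∷ []) ≡ w
lastOr-snoc z [] w = refl
lastOr-snoc z (z' ∷ zs) w = lastOr-snoc z' zs w

reverseVtx-shape : ∀ v vs → Σ Vtx λ y → Σ (List Vtx) λ ys → (reverseVtx (v ∷ vs) ≡ y ∷ ys) × (y ≡ lastOr v vs) × (lastOr y ys ≡ v)
reverseVtx-shape v [] = v , [] , refl , refl , refl
reverseVtx-shape v (w ∷ ws) with reverseVtx-shape w ws
... | y , ys , e , e1 , e2 = y , ys ++ v ∷ [] , cong (_++ v ∷ []) e , e1 , lastOr-snoc y ys v

pathSum-snoc : ∀ (f : Vtx → Vtx → ℤ) y ys v → pathSum f ((y ∷ ys) ++ v ∷ []) ≡ pathSum f (y ∷ ys) ℤ.+ f (lastOr y ys) v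
pathSum-snoc f y [] v = trans (ℤP.+-identityʳ (f y v)) (sym (ℤP.+-identityˡ (f y v)))
pathSum-snoc f y (y' ∷ ys) v rewrite pathSum-snoc f y' ys v = sym (ℤP.+-assoc (f y y') (pathSum f (y' ∷ ys)) (f (lastOr y' ys) v))

pathSum-rev : ∀ (f : Vtx → Vtx → ℤ) v vs → pathSum f (reverseVtx (v ∷ vs)) ≡ pathSum (λ a b → f b a) (v ∷ vs)
pathSum-rev f v [] = refl
pathSum-rev f v (w ∷ ws) with reverseVtx-shape w ws | pathSum-rev f w ws
... | y , ys , e , e1 , e2 | ih =
  trans (cong (λ L → pathSum f (L ++ v ∷ [])) e)
  (trans (pathSum-snoc f y ys v)
  (trans (cong₂ ℤ._+_ (trans (cong (pathSum f) (sym e)) ih) (cong (λ z → f z v) e2))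
         (ℤP.+-comm _ (f w v))))

corner-src : ∀ {p q c} → (p , q) ∈ sides c → p ∈ corners c
corner-src (here refl) = here refl
corner-src (there (here refl)) = there (here refl)
corner-src (there (there (here refl))) = there (here refl)
corner-src (there (there (there (here refl)))) = there (there (here refl))
corner-src (there (there (there (there (here refl))))) = there (there (here refl))
corner-src (there (there (there (there (there (here refl)))))) = there (there (there (here refl)))
corner-src (there (there (there (there (there (there (here refl))))))) = there (there (there (here refl)))
corner-src (there (there (there (there (there (there (there (here refl)))))))) = here refl
corner-src (there (there (there (there (there (there (there (there ()))))))))

vtx-src : ∀ {F v w} → Arc F v w → IsVertex F v
vtx-src (c , cF , s , t1 , t2) = c , cF , corner-src s , t1

path-snoc : ∀ {F} y ys v → IsPath F (y ∷ ys) → Arc F (lastOr y ys) v → IsVertex F v → IsPath F ((y ∷ ys) ++ v ∷ [])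
path-snoc y [] v _ a iv = a , iv
path-snoc y (y' ∷ ys) v (a0 , p) a iv = a0 , path-snoc y' ys v p a iv

path-reverseVtx : ∀ {F} v vs → IsPath F (v ∷ vs) → IsPath F (reverseVtx (v ∷ vs))
path-reverseVtx v [] p = p
path-reverseVtx {F} v (w ∷ ws) (a , p) with reverseVtx-shape w ws | path-reverseVtx {F} w ws p
... | y , ys , e , e1 , e2 | ih =
  subst (λ L → IsPath F (L ++ v ∷ [])) (sym e)
    (path-snoc y ys v (subst (IsPath F) e ih) (subst (λ z → Arc F z v) (sym e2) (Arc-sym {F} {v} {w} a)) (vtx-src {F} {v} {w} a))

closed-reverseVtx : ∀ v vs → Closed (v ∷ vs) → Closed (reverseVtx (v ∷ vs))
closed-reverseVtx v vs cl with reverseVtx-shape v vs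
... | y , ys , e , e1 , e2 = subst Closed (sym e) (trans e2 (trans (sym cl) (sym e1)))

dropLast-snoc' : ∀ L v → dropLast (L ++ v ∷ []) ≡ L
dropLast-snoc' [] v = refl
dropLast-snoc' (x ∷ []) v = refl
dropLast-snoc' (x ∷ y ∷ L) v = cong (x ∷_) (dropLast-snoc' (y ∷ L) v)

∈-reverseVtx : ∀ {z} xs → z ∈ reverseVtx xs → z ∈ xs
∈-reverseVtx (x ∷ xs) m with ∈-++⁻ (reverseVtx xs) m
... | inj₁ m1 = there (∈-reverseVtx xs m1)
... | inj₂ (here refl) = here refl

Unique-reverseVtx : ∀ xs → Unique xs → Unique (reverseVtx xs)
Unique-reverseVtx [] _ = []
Unique-reverseVtx (x ∷ xs) (nx ∷ u) =
  UP.++⁺ (Unique-reverseVtx xs u) ([] ∷ []) λ { (m1 , here refl) → All.lookup nx (∈-reverseVtx xs m1) refl }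

length-++1 : ∀ (L : List Vtx) v → length (L ++ v ∷ []) ≡ suc (length L)
length-++1 [] v = refl
length-++1 (x ∷ L) v = cong suc (length-++1 L v)

length-reverseVtx : ∀ xs → length (reverseVtx xs) ≡ length xs
length-reverseVtx [] = refl
length-reverseVtx (x ∷ xs) = trans (length-++1 (reverseVtx xs) x) (cong suc (length-reverseVtx xs))

length-dropLast : ∀ v vs → length (dropLast (v ∷ vs)) ≡ length vs
length-dropLast v [] = refl
length-dropLast v (w ∷ ws) = cong suc (length-dropLast w ws)

shoelaceStep-flip : ∀ v w → shoelaceStep w v ≡ - shoelaceStep v w
shoelaceStep-flip ((x , y) , t) ((x' , y') , u) = lem x y x' y'
  where
  lem : ∀ x y x' y' → x' * y - x * y' ≡ - (x * y' - x' * y)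
  lem = solve-∀

_≟V_ : (v w : Vtx) → Dec (v ≡ w)
_≟V_ = ≡-dec _≟P_ Boolᴾ._≟_

open DecMem _≟V_ using (_∈?_)

allNot : ∀ {y : Vtx} ys → y ∉ ys → All (y ≢_) ys
allNot [] _ = []
allNot (z ∷ zs) n = (λ e → n (here e)) ∷ allNot zs (λ m → n (there m))

duplicate? : ∀ (xs : List Vtx) → Unique xs ⊎ Σ (List Vtx) λ A → Σ Vtx λ x → Σ (List Vtx) λ B → Σ (List Vtx) λ D → xs ≡ A ++ x ∷ B ++ x ∷ D
duplicate? [] = inj₁ []
duplicate? (y ∷ ys) with y ∈? ys
... | yes m with ∈-∃++ m
...   | B , D , refl = inj₂ ([] , y , B , D , refl)
duplicate? (y ∷ ys) | no nm with duplicate? ys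
... | inj₁ u = inj₁ (allNot ys nm ∷ u)
... | inj₂ (A , x , B , D , refl) = inj₂ (y ∷ A , x , B , D , refl)

pathSum-++ : ∀ (f : Vtx → Vtx → ℤ) A x R → pathSum f (A ++ x ∷ R) ≡ pathSum f (A ++ x ∷ []) ℤ.+ pathSum f (x ∷ R)
pathSum-++ f [] x R = sym (ℤP.+-identityˡ _)
pathSum-++ f (a ∷ []) x R = cong (ℤ._+ pathSum f (x ∷ R)) (sym (ℤP.+-identityʳ (f a x)))
pathSum-++ f (a ∷ b ∷ A) x R rewrite pathSum-++ f (b ∷ A) x R =
  sym (ℤP.+-assoc (f a b) (pathSum f ((b ∷ A) ++ x ∷ [])) (pathSum f (x ∷ R)))

head-vtx : ∀ {F} x R → IsPath F (x ∷ R) → IsVertex F x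
head-vtx x [] p = p
head-vtx {F} x (r ∷ R) (a , _) = vtx-src {F} {x} {r} a

path-split : ∀ {F} A x R → IsPath F (A ++ x ∷ R) → IsPath F (A ++ x ∷ []) × IsPath F (x ∷ R)
path-split [] x R p = head-vtx x R p , p
path-split (a ∷ []) x R (arc , p) = (arc , head-vtx x R p) , p
path-split (a ∷ b ∷ A) x R (arc , p) with path-split (b ∷ A) x R p
... | p1 , p2 = (arc , p1) , p2

path-join : ∀ {F} A x R → IsPath F (A ++ x ∷ []) → IsPath F (x ∷ R) → IsPath F (A ++ x ∷ R)
path-join [] x R _ p = p
path-join (a ∷ []) x R (arc , _) p = arc , p
path-join (a ∷ b ∷ A) x R (arc , p') p = arc , path-join (b ∷ A) x R p' p

lastOr-app : ∀ a A x R → lastOr a (A ++ x ∷ R) ≡ lastOr x R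
lastOr-app a [] x R = refl
lastOr-app a (b ∷ A) x R = lastOr-app b A x R

closed-app : ∀ A x R R' → lastOr x R ≡ lastOr x R' → Closed (A ++ x ∷ R') → Closed (A ++ x ∷ R)
closed-app [] x R R' e cl = trans e cl
closed-app (a ∷ A) x R R' e cl = trans (lastOr-app a A x R) (trans e (trans (sym (lastOr-app a A x R')) cl))

pathSum-flip : ∀ {F} (g : Vtx → Vtx → ℤ) → (∀ {v w} → Arc F v w → g w v ≡ - g v w) →
  ∀ C → AllSteps (Arc F) C → pathSum (flip g) C ≡ - pathSum g C
pathSum-flip g skew C arcs = trans (pathSum-cong (flip g) (λ a b → - g a b) skew C arcs) (pathSum-neg g C)

shoelace-reverse : ∀ C → pathSum shoelaceStep (reverseVtx C) ≡ - pathSum shoelaceStep C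
shoelace-reverse [] = refl
shoelace-reverse (v ∷ vs) =
  trans (pathSum-rev shoelaceStep v vs)
        (trans (pathSum-ext (flip shoelaceStep) (λ a b → - shoelaceStep a b) shoelaceStep-flip (v ∷ vs))
               (pathSum-neg shoelaceStep (v ∷ vs)))

counterclockwise-reverse : ∀ C → 0ℤ ℤ.< pathSum shoelaceStep C → IsClockwise (reverseVtx C)
counterclockwise-reverse C ccw = subst (ℤ._< 0ℤ) (sym (shoelace-reverse C)) (ℤP.neg-mono-< ccw)

elementary-reverse : ∀ {F} C → IsElementaryCycle F C → IsElementaryCycle F (reverseVtx C)
elementary-reverse {F} (v ∷ vs) ((path , cl) , u) with reverseVtx-shape v vs
... | y , ys , e , _ , _ =
  subst (IsElementaryCycle F) (sym e)
    ((subst (IsPath F) e (path-reverseVtx v vs path) , subst Closed e (closed-reverseVtx v vs cl)) ,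
     subst Unique (sym dropLast-reversed) (Unique-reverseVtx vs (Unique-tail (v ∷ vs) cl u)))
  where
  dropLast-reversed : dropLast (y ∷ ys) ≡ reverseVtx vs
  dropLast-reversed = trans (cong dropLast (sym e)) (dropLast-snoc' (reverseVtx vs) v)

Arc⇒≢ : ∀ {F v w} → Arc F v w → proj₁ w ≢ proj₁ v
Arc⇒≢ {F} {v} {w} a e with Arc⇒UnitStep {F} {v} {w} a
... | d , moved = move-≢ d (proj₁ v) (trans (sym moved) e)

clockwise⇒long : ∀ {F} C → IsElementaryCycle F C → IsClockwise C → 3 ℕ.≤ length (dropLast C)
clockwise⇒long (v ∷ []) _ cw = ⊥-elim (ℤP.<-irrefl refl cw)
clockwise⇒long {F} (v ∷ w ∷ []) (((a , _) , cl) , _) _ = ⊥-elim (Arc⇒≢ {F} a (cong proj₁ cl))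
clockwise⇒long (v ∷ w ∷ x ∷ []) ((_ , refl) , _) cw =
  ⊥-elim (ℤP.<-irrefl back-and-forth cw)
  where
  back-and-forth : shoelaceStep v w ℤ.+ (shoelaceStep w v ℤ.+ 0ℤ) ≡ 0ℤ
  back-and-forth = trans (cong (λ z → shoelaceStep v w ℤ.+ (z ℤ.+ 0ℤ)) (shoelaceStep-flip v w)) (lem (shoelaceStep v w))
    where
    lem : ∀ a → a ℤ.+ (- a ℤ.+ 0ℤ) ≡ 0ℤ
    lem = solve-∀
clockwise⇒long (v ∷ w ∷ x ∷ y ∷ rest) _ _ = s≤s (s≤s (s≤s z≤n))

-- Reduction to elementary clockwise cycles

module _ {F : Figure} (g : Vtx → Vtx → ℤ) where

  elementary-sum-zero : (∀ {v w} → Arc F v w → g w v ≡ - g v w) →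
    (∀ C → IsElementaryCycle F C → IsClockwise C → pathSum g C ≡ 0ℤ) →
    ∀ C → IsElementaryCycle F C → pathSum g C ≡ 0ℤ
  elementary-sum-zero skew clockwise (v ∷ []) _ = refl
  elementary-sum-zero skew clockwise (v ∷ w ∷ []) (((a , _) , cl) , _) = ⊥-elim (Arc⇒≢ {F} a (cong proj₁ cl))
  elementary-sum-zero skew clockwise (v ∷ w ∷ x ∷ []) (((a , _) , refl) , _) =
    trans (cong (λ z → g v w ℤ.+ (z ℤ.+ 0ℤ)) (skew a)) (lem (g v w))
    where
    lem : ∀ a → a ℤ.+ (- a ℤ.+ 0ℤ) ≡ 0ℤ
    lem = solve-∀
  elementary-sum-zero skew clockwise C@(v ∷ vs@(_ ∷ _ ∷ _ ∷ _)) ec@((path , cl) , u)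
    with ℤP.<-cmp (pathSum shoelaceStep C) 0ℤ
  ... | tri< cw _ _ = clockwise C ec cw
  ... | tri≈ _ flat _ = ⊥-elim (CycleOrientation.shoelace≢0 F C path cl u (s≤s (s≤s (s≤s z≤n))) flat)
  ... | tri> _ _ ccw = ℤP.neg-injective (begin
      - pathSum g C                ≡⟨ sym (pathSum-flip {F} g skew C (path⇒AllSteps C path)) ⟩
      pathSum (flip g) C           ≡⟨ sym (pathSum-rev g v vs) ⟩
      pathSum g (reverseVtx C)     ≡⟨ clockwise (reverseVtx C) (elementary-reverse C ec) (counterclockwise-reverse C ccw) ⟩
      0ℤ                           ∎)
    where open ≡-Reasoning

  pathSum-split : ∀ A x B E → pathSum g (A ++ x ∷ (B ++ x ∷ E)) ≡
                  pathSum g (A ++ x ∷ E) ℤ.+ pathSum g (x ∷ (B ++ x ∷ []))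
  pathSum-split A x B E =
    trans (pathSum-++ g A x (B ++ x ∷ E))
    (trans (cong (λ z → pathSum g (A ++ x ∷ []) ℤ.+ z) (pathSum-++ g (x ∷ B) x E))
    (trans (lem (pathSum g (A ++ x ∷ [])) (pathSum g (x ∷ (B ++ x ∷ []))) (pathSum g (x ∷ E)))
           (cong (ℤ._+ pathSum g (x ∷ (B ++ x ∷ []))) (sym (pathSum-++ g A x E)))))
    where
    lem : ∀ a b c → a ℤ.+ (b ℤ.+ c) ≡ a ℤ.+ c ℤ.+ b
    lem = solve-∀

  cycle-sum-zero-bounded : (∀ C → IsElementaryCycle F C → pathSum g C ≡ 0ℤ) →
    ∀ n C → length C ℕ.≤ n → IsPath F C → Closed C → pathSum g C ≡ 0ℤ
  cycle-sum-zero-bounded elementary zero (v ∷ vs) () _ _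
  cycle-sum-zero-bounded elementary (suc n) (v ∷ vs) le p cl with duplicate? (dropLast (v ∷ vs))
  ... | inj₁ u = elementary (v ∷ vs) ((p , cl) , u)
  ... | inj₂ (A , x , B , D , e) =
    subst (λ L → pathSum g L ≡ 0ℤ) (sym Ceq)
      (trans (pathSum-split A x B E) (cong₂ ℤ._+_ (recurse (A ++ x ∷ E) len1 path1 clo1)
                                                  (recurse (x ∷ (B ++ x ∷ [])) len2 path2 clo2)))
    where
    recurse = cycle-sum-zero-bounded elementary n
    ℓ = lastOr v vs
    E = D ++ ℓ ∷ []
    Ceq : v ∷ vs ≡ A ++ x ∷ (B ++ x ∷ E)
    Ceq = trans (dropLast-++-lastOr v vs)
          (trans (cong (_++ ℓ ∷ []) e)
          (trans (++-assoc A (x ∷ B ++ x ∷ D) (ℓ ∷ []))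
                 (cong (λ L → A ++ x ∷ L) (++-assoc B (x ∷ D) (ℓ ∷ [])))))
    split₁ = path-split A x (B ++ x ∷ E) (subst (IsPath F) Ceq p)
    split₂ = path-split (x ∷ B) x E (proj₂ split₁)
    path1 : IsPath F (A ++ x ∷ E)
    path1 = path-join A x E (proj₁ split₁) (proj₂ split₂)
    path2 : IsPath F (x ∷ (B ++ x ∷ []))
    path2 = proj₁ split₂
    clo1 : Closed (A ++ x ∷ E)
    clo1 = closed-app A x E (B ++ x ∷ E) (sym (lastOr-app x B x E)) (subst Closed Ceq cl)
    clo2 : Closed (x ∷ (B ++ x ∷ []))
    clo2 = lastOr-app x B x []
    a = length A
    b = length B
    c = length E
    c≥1 : 1 ℕ.≤ c
    c≥1 = subst (1 ℕ.≤_) (sym (trans (length-++ D) (ℕP.+-comm (length D) 1))) (s≤s z≤n)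
    le' : a ℕ.+ suc (b ℕ.+ suc c) ℕ.≤ suc n
    le' = subst (ℕ._≤ suc n) (trans (cong length Ceq) (trans (length-++ A) (cong (λ z → a ℕ.+ suc z) (length-++ B)))) le
    len1 : length (A ++ x ∷ E) ℕ.≤ n
    len1 = ℕP.≤-pred (ℕP.≤-trans (subst (ℕ._< a ℕ.+ suc (b ℕ.+ suc c)) (sym (length-++ A {x ∷ E}))
             (ℕP.+-monoʳ-< a (s≤s (ℕP.≤-trans (ℕP.n<1+n c) (ℕP.m≤n+m (suc c) b))))) le')
    len2 : length (x ∷ (B ++ x ∷ [])) ℕ.≤ n
    len2 = ℕP.≤-pred (ℕP.≤-trans (subst (ℕ._< a ℕ.+ suc (b ℕ.+ suc c)) (sym (cong suc (length-++ B {x ∷ []})))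
             (ℕP.<-≤-trans (s≤s (ℕP.+-monoʳ-< b (s≤s c≥1))) (ℕP.m≤n+m _ a))) le')

  cycle-sum-zero : (∀ C → IsElementaryCycle F C → pathSum g C ≡ 0ℤ) →
    ∀ C → IsCycle F C → pathSum g C ≡ 0ℤ
  cycle-sum-zero elementary (v ∷ vs) (p , cl) =
    cycle-sum-zero-bounded elementary (length (v ∷ vs)) (v ∷ vs) ℕP.≤-refl p cl

pathSum-gT : ∀ T eqf C →
  pathSum (gT T eqf) C ≡ pathSum eqf C ℤ.+ pathSum sp C - ℤ.+ 4 * pathSum (λ a b → sp a b * χ T a b) C
pathSum-gT T eqf C =
  trans (pathSum-ext (gT T eqf) (λ a b → eqf a b ℤ.+ sp a b - ℤ.+ 4 * (sp a b * χ T a b)) (gT-form T eqf) C)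
  (trans (pathSum-- (λ a b → eqf a b ℤ.+ sp a b) (λ a b → ℤ.+ 4 * (sp a b * χ T a b)) C)
         (cong₂ _-_ (pathSum-+ eqf sp C) (pathSum-*ˡ (ℤ.+ 4) (λ a b → sp a b * χ T a b) C)))

Dis-clockwise : ∀ F C → IsElementaryCycle F C → IsClockwise C →
  Dis F C ≡ - sumCells (λ c → winding C c * colourSign c) (cells F)
Dis-clockwise F C@(_ ∷ _) ec@((path , cl) , u) cw =
  trans (sumCells-cong (cells F) enclosed) (sumCells-neg (λ c → winding C c * colourSign c) (cells F))
  where
  open CycleOrientation F C path cl u (clockwise⇒long C ec cw) using (clockwise⇒winding∈0-1)
  enclosed : ∀ c → (if winding C c == 0ℤ then 0ℤ else colourSign c) ≡ - (winding C c * colourSign c)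
  enclosed c with clockwise⇒winding∈0-1 cw c
  ... | inj₁ w≡0 rewrite w≡0 = sym (cong -_ (ℤP.*-zeroˡ (colourSign c)))
  ... | inj₂ w≡-1 rewrite w≡-1 = lem (colourSign c)
    where
    lem : ∀ k → k ≡ - (- 1ℤ * k)
    lem = solve-∀

spinχ-clockwise : ∀ F T → IsTiling F T → ∀ C → IsElementaryCycle F C → IsClockwise C →
  pathSum (λ a b → sp a b * χ T a b) C ≡ Dis F C
spinχ-clockwise F T til C@(_ ∷ _) ec@((path , cl) , _) cw = begin
    spχ                   ≡⟨ sym (lem W spχ) ⟩
    - W ℤ.+ (W ℤ.+ spχ)   ≡⟨ cong (λ z → - W ℤ.+ z) (Tiled.tiling-balance F T til C cl (AllSteps-map (λ {v} {w} → Arc⇒UnitStep {F} {v} {w}) C (path⇒AllSteps C path))) ⟩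
    - W ℤ.+ 0ℤ            ≡⟨ ℤP.+-identityʳ (- W) ⟩
    - W                   ≡⟨ sym (Dis-clockwise F C ec cw) ⟩
    Dis F C               ∎
  where
  open ≡-Reasoning
  W = sumCells (λ c → winding C c * colourSign c) (cells F)
  spχ = pathSum (λ a b → sp a b * χ T a b) C
  lem : ∀ a b → - a ℤ.+ (a ℤ.+ b) ≡ b
  lem = solve-∀

pathSum-gT-clockwise : ∀ F eqf → IsEquilibrium F eqf → ∀ T → IsTiling F T →
  ∀ C → IsElementaryCycle F C → IsClockwise C → pathSum (gT T eqf) C ≡ 0ℤ
pathSum-gT-clockwise F eqf eqp T til C ec cw = begin
    pathSum (gT T eqf) C
      ≡⟨ pathSum-gT T eqf C ⟩
    pathSum eqf C ℤ.+ pathSum sp C - ℤ.+ 4 * pathSum (λ a b → sp a b * χ T a b) C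
      ≡⟨ cong₂ (λ s d → s - ℤ.+ 4 * d) (ℤP.+-comm (pathSum eqf C) (pathSum sp C)) (spinχ-clockwise F T til C ec cw) ⟩
    pathSum sp C ℤ.+ pathSum eqf C - ℤ.+ 4 * Dis F C
      ≡⟨ cong (_- ℤ.+ 4 * Dis F C) (IsEquilibrium.balance eqp C ec cw) ⟩
    ℤ.+ 4 * Dis F C - ℤ.+ 4 * Dis F C
      ≡⟨ ℤP.+-inverseʳ (ℤ.+ 4 * Dis F C) ⟩
    0ℤ ∎
  where open ≡-Reasoning

mainTheorem1 : (F : Figure) (eqf : Vtx → Vtx → ℤ) → IsEquilibrium F eqf →
    (T : List Domino) → IsTiling F T →
    (C : List Vtx) → IsCycle F C → pathSum (gT T eqf) C ≡ 0ℤ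
mainTheorem1 F eqf eqp T til =
  cycle-sum-zero (gT T eqf)
    (elementary-sum-zero (gT T eqf) (gT-skew T eqf eqp) (pathSum-gT-clockwise F eqf eqp T til))
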